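{- For any $c\in\mathbb{N}$, there exists a planar graph $G$ such that for any tree-partition $\mathcal{P}$ of $G$ and any partition $\mathcal{Q}$ of $G$ with $|P\cap Q|\leq c$ for each $P\in\mathcal{P}$ and $Q\in\mathcal{Q}$, there is a $4$-clique $\{v_1,v_2,v_3,v_4\}$ in $G$ such that the parts $Q_1,Q_2,Q_3,Q_4$ of $\mathcal{Q}$ containing $v_1,v_2,v_3,v_4$ respectively are pairwise distinct.
   Context: All graphs are finite, simple and undirected. A partition $\mathcal{P}$ of a graph $G$ is a partition of $V(G)$ into parts. $G/\mathcal{P}$ is the graph whose vertices are the non-empty parts of $\mathcal{P}$, with distinct parts $P_1,P_2$ adjacent iff some $v_1\in P_1$, $v_2\in P_2$ satisfy $v_1v_2\in E(G)$. $\mathcal{P}$ is a tree-partition if $G/\mathcal{P}$ is isomorphic to a subgraph of a tree. -}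

module Defs where

open import Data.Nat using (ℕ; zero; suc; _≤_; _<_; _≟_)
open import Data.Integer as ℤ using (ℤ; +_)
open import Data.Fin using (Fin; zero; suc; inject₁; fromℕ)
open import Data.Fin.Properties using () renaming (_≟_ to _≟ᶠ_)
open import Data.Product using (Σ; ∃; ∃-syntax; _×_; _,_)
open import Data.Bool using (Bool; true; false)
open import Data.List using (List; length; filter; allFin)
open import Relation.Nullary using (¬_)
open import Relation.Nullary.Decidable using (_×-dec_)
open import Relation.Binary.PropositionalEquality using (_≡_; _≢_)
open import Function.Bundles using (_⇔_)
open import Function.Definitions using (Injective)

record Graph : Set where
  field
    n      : ℕ
    adj    : Fin n → Fin n → Bool
    sym    : ∀ u v → adj u v ≡ adj v u
    irrefl : ∀ v → adj v v ≡ false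

open Graph public

Adj : (G : Graph) → Fin (n G) → Fin (n G) → Set
Adj G u v = adj G u v ≡ true

data Walk (G : Graph) : Fin (n G) → Fin (n G) → Set where
  here : ∀ {v} → Walk G v v
  step : ∀ {u w v} → Adj G u w → Walk G w v → Walk G u v

Connected : Graph → Set
Connected G = ∀ u v → Walk G u v

-- A cycle of length k+3: injective cyclic sequence of vertices,
-- consecutive ones adjacent (including last–first).
record Cycle (G : Graph) : Set where
  field
    k      : ℕ
    vtx    : Fin (suc (suc (suc k))) → Fin (n G)
    inj    : Injective _≡_ _≡_ vtx
    consec : ∀ (i : Fin (suc (suc k))) → Adj G (vtx (inject₁ i)) (vtx (suc i))
    close  : Adj G (vtx (fromℕ (suc (suc k)))) (vtx zero)

IsTree : Graph → Set
IsTree G = (1 ≤ n G) × Connected G × ¬ Cycle G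

-- Partitions of V(G) are given by labellings p : Fin n → ℕ;
-- the parts are the non-empty fibres of p.

Partition : Graph → Set
Partition G = Fin (n G) → ℕ

-- G / P is isomorphic to a subgraph of a tree T: there is a map f from
-- V(G) to V(T) identifying exactly the vertices in the same part
-- (i.e. an injection of the parts into V(T)), such that adjacent
-- distinct parts are sent to adjacent vertices of T.
IsTreePartition : (G : Graph) → Partition G → Set
IsTreePartition G p =
  Σ Graph λ T → IsTree T ×
    Σ (Fin (n G) → Fin (n T)) λ f →
      (∀ u v → (f u ≡ f v) ⇔ (p u ≡ p v)) ×
      (∀ u v → Adj G u v → p u ≢ p v → Adj T (f u) (f v))

meetSize : (G : Graph) → Partition G → Partition G → ℕ → ℕ → ℕ
meetSize G p q a b =
  length (filter (λ v → (p v ≟ a) ×-dec (q v ≟ b)) (allFin (n G)))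

-- Planarity, via straight-line drawings on the integer grid
-- (equivalent to planarity by Fáry's theorem + de Fraysseix–Pach–Pollack).

Point : Set
Point = ℤ × ℤ

OnSeg : Point → Point → Point → Set
OnSeg (px , py) (qx , qy) (wx , wy) =
  ∃[ d ] ∃[ a ] (0 < d) × (a ≤ d) ×
    (+ d ℤ.* wx ≡ + d ℤ.* px ℤ.+ + a ℤ.* (qx ℤ.- px)) ×
    (+ d ℤ.* wy ≡ + d ℤ.* py ℤ.+ + a ℤ.* (qy ℤ.- py))

SegsMeet : Point → Point → Point → Point → Set
SegsMeet (px , py) (qx , qy) (rx , ry) (sx , sy) =
  ∃[ d ] ∃[ a ] ∃[ b ] (0 < d) × (a ≤ d) × (b ≤ d) ×
    (+ d ℤ.* px ℤ.+ + a ℤ.* (qx ℤ.- px) ≡ + d ℤ.* rx ℤ.+ + b ℤ.* (sx ℤ.- rx)) ×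
    (+ d ℤ.* py ℤ.+ + a ℤ.* (qy ℤ.- py) ≡ + d ℤ.* ry ℤ.+ + b ℤ.* (sy ℤ.- ry))

-- A straight-line plane drawing: distinct vertices at distinct points,
-- no vertex on an edge not incident to it, and edges with no common
-- endpoint disjoint (edges sharing an endpoint then meet only there).
IsPlaneDrawing : (G : Graph) → (Fin (n G) → Point) → Set
IsPlaneDrawing G pos =
  Injective _≡_ _≡_ pos ×
  (∀ u v w → Adj G u v → w ≢ u → w ≢ v → ¬ OnSeg (pos u) (pos v) (pos w)) ×
  (∀ u v x y → Adj G u v → Adj G x y →
     u ≢ x → u ≢ y → v ≢ x → v ≢ y →
     ¬ SegsMeet (pos u) (pos v) (pos x) (pos y))

Planar : Graph → Set
Planar G = Σ (Fin (n G) → Point) (IsPlaneDrawing G)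

module Submission where

-- G is the depth-3 fan (see Fan) on a path of L = (4c + 1)(2c + 1) edges, with hubs u and v; it has an
-- explicit nested straight-line drawing on the integer grid.
--
-- In a tree-partition P, a triangle meets at most two parts. So if u and v lie in different parts of
-- both P and Q, the whole path lies in the two P-parts of u and v; since a P-part meets a Q-part in at
-- most c vertices, some block of 2c + 1 consecutive path vertices avoids the Q-parts of u and v and is
-- not Q-monochromatic, giving a path edge p p' with u, v, p, p' in four Q-parts, a rainbow K₄.
-- Otherwise the same counting finds a path vertex p separated from u (or v) by P or Q, and one descends
-- into the child fan glued on u p (or v p); three levels suffice.

open import Defs hiding (sym)
open import Data.Nat using (ℕ; suc; _≤_)
open import Data.Fin using (Fin; zero; suc; inject₁)
import Data.Fin.Properties as FP
open import Data.Product using (Σ; ∃-syntax; _×_; _,_)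
open import Data.Empty using (⊥-elim)
open import Relation.Binary.PropositionalEquality using (_≡_; _≢_; refl; sym; trans)

module Sign where

  open import Data.Nat as ℕ using (ℕ; suc)
  open import Data.Integer using (ℤ; +_; _+_; _*_; -_; 0ℤ)
  import Data.Integer.Properties as ℤP
  open import Data.Integer.Tactic.RingSolver
  open import Data.Product using (Σ; _,_)
  open import Data.Sum using (_⊎_; inj₁; inj₂)
  open import Relation.Nullary using (¬_)
  open import Relation.Binary.PropositionalEquality

  Neg NonNeg Pos NonPos : ℤ → Set
  Neg x = Σ ℕ λ m → x ≡ - + suc m
  NonNeg x = Σ ℕ λ m → x ≡ + m
  Pos x = Σ ℕ λ m → x ≡ + suc m
  NonPos x = Σ ℕ λ m → x ≡ - + m

  Neg⇒¬NonNeg : ∀ {x} → Neg x → ¬ NonNeg x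
  Neg⇒¬NonNeg (m , refl) (k , ())

  Neg⇒≢0 : ∀ {x} → Neg x → x ≢ 0ℤ
  Neg⇒≢0 (m , refl) ()

  Pos⇒NonNeg : ∀ {x} → Pos x → NonNeg x
  Pos⇒NonNeg (m , e) = suc m , e

  Neg⇒NonPos : ∀ {x} → Neg x → NonPos x
  Neg⇒NonPos (m , e) = suc m , e

  ≡0⇒NonNeg : ∀ {x} → x ≡ 0ℤ → NonNeg x
  ≡0⇒NonNeg refl = 0 , refl

  ≡0⇒NonPos : ∀ {x} → x ≡ 0ℤ → NonPos x
  ≡0⇒NonPos refl = 0 , refl

  Pos⇒-Neg : ∀ {x} → Pos x → Neg (- x)
  Pos⇒-Neg (m , refl) = m , refl

  Neg⇒-Pos : ∀ {x} → Neg x → Pos (- x)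
  Neg⇒-Pos (m , refl) = m , refl

  private
    *-neg : ∀ (a m : ℤ) → a * (- m) ≡ - (a * m)
    *-neg = solve-∀
    neg-+ : ∀ (x y : ℤ) → - x + - y ≡ - (x + y)
    neg-+ = solve-∀

  *-NonNeg : ∀ a {e} → NonNeg e → NonNeg (+ a * e)
  *-NonNeg a (m , refl) = a ℕ.* m , sym (ℤP.pos-* a m)

  *-NonPos : ∀ a {e} → NonPos e → NonPos (+ a * e)
  *-NonPos a (m , refl) = a ℕ.* m , trans (*-neg (+ a) (+ m)) (cong -_ (sym (ℤP.pos-* a m)))

  *-Pos : ∀ {a e} → 0 ℕ.< a → Pos e → Pos (+ a * e)
  *-Pos {suc a} _ (m , refl) = m ℕ.+ a ℕ.* suc m , sym (ℤP.pos-* (suc a) (suc m))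

  *-Neg : ∀ {a e} → 0 ℕ.< a → Neg e → Neg (+ a * e)
  *-Neg {suc a} _ (m , refl) = m ℕ.+ a ℕ.* suc m , trans (*-neg (+ suc a) (+ suc m))
    (cong -_ (sym (ℤP.pos-* (suc a) (suc m))))

  +-NonNeg : ∀ {x y} → NonNeg x → NonNeg y → NonNeg (x + y)
  +-NonNeg (m , refl) (n , refl) = m ℕ.+ n , sym (ℤP.pos-+ m n)

  +-Pos-NonNeg : ∀ {x y} → Pos x → NonNeg y → Pos (x + y)
  +-Pos-NonNeg (m , refl) (n , refl) = m ℕ.+ n , sym (ℤP.pos-+ (suc m) n)

  +-NonNeg-Pos : ∀ {x y} → NonNeg x → Pos y → Pos (x + y)
  +-NonNeg-Pos {x} {y} p q = subst Pos (ℤP.+-comm y x) (+-Pos-NonNeg q p)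

  +-NonPos : ∀ {x y} → NonPos x → NonPos y → NonPos (x + y)
  +-NonPos (m , refl) (n , refl) = m ℕ.+ n , trans (neg-+ (+ m) (+ n)) (cong -_ (sym (ℤP.pos-+ m n)))

  +-Neg-NonPos : ∀ {x y} → Neg x → NonPos y → Neg (x + y)
  +-Neg-NonPos (m , refl) (n , refl) = m ℕ.+ n , trans (neg-+ (+ suc m) (+ n)) (cong -_ (sym (ℤP.pos-+ (suc m) n)))

  +-NonPos-Neg : ∀ {x y} → NonPos x → Neg y → Neg (x + y)
  +-NonPos-Neg {x} {y} p q = subst Neg (ℤP.+-comm y x) (+-Neg-NonPos q p)

  comb₃-Pos : ∀ {a b c e₀ e₁ e₂} → 0 ℕ.< a → 0 ℕ.< b → 0 ℕ.< c → NonNeg e₀ → NonNeg e₁ → NonNeg e₂ →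
    (Pos e₀ ⊎ Pos e₁ ⊎ Pos e₂) → Pos (+ a * e₀ + + b * e₁ + + c * e₂)
  comb₃-Pos {a} {b} {c} pa pb pc n₀ n₁ n₂ (inj₁ p) = +-Pos-NonNeg (+-Pos-NonNeg (*-Pos pa p) (*-NonNeg b n₁))
    (*-NonNeg c n₂)
  comb₃-Pos {a} {b} {c} pa pb pc n₀ n₁ n₂ (inj₂ (inj₁ p)) = +-Pos-NonNeg (+-NonNeg-Pos (*-NonNeg a n₀) (*-Pos pb p))
    (*-NonNeg c n₂)
  comb₃-Pos {a} {b} {c} pa pb pc n₀ n₁ n₂ (inj₂ (inj₂ p)) = +-NonNeg-Pos (+-NonNeg (*-NonNeg a n₀) (*-NonNeg b n₁))
    (*-Pos pc p)

  comb₃-Neg : ∀ {a b c e₀ e₁ e₂} → 0 ℕ.< a → 0 ℕ.< b → 0 ℕ.< c → NonPos e₀ → NonPos e₁ → NonPos e₂ →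
    (Neg e₀ ⊎ Neg e₁ ⊎ Neg e₂) → Neg (+ a * e₀ + + b * e₁ + + c * e₂)
  comb₃-Neg {a} {b} {c} pa pb pc n₀ n₁ n₂ (inj₁ p) = +-Neg-NonPos (+-Neg-NonPos (*-Neg pa p) (*-NonPos b n₁))
    (*-NonPos c n₂)
  comb₃-Neg {a} {b} {c} pa pb pc n₀ n₁ n₂ (inj₂ (inj₁ p)) = +-Neg-NonPos (+-NonPos-Neg (*-NonPos a n₀) (*-Neg pb p))
    (*-NonPos c n₂)
  comb₃-Neg {a} {b} {c} pa pb pc n₀ n₁ n₂ (inj₂ (inj₂ p)) = +-NonPos-Neg (+-NonPos (*-NonPos a n₀) (*-NonPos b n₁))
    (*-Neg pc p)

module Separation where

  open import Data.Nat as ℕ using (ℕ; zero; suc; z≤n; s≤s)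
  import Data.Nat.Properties as ℕP
  open import Data.Integer using (ℤ; +_; _+_; _*_; _-_; -_; 0ℤ)
  import Data.Integer.Properties as ℤP
  open import Data.Integer.Tactic.RingSolver
  open import Algebra.Properties.AbelianGroup ℤP.+-0-abelianGroup using (∙-cancelʳ)
  open import Data.Product using (Σ; _×_; _,_; proj₁; proj₂)
  open import Data.Sum using (inj₁; inj₂)
  open import Data.Empty using (⊥-elim)
  open import Relation.Nullary using (¬_)
  open import Relation.Binary.PropositionalEquality

  open Sign

  private
    +-comb : ∀ e a m₁ m₂ → + e * + m₁ + + a * + m₂ ≡ + (e ℕ.* m₁ ℕ.+ a ℕ.* m₂)
    +-comb e a m₁ m₂ =
      trans (cong₂ _+_ (sym (ℤP.pos-* e m₁)) (sym (ℤP.pos-* a m₂))) (sym (ℤP.pos-+ (e ℕ.* m₁) (a ℕ.* m₂)))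

    suc-comb : ∀ e a m₁ m₂ → 0 ℕ.< e ℕ.+ a → Σ ℕ λ z → e ℕ.* suc m₁ ℕ.+ a ℕ.* suc m₂ ≡ suc z
    suc-comb (suc e) a m₁ m₂ _ = _ , refl
    suc-comb zero (suc a) m₁ m₂ _ = _ , refl

  Neg-comb : ∀ e a {x y} → 0 ℕ.< e ℕ.+ a → Neg x → Neg y → Neg (+ e * x + + a * y)
  Neg-comb e a p (m₁ , refl) (m₂ , refl) with suc-comb e a m₁ m₂ p
  ... | z , eq = z , trans (neg-comb (+ e) (+ a) (+ suc m₁) (+ suc m₂))
                       (cong -_ (trans (+-comb e a (suc m₁) (suc m₂)) (cong +_ eq)))
    where
    neg-comb : ∀ (e a m₁ m₂ : ℤ) → e * (- m₁) + a * (- m₂) ≡ - (e * m₁ + a * m₂)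
    neg-comb = solve-∀

  NonNeg-comb : ∀ e a {x y} → NonNeg x → NonNeg y → NonNeg (+ e * x + + a * y)
  NonNeg-comb e a (m₁ , refl) (m₂ , refl) = _ , +-comb e a m₁ m₂

  NonNeg-comb⇒weight≡0 : ∀ e a {y} → Neg y → NonNeg (+ e * 0ℤ + + a * y) → a ≡ 0
  NonNeg-comb⇒weight≡0 e zero ny nn = refl
  NonNeg-comb⇒weight≡0 e (suc a) {y} ny nn =
    ⊥-elim (Neg⇒¬NonNeg (subst Neg (cong (_+ + suc a * y) (sym (ℤP.*-zeroʳ (+ e))))
                           (Neg-comb 0 (suc a) (s≤s z≤n) (0 , refl) ny)) nn)

  Form : Set
  Form = ℤ × ℤ × ℤ

  eval : Form → Point → ℤ
  eval (A , B , C) (x , y) = A * x + B * y + C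

  private
    pos-∸ : ∀ {d a} → a ℕ.≤ d → + d - + a ≡ + (d ℕ.∸ a)
    pos-∸ {d} {a} le = trans (ℤP.m-n≡m⊖n d a) (ℤP.⊖-≥ le)

    ∸+-pos : ∀ {d a} → a ℕ.≤ d → 0 ℕ.< d → 0 ℕ.< d ℕ.∸ a ℕ.+ a
    ∸+-pos le p rewrite ℕP.m∸n+n≡m le = p

    evalOnSeg : Form → ℕ → ℕ → Point → Point → ℤ
    evalOnSeg (A , B , C) d a (px , py) (qx , qy) =
      A * (+ d * px + + a * (qx - px)) + B * (+ d * py + + a * (qy - py)) + + d * C

    evalOnSeg-convex : ∀ f d a p q → a ℕ.≤ d → evalOnSeg f d a p q ≡ + (d ℕ.∸ a) * eval f p + + a * eval f q
    evalOnSeg-convex (A , B , C) d a (px , py) (qx , qy) le =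
      trans (expand A B C (+ d) (+ a) px py qx qy)
            (cong (λ z → z * (A * px + B * py + C) + + a * (A * qx + B * qy + C)) (pos-∸ le))
      where
      expand : ∀ (A B C D a px py qx qy : ℤ) → A * (D * px + a * (qx - px)) + B * (D * py + a * (qy - py)) + D * C
        ≡ (D - a) * (A * px + B * py + C) + a * (A * qx + B * qy + C)
      expand = solve-∀

    evalOnSeg-point : ∀ (A B C D wx wy : ℤ) → A * (D * wx) + B * (D * wy) + D * C
      ≡ D * (A * wx + B * wy + C) + + 0 * (A * wx + B * wy + C)
    evalOnSeg-point = solve-∀

  ¬SegsMeet-across : ∀ f {p q r s} → Neg (eval f p) → Neg (eval f q) → NonNeg (eval f r) → NonNeg (eval f s) →
    ¬ SegsMeet p q r s
  ¬SegsMeet-across f@(A , B , C) {p} {q} {r} {s} np nq nr ns (d , a , b , d>0 , a≤d , b≤d , ex , ey) =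
    Neg⇒¬NonNeg (subst Neg (sym (evalOnSeg-convex f d a p q a≤d)) (Neg-comb (d ℕ.∸ a) a (∸+-pos a≤d d>0) np nq))
      (subst NonNeg (trans (sym (evalOnSeg-convex f d b r s b≤d)) (sym same)) (NonNeg-comb (d ℕ.∸ b) b nr ns))
    where
    same : evalOnSeg f d a p q ≡ evalOnSeg f d b r s
    same = cong₂ (λ u v → A * u + B * v + + d * C) ex ey

  ¬OnSeg-across : ∀ f {p q w} → NonNeg (eval f p) → NonNeg (eval f q) → Neg (eval f w) → ¬ OnSeg p q w
  ¬OnSeg-across f@(A , B , C) {p} {q} {w@(wx , wy)} np nq nw (d , a , d>0 , a≤d , ex , ey) =
    Neg⇒¬NonNeg (subst Neg (sym at-w) (Neg-comb d 0 (subst (0 ℕ.<_) (sym (ℕP.+-identityʳ d)) d>0) nw nw))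
      (subst NonNeg (sym (evalOnSeg-convex f d a p q a≤d)) (NonNeg-comb (d ℕ.∸ a) a np nq))
    where
    at-w : evalOnSeg f d a p q ≡ + d * eval f w + + 0 * eval f w
    at-w = trans (sym (cong₂ (λ u v → A * u + B * v + + d * C) ex ey)) (evalOnSeg-point A B C (+ d) wx wy)

  ¬OnSeg-across′ : ∀ f {p q w} → Neg (eval f p) → Neg (eval f q) → NonNeg (eval f w) → ¬ OnSeg p q w
  ¬OnSeg-across′ f@(A , B , C) {p} {q} {w@(wx , wy)} np nq nw (d , a , d>0 , a≤d , ex , ey) =
    Neg⇒¬NonNeg (subst Neg (sym (evalOnSeg-convex f d a p q a≤d)) (Neg-comb (d ℕ.∸ a) a (∸+-pos a≤d d>0) np nq))
      (subst NonNeg (sym at-w) (NonNeg-comb d 0 nw nw))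
    where
    at-w : evalOnSeg f d a p q ≡ + d * eval f w + + 0 * eval f w
    at-w = trans (sym (cong₂ (λ u v → A * u + B * v + + d * C) ex ey)) (evalOnSeg-point A B C (+ d) wx wy)

  SegsMeet-touch⇒OnSeg : ∀ f {p q r s} → eval f p ≡ 0ℤ → Neg (eval f q) → NonNeg (eval f r) → NonNeg (eval f s) →
    SegsMeet p q r s → OnSeg r s p
  SegsMeet-touch⇒OnSeg f@(A , B , C) {p@(px , py)} {q@(qx , qy)} {r@(rx , ry)} {s@(sx , sy)} zp nq nr ns
    (d , a , b , d>0 , a≤d , b≤d , ex , ey) = d , b , d>0 , b≤d , at-p px qx ex , at-p py qy ey
    where
    same : evalOnSeg f d a p q ≡ evalOnSeg f d b r s
    same = cong₂ (λ u v → A * u + B * v + + d * C) ex ey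
    a≡0 : a ≡ 0
    a≡0 = NonNeg-comb⇒weight≡0 (d ℕ.∸ a) a nq
            (subst NonNeg (trans (evalOnSeg-convex f d a p q a≤d) (cong (λ z → + (d ℕ.∸ a) * z + + a * eval f q) zp))
              (subst NonNeg (trans (sym (evalOnSeg-convex f d b r s b≤d)) (sym same))
                (NonNeg-comb (d ℕ.∸ b) b nr ns)))
    +0* : ∀ (D px qx : ℤ) → D * px ≡ D * px + 0ℤ * (qx - px)
    +0* = solve-∀
    at-p : ∀ px qx {rhs} → + d * px + + a * (qx - px) ≡ rhs → + d * px ≡ rhs
    at-p px qx e = trans (+0* (+ d) px qx) (trans (cong (λ z → + d * px + + z * (qx - px)) (sym a≡0)) e)

  SegsMeet-swap : ∀ {p q r s} → SegsMeet p q r s → SegsMeet r s p q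
  SegsMeet-swap (d , a , b , d>0 , a≤d , b≤d , ex , ey) = d , b , a , d>0 , b≤d , a≤d , sym ex , sym ey

  private
    reverse-param : ∀ (D a' a px qx : ℤ) → D - a' ≡ a → D * px + a * (qx - px) ≡ D * qx + a' * (px - qx)
    reverse-param D a' a px qx refl = reverse D a' px qx
      where
      reverse : ∀ (D a' px qx : ℤ) → D * px + (D - a') * (qx - px) ≡ D * qx + a' * (px - qx)
      reverse = solve-∀

    ∸-complement : ∀ {d a} → a ℕ.≤ d → + d - + (d ℕ.∸ a) ≡ + a
    ∸-complement {d} {a} le = trans (pos-∸ (ℕP.m∸n≤m d a)) (cong +_ (ℕP.m∸[m∸n]≡n le))

  SegsMeet-flip : ∀ {p q r s} → SegsMeet p q r s → SegsMeet q p r s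
  SegsMeet-flip {px , py} {qx , qy} (d , a , b , d>0 , a≤d , b≤d , ex , ey) =
    d , d ℕ.∸ a , b , d>0 , ℕP.m∸n≤m d a , b≤d ,
    trans (sym (reverse-param (+ d) (+ (d ℕ.∸ a)) (+ a) px qx (∸-complement a≤d))) ex ,
    trans (sym (reverse-param (+ d) (+ (d ℕ.∸ a)) (+ a) py qy (∸-complement a≤d))) ey

  OnSeg-flip : ∀ {p q w} → OnSeg p q w → OnSeg q p w
  OnSeg-flip {px , py} {qx , qy} (d , a , d>0 , a≤d , ex , ey) =
    d , d ℕ.∸ a , d>0 , ℕP.m∸n≤m d a ,
    trans ex (reverse-param (+ d) (+ (d ℕ.∸ a)) (+ a) px qx (∸-complement a≤d)) ,
    trans ey (reverse-param (+ d) (+ (d ℕ.∸ a)) (+ a) py qy (∸-complement a≤d))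

  OnSeg-start : ∀ {p q} → OnSeg p q p
  OnSeg-start {px , py} {qx , qy} = 1 , 0 , s≤s z≤n , z≤n , at-start px qx , at-start py qy
    where
    at-start : ∀ (px qx : ℤ) → + 1 * px ≡ + 1 * px + + 0 * (qx - px)
    at-start = solve-∀

  record Affine : Set where
    constructor affine
    field m₁₁ m₁₂ m₂₁ m₂₂ t₁ t₂ : ℤ

  apply : Affine → Point → Point
  apply (affine m₁₁ m₁₂ m₂₁ m₂₂ t₁ t₂) (x , y) = m₁₁ * x + m₁₂ * y + t₁ , m₂₁ * x + m₂₂ * y + t₂

  det : Affine → ℤ
  det (affine m₁₁ m₁₂ m₂₁ m₂₂ t₁ t₂) = m₁₁ * m₂₂ - m₁₂ * m₂₁

  private
    det≢0⇒kernel≡0 : ∀ m₁₁ m₁₂ m₂₁ m₂₂ e₁ e₂ → m₁₁ * m₂₂ - m₁₂ * m₂₁ ≢ 0ℤ → m₁₁ * e₁ + m₁₂ * e₂ ≡ 0ℤ →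
      m₂₁ * e₁ + m₂₂ * e₂ ≡ 0ℤ → e₁ ≡ 0ℤ × e₂ ≡ 0ℤ
    det≢0⇒kernel≡0 m₁₁ m₁₂ m₂₁ m₂₂ e₁ e₂ det≢0 h₁ h₂ =
      det*≡0 (trans (cramer₁ m₁₁ m₁₂ m₂₁ m₂₂ e₁ e₂) (trans (cong₂ (λ u v → m₂₂ * u - m₁₂ * v) h₁ h₂) (zero₂ m₂₂ m₁₂)))
        ,
      det*≡0 (trans (cramer₂ m₁₁ m₁₂ m₂₁ m₂₂ e₁ e₂) (trans (cong₂ (λ u v → m₁₁ * v - m₂₁ * u) h₁ h₂) (zero₂ m₁₁ m₂₁)))
      where
      det*≡0 : ∀ {e} → (m₁₁ * m₂₂ - m₁₂ * m₂₁) * e ≡ 0ℤ → e ≡ 0ℤ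
      det*≡0 p with ℤP.i*j≡0⇒i≡0∨j≡0 _ p
      ... | inj₁ d≡0 = ⊥-elim (det≢0 d≡0)
      ... | inj₂ e≡0 = e≡0
      cramer₁ : ∀ m₁₁ m₁₂ m₂₁ m₂₂ e₁ e₂ → (m₁₁ * m₂₂ - m₁₂ * m₂₁) * e₁
        ≡ m₂₂ * (m₁₁ * e₁ + m₁₂ * e₂) - m₁₂ * (m₂₁ * e₁ + m₂₂ * e₂)
      cramer₁ = solve-∀
      cramer₂ : ∀ m₁₁ m₁₂ m₂₁ m₂₂ e₁ e₂ → (m₁₁ * m₂₂ - m₁₂ * m₂₁) * e₂
        ≡ m₁₁ * (m₂₁ * e₁ + m₂₂ * e₂) - m₂₁ * (m₁₁ * e₁ + m₁₂ * e₂)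
      cramer₂ = solve-∀
      zero₂ : ∀ a b → a * 0ℤ - b * 0ℤ ≡ 0ℤ
      zero₂ = solve-∀

    apply-comb : ∀ m₁ m₂ t D A px py qx qy →
      D * (m₁ * px + m₂ * py + t) + A * ((m₁ * qx + m₂ * qy + t) - (m₁ * px + m₂ * py + t))
      ≡ (m₁ * (D * px + A * (qx - px)) + m₂ * (D * py + A * (qy - py))) + D * t
    apply-comb = solve-∀

    apply-scaled : ∀ m₁ m₂ t D wx wy → D * (m₁ * wx + m₂ * wy + t) ≡ (m₁ * (D * wx) + m₂ * (D * wy)) + D * t
    apply-scaled = solve-∀

    linear-diff≡0 : ∀ m₁ m₂ x₁ y₁ x₂ y₂ → m₁ * x₁ + m₂ * y₁ ≡ m₁ * x₂ + m₂ * y₂ →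
      m₁ * (x₁ - x₂) + m₂ * (y₁ - y₂) ≡ 0ℤ
    linear-diff≡0 m₁ m₂ x₁ y₁ x₂ y₂ e =
      trans (split m₁ m₂ x₁ y₁ x₂ y₂) (ℤP.i≡j⇒i-j≡0 e)
      where
      split : ∀ m₁ m₂ x₁ y₁ x₂ y₂ → m₁ * (x₁ - x₂) + m₂ * (y₁ - y₂) ≡ (m₁ * x₁ + m₂ * y₁) - (m₁ * x₂ + m₂ * y₂)
      split = solve-∀

  OnSeg-reflect : ∀ F {p q w} → det F ≢ 0ℤ → OnSeg (apply F p) (apply F q) (apply F w) → OnSeg p q w
  OnSeg-reflect (affine m₁₁ m₁₂ m₂₁ m₂₂ t₁ t₂) {px , py} {qx , qy} {wx , wy} det≢0 (d , a , d>0 , a≤d , ex , ey) =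
    d , a , d>0 , a≤d , ℤP.i-j≡0⇒i≡j _ _ (proj₁ ker) , ℤP.i-j≡0⇒i≡j _ _ (proj₂ ker)
    where
    h₁ : m₁₁ * (+ d * wx) + m₁₂ * (+ d * wy)
      ≡ m₁₁ * (+ d * px + + a * (qx - px)) + m₁₂ * (+ d * py + + a * (qy - py))
    h₁ = ∙-cancelʳ (+ d * t₁) _ _
           (trans (sym (apply-scaled m₁₁ m₁₂ t₁ (+ d) wx wy))
             (trans ex (apply-comb m₁₁ m₁₂ t₁ (+ d) (+ a) px py qx qy)))
    h₂ : m₂₁ * (+ d * wx) + m₂₂ * (+ d * wy)
      ≡ m₂₁ * (+ d * px + + a * (qx - px)) + m₂₂ * (+ d * py + + a * (qy - py))
    h₂ = ∙-cancelʳ (+ d * t₂) _ _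
           (trans (sym (apply-scaled m₂₁ m₂₂ t₂ (+ d) wx wy))
             (trans ey (apply-comb m₂₁ m₂₂ t₂ (+ d) (+ a) px py qx qy)))
    ker : + d * wx - (+ d * px + + a * (qx - px)) ≡ 0ℤ × + d * wy - (+ d * py + + a * (qy - py)) ≡ 0ℤ
    ker = det≢0⇒kernel≡0 m₁₁ m₁₂ m₂₁ m₂₂ _ _ det≢0 (linear-diff≡0 m₁₁ m₁₂ _ _ _ _ h₁)
      (linear-diff≡0 m₂₁ m₂₂ _ _ _ _ h₂)

  SegsMeet-reflect : ∀ F {p q r s} → det F ≢ 0ℤ → SegsMeet (apply F p) (apply F q) (apply F r) (apply F s) →
    SegsMeet p q r s
  SegsMeet-reflect (affine m₁₁ m₁₂ m₂₁ m₂₂ t₁ t₂) {px , py} {qx , qy} {rx , ry} {sx , sy} det≢0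
    (d , a , b , d>0 , a≤d , b≤d , ex , ey) =
    d , a , b , d>0 , a≤d , b≤d , ℤP.i-j≡0⇒i≡j _ _ (proj₁ ker) , ℤP.i-j≡0⇒i≡j _ _ (proj₂ ker)
    where
    h₁ : m₁₁ * (+ d * px + + a * (qx - px)) + m₁₂ * (+ d * py + + a * (qy - py))
      ≡ m₁₁ * (+ d * rx + + b * (sx - rx)) + m₁₂ * (+ d * ry + + b * (sy - ry))
    h₁ = ∙-cancelʳ (+ d * t₁) _ _
           (trans (sym (apply-comb m₁₁ m₁₂ t₁ (+ d) (+ a) px py qx qy))
             (trans ex (apply-comb m₁₁ m₁₂ t₁ (+ d) (+ b) rx ry sx sy)))
    h₂ : m₂₁ * (+ d * px + + a * (qx - px)) + m₂₂ * (+ d * py + + a * (qy - py))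
      ≡ m₂₁ * (+ d * rx + + b * (sx - rx)) + m₂₂ * (+ d * ry + + b * (sy - ry))
    h₂ = ∙-cancelʳ (+ d * t₂) _ _
           (trans (sym (apply-comb m₂₁ m₂₂ t₂ (+ d) (+ a) px py qx qy))
             (trans ey (apply-comb m₂₁ m₂₂ t₂ (+ d) (+ b) rx ry sx sy)))
    ker : (+ d * px + + a * (qx - px)) - (+ d * rx + + b * (sx - rx)) ≡ 0ℤ ×
          (+ d * py + + a * (qy - py)) - (+ d * ry + + b * (sy - ry)) ≡ 0ℤ
    ker = det≢0⇒kernel≡0 m₁₁ m₁₂ m₂₁ m₂₂ _ _ det≢0 (linear-diff≡0 m₁₁ m₁₂ _ _ _ _ h₁)
      (linear-diff≡0 m₂₁ m₂₂ _ _ _ _ h₂)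

-- The depth-(d+1) fan: adjacent hubs hu, hv, a path p₀ … p_L joined to both hubs, and for every
-- hub σ and k < L a copy of the depth-d fan whose hubs are identified with hub σ and p_k.
module Fan (L : ℕ) where
  open import Data.Nat using (ℕ; zero; suc; _≡ᵇ_)
  import Data.Nat.Properties as ℕP
  open import Data.Fin using (Fin; zero; suc; toℕ; inject₁)
  import Data.Fin.Properties as FP
  open import Data.Bool as Bool using (Bool; true; false; _∧_; _∨_; not; T)
  open import Data.Bool.Properties using (∨-comm; ∧-zeroʳ)
  open import Data.Product using (Σ; _×_; _,_)
  open import Data.Sum using (_⊎_; inj₁; inj₂)
  open import Data.Unit using (tt)
  open import Data.Empty using (⊥-elim)
  open import Relation.Nullary using (yes; no; does)
  open import Relation.Binary.Definitions using (DecidableEquality)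
  open import Relation.Binary.PropositionalEquality

  data Inner : ℕ → Set where
    path  : ∀ {d} → Fin (suc L) → Inner (suc d)
    child : ∀ {d} → Bool → Fin L → Inner d → Inner (suc d)

  data Vertex (d : ℕ) : Set where
    hu hv : Vertex d
    inner : Inner d → Vertex d

  hub : ∀ {d} → Bool → Vertex d
  hub true = hu
  hub false = hv

  inChild : ∀ {d} → Bool → Fin L → Vertex d → Vertex (suc d)
  inChild σ k hu = hub σ
  inChild σ k hv = inner (path (inject₁ k))
  inChild σ k (inner i) = inner (child σ k i)

  module _ {A : Set} (_≟_ : DecidableEquality A) where
    sameᵇ : A → A → Bool
    sameᵇ x y = does (x ≟ y)

    sameᵇ-sym : ∀ x y → sameᵇ x y ≡ sameᵇ y x
    sameᵇ-sym x y with x ≟ y | y ≟ x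
    ... | yes _ | yes _ = refl
    ... | no _ | no _ = refl
    ... | yes p | no q = ⊥-elim (q (sym p))
    ... | no p | yes q = ⊥-elim (p (sym q))

    sameᵇ-refl : ∀ x → sameᵇ x x ≡ true
    sameᵇ-refl x with x ≟ x
    ... | yes _ = refl
    ... | no p = ⊥-elim (p refl)

    sameᵇ⇒≡ : ∀ {x y} → sameᵇ x y ≡ true → x ≡ y
    sameᵇ⇒≡ {x} {y} e with x ≟ y
    ... | yes p = p
    sameᵇ⇒≡ () | no _

  consecutive : Fin (suc L) → Fin (suc L) → Bool
  consecutive j j' = (suc (toℕ j) ≡ᵇ toℕ j') ∨ (suc (toℕ j') ≡ᵇ toℕ j)

  adjacent : ∀ d → Vertex d → Vertex d → Bool
  adjacent d hu hu = false
  adjacent d hu hv = true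
  adjacent d hv hu = true
  adjacent d hv hv = false
  adjacent (suc d) hu (inner (path j)) = true
  adjacent (suc d) hv (inner (path j)) = true
  adjacent (suc d) (inner (path j)) hu = true
  adjacent (suc d) (inner (path j)) hv = true
  adjacent (suc d) hu (inner (child σ k i)) = σ ∧ adjacent d hu (inner i)
  adjacent (suc d) hv (inner (child σ k i)) = not σ ∧ adjacent d hu (inner i)
  adjacent (suc d) (inner (child σ k i)) hu = σ ∧ adjacent d (inner i) hu
  adjacent (suc d) (inner (child σ k i)) hv = not σ ∧ adjacent d (inner i) hu
  adjacent (suc d) (inner (path j)) (inner (path j')) = consecutive j j'
  adjacent (suc d) (inner (path j)) (inner (child σ k i)) = sameᵇ FP._≟_ j (inject₁ k) ∧ adjacent d hv (inner i)
  adjacent (suc d) (inner (child σ k i)) (inner (path j)) = sameᵇ FP._≟_ j (inject₁ k) ∧ adjacent d (inner i) hv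
  adjacent (suc d) (inner (child σ k i)) (inner (child σ' k' i')) =
    (sameᵇ Bool._≟_ σ σ' ∧ sameᵇ FP._≟_ k k') ∧ adjacent d (inner i) (inner i')

  adjacent-sym : ∀ d a b → adjacent d a b ≡ adjacent d b a
  adjacent-sym d hu hu = refl
  adjacent-sym d hu hv = refl
  adjacent-sym d hv hu = refl
  adjacent-sym d hv hv = refl
  adjacent-sym (suc d) hu (inner (path j)) = refl
  adjacent-sym (suc d) hv (inner (path j)) = refl
  adjacent-sym (suc d) (inner (path j)) hu = refl
  adjacent-sym (suc d) (inner (path j)) hv = refl
  adjacent-sym (suc d) hu (inner (child σ k i)) = cong (σ ∧_) (adjacent-sym d hu (inner i))
  adjacent-sym (suc d) hv (inner (child σ k i)) = cong (not σ ∧_) (adjacent-sym d hu (inner i))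
  adjacent-sym (suc d) (inner (child σ k i)) hu = cong (σ ∧_) (adjacent-sym d (inner i) hu)
  adjacent-sym (suc d) (inner (child σ k i)) hv = cong (not σ ∧_) (adjacent-sym d (inner i) hu)
  adjacent-sym (suc d) (inner (path j)) (inner (path j')) = ∨-comm (suc (toℕ j) ≡ᵇ toℕ j') (suc (toℕ j') ≡ᵇ toℕ j)
  adjacent-sym (suc d) (inner (path j)) (inner (child σ k i)) =
    cong (sameᵇ FP._≟_ j (inject₁ k) ∧_) (adjacent-sym d hv (inner i))
  adjacent-sym (suc d) (inner (child σ k i)) (inner (path j)) =
    cong (sameᵇ FP._≟_ j (inject₁ k) ∧_) (adjacent-sym d (inner i) hv)
  adjacent-sym (suc d) (inner (child σ k i)) (inner (child σ' k' i')) =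
    cong₂ _∧_ (cong₂ _∧_ (sameᵇ-sym Bool._≟_ σ σ') (sameᵇ-sym FP._≟_ k k')) (adjacent-sym d (inner i) (inner i'))

  private
    suc≡ᵇ-false : ∀ n → (suc n ≡ᵇ n) ≡ false
    suc≡ᵇ-false zero = refl
    suc≡ᵇ-false (suc n) = suc≡ᵇ-false n

    ≡ᵇ-refl : ∀ n → (n ≡ᵇ n) ≡ true
    ≡ᵇ-refl zero = refl
    ≡ᵇ-refl (suc n) = ≡ᵇ-refl n

  adjacent-irrefl : ∀ d a → adjacent d a a ≡ false
  adjacent-irrefl d hu = refl
  adjacent-irrefl d hv = refl
  adjacent-irrefl (suc d) (inner (path j)) rewrite suc≡ᵇ-false (toℕ j) = refl
  adjacent-irrefl (suc d) (inner (child σ k i)) =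
    trans (cong (_ ∧_) (adjacent-irrefl d (inner i))) (∧-zeroʳ _)

  path-adjacent : ∀ {d} (k : Fin L) → adjacent (suc d) (inner (path (inject₁ k))) (inner (path (suc k))) ≡ true
  path-adjacent k rewrite FP.toℕ-inject₁ k | ≡ᵇ-refl (suc (toℕ k)) = refl

  inChild-adjacent : ∀ {d} σ k (a b : Vertex d) → adjacent d a b ≡ true →
    adjacent (suc d) (inChild σ k a) (inChild σ k b) ≡ true
  inChild-adjacent true k hu hv e = refl
  inChild-adjacent false k hu hv e = refl
  inChild-adjacent true k hv hu e = refl
  inChild-adjacent false k hv hu e = refl
  inChild-adjacent true k hu (inner i) e = e
  inChild-adjacent false k hu (inner i) e = e
  inChild-adjacent true k (inner i) hu e = e
  inChild-adjacent false k (inner i) hu e = e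
  inChild-adjacent σ k hv (inner i) e = cong₂ _∧_ (sameᵇ-refl FP._≟_ (inject₁ k)) e
  inChild-adjacent σ k (inner i) hv e = cong₂ _∧_ (sameᵇ-refl FP._≟_ (inject₁ k)) e
  inChild-adjacent true k (inner i) (inner i') e = cong₂ _∧_ (sameᵇ-refl FP._≟_ k) e
  inChild-adjacent false k (inner i) (inner i') e = cong₂ _∧_ (sameᵇ-refl FP._≟_ k) e

  inChild-injective : ∀ {d} σ k {a b : Vertex d} → inChild σ k a ≡ inChild σ k b → a ≡ b
  inChild-injective true k {hu} {hu} e = refl
  inChild-injective false k {hu} {hu} e = refl
  inChild-injective σ k {hv} {hv} e = refl
  inChild-injective true k {hu} {hv} ()
  inChild-injective false k {hu} {hv} ()
  inChild-injective true k {hv} {hu} ()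
  inChild-injective false k {hv} {hu} ()
  inChild-injective true k {hu} {inner i} ()
  inChild-injective false k {hu} {inner i} ()
  inChild-injective true k {inner i} {hu} ()
  inChild-injective false k {inner i} {hu} ()
  inChild-injective σ k {hv} {inner i} ()
  inChild-injective σ k {inner i} {hv} ()
  inChild-injective σ k {inner i} {inner .i} refl = refl

  inChild-≢ : ∀ {d} σ k {a b : Vertex d} → inChild σ k a ≢ inChild σ k b → a ≢ b
  inChild-≢ σ k n e = n (cong (inChild σ k) e)

  _≟ᴵ_ : ∀ {d} → DecidableEquality (Inner d)
  path j ≟ᴵ path j' with j FP.≟ j'
  ... | yes refl = yes refl
  ... | no n = no λ { refl → n refl }
  path j ≟ᴵ child σ k i = no λ ()
  child σ k i ≟ᴵ path j = no λ ()
  child σ k i ≟ᴵ child σ' k' i' with σ Bool.≟ σ' | k FP.≟ k' | i ≟ᴵ i'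
  ... | yes refl | yes refl | yes refl = yes refl
  ... | no n | _ | _ = no λ { refl → n refl }
  ... | yes _ | no n | _ = no λ { refl → n refl }
  ... | yes _ | yes _ | no n = no λ { refl → n refl }

  _≟ⱽ_ : ∀ {d} → DecidableEquality (Vertex d)
  hu ≟ⱽ hu = yes refl
  hv ≟ⱽ hv = yes refl
  hu ≟ⱽ hv = no λ ()
  hv ≟ⱽ hu = no λ ()
  hu ≟ⱽ inner _ = no λ ()
  hv ≟ⱽ inner _ = no λ ()
  inner _ ≟ⱽ hu = no λ ()
  inner _ ≟ⱽ hv = no λ ()
  inner i ≟ⱽ inner i' with i ≟ᴵ i'
  ... | yes refl = yes refl
  ... | no n = no λ { refl → n refl }

  two-neighbours : ∀ d (x : Vertex (suc d)) → Σ (Vertex (suc d)) λ z₁ → Σ (Vertex (suc d)) λ z₂ →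
    adjacent (suc d) x z₁ ≡ true × adjacent (suc d) x z₂ ≡ true × z₁ ≢ z₂
  two-neighbours d hu = hv , inner (path zero) , refl , refl , λ ()
  two-neighbours d hv = hu , inner (path zero) , refl , refl , λ ()
  two-neighbours d (inner (path j)) = hu , hv , refl , refl , λ ()
  two-neighbours (suc d) (inner (child σ k i)) with two-neighbours d (inner i)
  ... | z₁ , z₂ , a₁ , a₂ , z₁≢z₂ =
    inChild σ k z₁ , inChild σ k z₂ , inChild-adjacent σ k (inner i) z₁ a₁ , inChild-adjacent σ k (inner i) z₂ a₂ ,
    λ e → z₁≢z₂ (inChild-injective σ k e)

  private
    ∧-true : ∀ {a b} → a ∧ b ≡ true → a ≡ true × b ≡ true
    ∧-true {true} {true} _ = refl , refl

    ∨-true : ∀ {a b} → a ∨ b ≡ true → a ≡ true ⊎ b ≡ true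
    ∨-true {true} _ = inj₁ refl
    ∨-true {false} e = inj₂ e

    consecutive-view : (j j' : Fin (suc L)) → (suc (toℕ j) ≡ᵇ toℕ j') ≡ true →
      Σ (Fin L) λ m → j ≡ inject₁ m × j' ≡ suc m
    consecutive-view j zero ()
    consecutive-view j (suc m) e =
      m , FP.toℕ-injective (trans (ℕP.suc-injective (ℕP.≡ᵇ⇒≡ _ _ (subst T (sym e) tt))) (sym (FP.toℕ-inject₁ m))) ,
        refl

  data Edge {d : ℕ} : Vertex (suc d) → Vertex (suc d) → Set where
    hub-hub   : Edge hu hv
    hub-path  : ∀ σ j → Edge (hub σ) (inner (path j))
    path-path : ∀ (j : Fin L) → Edge (inner (path (inject₁ j))) (inner (path (suc j)))
    in-child  : ∀ σ k {a b : Vertex d} → adjacent d a b ≡ true → Edge (inChild σ k a) (inChild σ k b)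

  classify-edge : ∀ d (a b : Vertex (suc d)) → adjacent (suc d) a b ≡ true → Edge a b ⊎ Edge b a
  classify-edge d hu hv e = inj₁ hub-hub
  classify-edge d hv hu e = inj₂ hub-hub
  classify-edge d hu (inner (path j)) e = inj₁ (hub-path true j)
  classify-edge d hv (inner (path j)) e = inj₁ (hub-path false j)
  classify-edge d (inner (path j)) hu e = inj₂ (hub-path true j)
  classify-edge d (inner (path j)) hv e = inj₂ (hub-path false j)
  classify-edge d hu (inner (child true k i)) e = inj₁ (in-child true k {hu} {inner i} e)
  classify-edge d hu (inner (child false k i)) ()
  classify-edge d hv (inner (child false k i)) e = inj₁ (in-child false k {hu} {inner i} e)
  classify-edge d hv (inner (child true k i)) ()
  classify-edge d (inner (child true k i)) hu e = inj₁ (in-child true k {inner i} {hu} e)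
  classify-edge d (inner (child false k i)) hu ()
  classify-edge d (inner (child false k i)) hv e = inj₁ (in-child false k {inner i} {hu} e)
  classify-edge d (inner (child true k i)) hv ()
  classify-edge d (inner (path j)) (inner (path j')) e with ∨-true e
  ... | inj₁ e₁ with consecutive-view j j' e₁
  ...   | m , refl , refl = inj₁ (path-path m)
  classify-edge d (inner (path j)) (inner (path j')) e | inj₂ e₂ with consecutive-view j' j e₂
  ...   | m , refl , refl = inj₂ (path-path m)
  classify-edge d (inner (path j)) (inner (child σ k i)) e with ∧-true {sameᵇ FP._≟_ j (inject₁ k)} e
  ... | e₁ , e₂ with sameᵇ⇒≡ FP._≟_ {j} {inject₁ k} e₁
  ... | refl = inj₁ (in-child σ k {hv} {inner i} e₂)
  classify-edge d (inner (child σ k i)) (inner (path j)) e with ∧-true {sameᵇ FP._≟_ j (inject₁ k)} e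
  ... | e₁ , e₂ with sameᵇ⇒≡ FP._≟_ {j} {inject₁ k} e₁
  ... | refl = inj₁ (in-child σ k {inner i} {hv} e₂)
  classify-edge d (inner (child σ k i)) (inner (child σ' k' i')) e
    with ∧-true {sameᵇ Bool._≟_ σ σ' ∧ sameᵇ FP._≟_ k k'} e
  ... | e₁ , e₂ with ∧-true {sameᵇ Bool._≟_ σ σ'} e₁
  ... | e₃ , e₄ with sameᵇ⇒≡ Bool._≟_ {σ} {σ'} e₃ | sameᵇ⇒≡ FP._≟_ {k} {k'} e₄
  ... | refl | refl = inj₁ (in-child σ k {inner i} {inner i'} e₂)

  record FanIn (G : Graph) (d : ℕ) : Set where
    field
      embed           : Vertex d → Fin (n G)
      embed-injective : ∀ a b → embed a ≡ embed b → a ≡ b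
      embed-adjacent  : ∀ a b → adjacent d a b ≡ true → Adj G (embed a) (embed b)

  childFan : ∀ {G d} → Bool → Fin L → FanIn G (suc d) → FanIn G d
  childFan σ k F = record
    { embed = λ x → embed (inChild σ k x)
    ; embed-injective = λ a b e → inChild-injective σ k (embed-injective _ _ e)
    ; embed-adjacent = λ a b a~b → embed-adjacent _ _ (inChild-adjacent σ k a b a~b) }
    where open FanIn F

-- Vertices are placed by weighted barycentric coordinates (a , b , c), a + b + c = scale d, and drawn
-- at (b , c): hubs at two corners of a triangle, the path on the median a = b, and the child (σ , k)
-- mapped affinely onto the triangle hub σ, p_k, p_(k+1).
module Drawing (L : ℕ) where
  open import Data.Nat as ℕ using (ℕ; zero; suc; z≤n; s≤s)
  import Data.Nat.Properties as ℕP
  import Data.Nat.Tactic.RingSolver as ℕSolver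
  open import Data.Fin using (Fin; zero; suc; toℕ; inject₁)
  import Data.Fin.Properties as FP
  open import Data.Bool using (Bool; true; false; not)
  open import Data.Integer using (ℤ; +_; _+_; _*_; _-_; -_; 0ℤ)
  import Data.Integer.Properties as ℤP
  open import Data.Integer.Tactic.RingSolver
  open import Data.Product using (_×_; _,_; proj₁; proj₂)
  open import Data.Sum using (inj₁; inj₂)
  open import Relation.Binary.PropositionalEquality
  open Sign
  open Separation
  open Fan L

  Bary : Set
  Bary = ℕ × ℕ × ℕ

  W : ℕ
  W = 2 ℕ.* (3 ℕ.+ L)

  infixl 7 _·₃_
  infixl 6 _+₃_
  _·₃_ : ℕ → Bary → Bary
  k ·₃ (a , b , c) = k ℕ.* a , k ℕ.* b , k ℕ.* c

  _+₃_ : Bary → Bary → Bary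
  (a , b , c) +₃ (a' , b' , c') = a ℕ.+ a' , b ℕ.+ b' , c ℕ.+ c'

  total : Bary → ℕ
  total (a , b , c) = a ℕ.+ b ℕ.+ c

  scale : ℕ → ℕ
  scale zero = 1
  scale (suc d) = scale d ℕ.* W

  hubBary : Bool → Bary
  hubBary true = W , 0 , 0
  hubBary false = 0 , W , 0

  pathBary : Fin (suc L) → Bary
  pathBary j = L ℕ.+ 2 ℕ.∸ toℕ j , L ℕ.+ 2 ℕ.∸ toℕ j , 2 ℕ.* suc (toℕ j)

  childBary : Bool → Fin L → Bary → Bary
  childBary σ k (a , b , c) = a ·₃ hubBary σ +₃ b ·₃ pathBary (inject₁ k) +₃ c ·₃ pathBary (suc k)

  bary : ∀ d → Vertex d → Bary
  bary d hu = scale d , 0 , 0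
  bary d hv = 0 , scale d , 0
  bary (suc d) (inner (path j)) = scale d ·₃ pathBary j
  bary (suc d) (inner (child σ k i)) = childBary σ k (bary d (inner i))

  project : Bary → Point
  project (a , b , c) = + b , + c

  point : ∀ d → Vertex d → Point
  point d x = project (bary d x)

  j<L+2 : ∀ (j : Fin (suc L)) → toℕ j ℕ.< L ℕ.+ 2
  j<L+2 j = ℕP.≤-trans (FP.toℕ<n j) (ℕP.≤-trans (ℕP.n≤1+n (suc L)) (ℕP.≤-reflexive (ℕP.+-comm 2 L)))

  L+2∸j+j : ∀ (j : Fin (suc L)) → L ℕ.+ 2 ℕ.∸ toℕ j ℕ.+ toℕ j ≡ L ℕ.+ 2
  L+2∸j+j j = ℕP.m∸n+n≡m (ℕP.<⇒≤ (j<L+2 j))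

  +-L+2∸j : ∀ (j : Fin (suc L)) → + (L ℕ.+ 2 ℕ.∸ toℕ j) ≡ + L + + 2 - + toℕ j
  +-L+2∸j j = trans (add-sub (+ (L ℕ.+ 2 ℕ.∸ toℕ j)) (+ toℕ j))
                (cong (_- + toℕ j) (trans (sym (ℤP.pos-+ _ (toℕ j))) (trans (cong +_ (L+2∸j+j j)) (ℤP.pos-+ L 2))))
    where
    add-sub : ∀ (x y : ℤ) → x ≡ x + y - y
    add-sub = solve-∀

  total-hubBary : ∀ σ → total (hubBary σ) ≡ W
  total-hubBary true = trans (ℕP.+-identityʳ (W ℕ.+ 0)) (ℕP.+-identityʳ W)
  total-hubBary false = ℕP.+-identityʳ W

  total-pathBary : ∀ j → total (pathBary j) ≡ W
  total-pathBary j =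
    ℕP.+-cancelʳ-≡ (toℕ j ℕ.+ toℕ j) _ _
      (trans (regroup (L ℕ.+ 2 ℕ.∸ toℕ j) (toℕ j))
        (trans (cong₂ (λ u v → u ℕ.+ v ℕ.+ 2 ℕ.* suc (toℕ j)) (L+2∸j+j j) (L+2∸j+j j)) (sum L (toℕ j))))
    where
    regroup : ∀ x j → x ℕ.+ x ℕ.+ 2 ℕ.* suc j ℕ.+ (j ℕ.+ j) ≡ (x ℕ.+ j) ℕ.+ (x ℕ.+ j) ℕ.+ 2 ℕ.* suc j
    regroup = ℕSolver.solve-∀
    sum : ∀ L j → L ℕ.+ 2 ℕ.+ (L ℕ.+ 2) ℕ.+ 2 ℕ.* suc j ≡ 2 ℕ.* (3 ℕ.+ L) ℕ.+ (j ℕ.+ j)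
    sum = ℕSolver.solve-∀

  total-· : ∀ k t → total (k ·₃ t) ≡ k ℕ.* total t
  total-· k (a , b , c) = distrib k a b c
    where
    distrib : ∀ k a b c → k ℕ.* a ℕ.+ k ℕ.* b ℕ.+ k ℕ.* c ≡ k ℕ.* (a ℕ.+ b ℕ.+ c)
    distrib = ℕSolver.solve-∀

  total-+ : ∀ t u → total (t +₃ u) ≡ total t ℕ.+ total u
  total-+ (a , b , c) (a' , b' , c') = regroup a b c a' b' c'
    where
    regroup : ∀ a b c a' b' c' → a ℕ.+ a' ℕ.+ (b ℕ.+ b') ℕ.+ (c ℕ.+ c') ≡ a ℕ.+ b ℕ.+ c ℕ.+ (a' ℕ.+ b' ℕ.+ c')
    regroup = ℕSolver.solve-∀

  total-childBary : ∀ σ k t → total (childBary σ k t) ≡ total t ℕ.* W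
  total-childBary σ k (a , b , c) = begin
    total (a ·₃ hubBary σ +₃ b ·₃ pathBary (inject₁ k) +₃ c ·₃ pathBary (suc k))
      ≡⟨ total-+ (a ·₃ hubBary σ +₃ b ·₃ pathBary (inject₁ k)) (c ·₃ pathBary (suc k)) ⟩
    total (a ·₃ hubBary σ +₃ b ·₃ pathBary (inject₁ k)) ℕ.+ total (c ·₃ pathBary (suc k))
      ≡⟨ cong₂ ℕ._+_ (total-+ (a ·₃ hubBary σ) (b ·₃ pathBary (inject₁ k))) (total-· c (pathBary (suc k))) ⟩
    total (a ·₃ hubBary σ) ℕ.+ total (b ·₃ pathBary (inject₁ k)) ℕ.+ c ℕ.* total (pathBary (suc k))
      ≡⟨ cong₂ (λ u v → u ℕ.+ v ℕ.+ c ℕ.* total (pathBary (suc k))) (total-· a (hubBary σ))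
        (total-· b (pathBary (inject₁ k))) ⟩
    a ℕ.* total (hubBary σ) ℕ.+ b ℕ.* total (pathBary (inject₁ k)) ℕ.+ c ℕ.* total (pathBary (suc k))
      ≡⟨ cong₂ (λ u v → u ℕ.+ v) (cong₂ (λ u v → a ℕ.* u ℕ.+ b ℕ.* v) (total-hubBary σ) (total-pathBary (inject₁ k)))
               (cong (c ℕ.*_) (total-pathBary (suc k))) ⟩
    a ℕ.* W ℕ.+ b ℕ.* W ℕ.+ c ℕ.* W
      ≡⟨ distrib a b c W ⟩
    (a ℕ.+ b ℕ.+ c) ℕ.* W ∎
    where
    open ≡-Reasoning
    distrib : ∀ a b c W → a ℕ.* W ℕ.+ b ℕ.* W ℕ.+ c ℕ.* W ≡ (a ℕ.+ b ℕ.+ c) ℕ.* W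
    distrib = ℕSolver.solve-∀

  total-bary : ∀ d x → total (bary d x) ≡ scale d
  total-bary d hu = trans (ℕP.+-identityʳ (scale d ℕ.+ 0)) (ℕP.+-identityʳ (scale d))
  total-bary d hv = ℕP.+-identityʳ (scale d)
  total-bary (suc d) (inner (path j)) = trans (total-· (scale d) (pathBary j))
    (cong (scale d ℕ.*_) (total-pathBary j))
  total-bary (suc d) (inner (child σ k i)) =
    trans (total-childBary σ k (bary d (inner i))) (cong (ℕ._* W) (total-bary d (inner i)))

  scale>0 : ∀ d → 0 ℕ.< scale d
  scale>0 zero = s≤s z≤n
  scale>0 (suc d) = ℕP.*-mono-< {0} {scale d} {0} {W} (scale>0 d) (s≤s z≤n)

  Interior : Bary → Set
  Interior (a , b , c) = 0 ℕ.< a × 0 ℕ.< b × 0 ℕ.< c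

  interior-pathBary : ∀ j → Interior (pathBary j)
  interior-pathBary j = ℕP.m<n⇒0<n∸m (j<L+2 j) , ℕP.m<n⇒0<n∸m (j<L+2 j) , s≤s z≤n

  interior-bary : ∀ d (i : Inner d) → Interior (bary d (inner i))
  interior-bary (suc d) (path j) with interior-pathBary j
  ... | p₁ , p₂ , p₃ = *-pos (scale>0 d) p₁ , *-pos (scale>0 d) p₂ , *-pos (scale>0 d) p₃
    where
    *-pos : ∀ {x y} → 0 ℕ.< x → 0 ℕ.< y → 0 ℕ.< x ℕ.* y
    *-pos {x} {y} p q = ℕP.*-mono-< {0} {x} {0} {y} p q
  interior-bary (suc d) (child σ k i) with bary d (inner i) | interior-bary d i | interior-pathBary (inject₁ k)
  ... | (a , b , c) | (_ , pb , _) | (q₁ , q₂ , q₃) =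
    middle (a ℕ.* proj₁ (hubBary σ)) (c ℕ.* proj₁ (pathBary (suc k))) (mul pb q₁) ,
    middle (a ℕ.* proj₁ (proj₂ (hubBary σ))) (c ℕ.* proj₁ (proj₂ (pathBary (suc k)))) (mul pb q₂) ,
    middle (a ℕ.* proj₂ (proj₂ (hubBary σ))) (c ℕ.* proj₂ (proj₂ (pathBary (suc k)))) (mul pb q₃)
    where
    mul : ∀ {x y} → 0 ℕ.< x → 0 ℕ.< y → 0 ℕ.< x ℕ.* y
    mul {x} {y} p q = ℕP.*-mono-< {0} {x} {0} {y} p q
    middle : ∀ x {y} z → 0 ℕ.< y → 0 ℕ.< x ℕ.+ y ℕ.+ z
    middle x {y} z p = ℕP.≤-trans p (ℕP.≤-trans (ℕP.m≤n+m y x) (ℕP.m≤m+n (x ℕ.+ y) z))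

  BaryForm : Set
  BaryForm = ℤ × ℤ × ℤ

  evalᵇ : BaryForm → Bary → ℤ
  evalᵇ (α , β , γ) (a , b , c) = α * + a + β * + b + γ * + c

  toForm : ℕ → BaryForm → Form
  toForm S (α , β , γ) = β - α , γ - α , α * + S

  eval-toForm : ∀ S f t → total t ≡ S → eval (toForm S f) (project t) ≡ evalᵇ f t
  eval-toForm S (α , β , γ) (a , b , c) refl =
    trans (cong (λ z → (β - α) * + b + (γ - α) * + c + α * z)
      (trans (ℤP.pos-+ (a ℕ.+ b) c) (cong (_+ + c) (ℤP.pos-+ a b))))
          (ring-identity α β γ (+ a) (+ b) (+ c))
    where
    ring-identity : ∀ α β γ a b c → (β - α) * b + (γ - α) * c + α * (a + b + c) ≡ α * a + β * b + γ * c
    ring-identity = solve-∀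

  negate : BaryForm → BaryForm
  negate (α , β , γ) = - α , - β , - γ

  evalᵇ-negate : ∀ f t → evalᵇ (negate f) t ≡ - evalᵇ f t
  evalᵇ-negate (α , β , γ) (a , b , c) = ring-identity α β γ (+ a) (+ b) (+ c)
    where
    ring-identity : ∀ α β γ a b c → - α * a + - β * b + - γ * c ≡ - (α * a + β * b + γ * c)
    ring-identity = solve-∀

  evalᵇ-+ : ∀ f t u → evalᵇ f (t +₃ u) ≡ evalᵇ f t + evalᵇ f u
  evalᵇ-+ (α , β , γ) (a , b , c) (a' , b' , c') =
    trans (cong₂ (λ x y → x + y + γ * + (c ℕ.+ c')) (cong (α *_) (ℤP.pos-+ a a')) (cong (β *_) (ℤP.pos-+ b b')))
    (trans (cong (λ z → α * (+ a + + a') + β * (+ b + + b') + γ * z) (ℤP.pos-+ c c'))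
           (ring-identity α β γ (+ a) (+ b) (+ c) (+ a') (+ b') (+ c')))
    where
    ring-identity : ∀ α β γ a b c a' b' c' → α * (a + a') + β * (b + b') + γ * (c + c')
      ≡ (α * a + β * b + γ * c) + (α * a' + β * b' + γ * c')
    ring-identity = solve-∀

  evalᵇ-· : ∀ f k t → evalᵇ f (k ·₃ t) ≡ + k * evalᵇ f t
  evalᵇ-· (α , β , γ) k (a , b , c) =
    trans (cong₂ (λ x y → x + y + γ * + (k ℕ.* c)) (cong (α *_) (ℤP.pos-* k a)) (cong (β *_) (ℤP.pos-* k b)))
    (trans (cong (λ z → α * (+ k * + a) + β * (+ k * + b) + γ * z) (ℤP.pos-* k c))
           (ring-identity α β γ (+ k) (+ a) (+ b) (+ c)))
    where
    ring-identity : ∀ α β γ k a b c → α * (k * a) + β * (k * b) + γ * (k * c) ≡ k * (α * a + β * b + γ * c)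
    ring-identity = solve-∀

  evalᵇ-childBary : ∀ f σ k a b c → evalᵇ f (childBary σ k (a , b , c))
    ≡ + a * evalᵇ f (hubBary σ) + + b * evalᵇ f (pathBary (inject₁ k)) + + c * evalᵇ f (pathBary (suc k))
  evalᵇ-childBary f σ k a b c =
    trans (evalᵇ-+ f (a ·₃ hubBary σ +₃ b ·₃ pathBary (inject₁ k)) (c ·₃ pathBary (suc k)))
    (trans (cong (_+ evalᵇ f (c ·₃ pathBary (suc k))) (evalᵇ-+ f (a ·₃ hubBary σ) (b ·₃ pathBary (inject₁ k))))
    (cong₂ _+_ (cong₂ _+_ (evalᵇ-· f a (hubBary σ)) (evalᵇ-· f b (pathBary (inject₁ k))))
      (evalᵇ-· f c (pathBary (suc k)))))

  private
    +0+0 : ∀ m → m ℕ.+ 0 ℕ.+ 0 ≡ m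
    +0+0 m = trans (ℕP.+-identityʳ _) (ℕP.+-identityʳ m)

    *0+0+0 : ∀ m → m ℕ.* 0 ℕ.+ 0 ℕ.+ 0 ≡ 0
    *0+0+0 m = trans (+0+0 _) (ℕP.*-zeroʳ m)

  bary-inChild : ∀ d σ k (x : Vertex d) → bary (suc d) (inChild σ k x) ≡ childBary σ k (bary d x)
  bary-inChild d true k hu =
    sym (cong₂ _,_ (+0+0 (scale d ℕ.* W)) (cong₂ _,_ (*0+0+0 (scale d)) (*0+0+0 (scale d))))
  bary-inChild d false k hu =
    sym (cong₂ _,_ (*0+0+0 (scale d)) (cong₂ _,_ (+0+0 (scale d ℕ.* W)) (*0+0+0 (scale d))))
  bary-inChild d σ k hv with pathBary (inject₁ k)
  ... | (x , y , z) = sym (cong₂ _,_ (ℕP.+-identityʳ _) (cong₂ _,_ (ℕP.+-identityʳ _) (ℕP.+-identityʳ _)))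
  bary-inChild d σ k (inner i) = refl

  affineOf : ℕ → Bary → Bary → Bary → Affine
  affineOf S (x1 , x2 , x3) (y1 , y2 , y3) (z1 , z2 , z3) =
    affine (+ y2 - + x2) (+ z2 - + x2) (+ y3 - + x3) (+ z3 - + x3) (+ S * + x2) (+ S * + x3)

  +-lincomb₃ : ∀ a b c x y z → + (a ℕ.* x ℕ.+ b ℕ.* y ℕ.+ c ℕ.* z) ≡ + a * + x + + b * + y + + c * + z
  +-lincomb₃ a b c x y z = trans (ℤP.pos-+ (a ℕ.* x ℕ.+ b ℕ.* y) (c ℕ.* z))
    (cong₂ _+_ (trans (ℤP.pos-+ (a ℕ.* x) (b ℕ.* y)) (cong₂ _+_ (ℤP.pos-* a x) (ℤP.pos-* b y))) (ℤP.pos-* c z))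

  lincomb₃-affine : ∀ a b c x y z S → + S ≡ + a + + b + + c → + a * + x + + b * + y + + c * + z
    ≡ (+ y - + x) * + b + (+ z - + x) * + c + + S * + x
  lincomb₃-affine a b c x y z S e = trans (ring-identity (+ a) (+ b) (+ c) (+ x) (+ y) (+ z))
    (cong (λ w → (+ y - + x) * + b + (+ z - + x) * + c + w * + x) (sym e))
    where
    ring-identity : ∀ a b c x y z → a * x + b * y + c * z ≡ (y - x) * b + (z - x) * c + (a + b + c) * x
    ring-identity = solve-∀

  project-comb : ∀ S X Y Z a b c → a ℕ.+ b ℕ.+ c ≡ S → project (a ·₃ X +₃ b ·₃ Y +₃ c ·₃ Z)
    ≡ apply (affineOf S X Y Z) (+ b , + c)
  project-comb S (x1 , x2 , x3) (y1 , y2 , y3) (z1 , z2 , z3) a b c e =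
    cong₂ _,_ (trans (+-lincomb₃ a b c x2 y2 z2) (lincomb₃-affine a b c x2 y2 z2 S +S≡))
              (trans (+-lincomb₃ a b c x3 y3 z3) (lincomb₃-affine a b c x3 y3 z3 S +S≡))
    where
    +S≡ : + S ≡ + a + + b + + c
    +S≡ = trans (cong +_ (sym e)) (trans (ℤP.pos-+ (a ℕ.+ b) c) (cong (_+ + c) (ℤP.pos-+ a b)))

  childAffine : ℕ → Bool → Fin L → Affine
  childAffine d σ k = affineOf (scale d) (hubBary σ) (pathBary (inject₁ k)) (pathBary (suc k))

  point-inChild : ∀ d σ k (x : Vertex d) → point (suc d) (inChild σ k x) ≡ apply (childAffine d σ k) (point d x)
  point-inChild d σ k x = trans (cong project (bary-inChild d σ k x)) (via-total (bary d x) (total-bary d x))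
    where
    via-total : ∀ t → total t ≡ scale d → project (childBary σ k t) ≡ apply (childAffine d σ k) (project t)
    via-total (a , b , c) e = project-comb (scale d) (hubBary σ) (pathBary (inject₁ k)) (pathBary (suc k)) a b c e

  +-suc : ∀ n → + suc n ≡ + n + + 1
  +-suc n = trans (cong +_ (ℕP.+-comm 1 n)) (ℤP.pos-+ n 1)

  +-2*suc : ∀ n → + (2 ℕ.* suc n) ≡ + 2 * (+ n + + 1)
  +-2*suc n = trans (ℤP.pos-* 2 (suc n)) (cong (+ 2 *_) (+-suc n))

  +W≡ : + W ≡ + 2 * (+ 3 + + L)
  +W≡ = trans (ℤP.pos-* 2 (3 ℕ.+ L)) (cong (+ 2 *_) (ℤP.pos-+ 3 L))

  +-L+2∸inject₁ : ∀ (k : Fin L) → + (L ℕ.+ 2 ℕ.∸ toℕ (inject₁ k)) ≡ + L + + 2 - + toℕ k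
  +-L+2∸inject₁ k = trans (+-L+2∸j (inject₁ k)) (cong (λ z → + L + + 2 - + z) (FP.toℕ-inject₁ k))

  +-L+2∸suc : ∀ (k : Fin L) → + (L ℕ.+ 2 ℕ.∸ suc (toℕ k)) ≡ + L + + 2 - (+ toℕ k + + 1)
  +-L+2∸suc k = trans (+-L+2∸j (suc k)) (cong (λ z → + L + + 2 - z) (+-suc (toℕ k)))

  +-2*suc-inject₁ : ∀ (k : Fin L) → + (2 ℕ.* suc (toℕ (inject₁ k))) ≡ + 2 * (+ toℕ k + + 1)
  +-2*suc-inject₁ k = trans (cong (λ z → + (2 ℕ.* suc z)) (FP.toℕ-inject₁ k)) (+-2*suc (toℕ k))

  +-2*suc-suc : ∀ n → + (2 ℕ.* suc (suc n)) ≡ + 2 * ((+ n + + 1) + + 1)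
  +-2*suc-suc n = trans (+-2*suc (suc n)) (cong (λ z → + 2 * (z + + 1)) (+-suc n))

  private
    det-with-hub : ∀ x (k : Fin L) →
      (+ (L ℕ.+ 2 ℕ.∸ toℕ (inject₁ k)) - + x) * (+ (2 ℕ.* suc (suc (toℕ k))) - + 0) -
        (+ (L ℕ.+ 2 ℕ.∸ suc (toℕ k)) - + x) * (+ (2 ℕ.* suc (toℕ (inject₁ k))) - + 0)
      ≡ + W - + 2 * + x
    det-with-hub x k = begin
      _ ≡⟨ cong₂ _-_ (cong₂ (λ y z → (y - + x) * (z - + 0)) (+-L+2∸inject₁ k) (+-2*suc-suc (toℕ k)))
                     (cong₂ (λ z y → (z - + x) * (y - + 0)) (+-L+2∸suc k) (+-2*suc-inject₁ k)) ⟩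
      _ ≡⟨ expand (+ x) (+ L) (+ toℕ k) ⟩
      _ ≡⟨ cong (_- + 2 * + x) (sym +W≡) ⟩
      + W - + 2 * + x ∎
      where
      open ≡-Reasoning
      expand : ∀ h Lz K →
        ((Lz + + 2 - K) - h) * (+ 2 * ((K + + 1) + + 1) - + 0) - ((Lz + + 2 - (K + + 1)) - h) *
          (+ 2 * (K + + 1) - + 0)
        ≡ + 2 * (+ 3 + Lz) - + 2 * h
      expand = solve-∀

  private
    w-2w : ∀ w → - w ≡ w - + 2 * w
    w-2w = solve-∀

  det-childAffine≢0 : ∀ d σ k → det (childAffine d σ k) ≢ 0ℤ
  det-childAffine≢0 d true k det≡0 with () ← trans (sym (det-with-hub 0 k)) det≡0
  det-childAffine≢0 d false k det≡0 with () ← trans (w-2w (+ W)) (trans (sym (det-with-hub W k)) det≡0)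

  -- The lines separating parts of the drawing: heightForm vanishes on the line hu hv, sideForm σ on
  -- the line carrying the path, rayForm σ j on the line through hub σ and p_j, and gapForm σ k on a
  -- line through p_(k+1) with hub σ and p_k strictly on its positive side.
  heightForm : BaryForm
  heightForm = + 0 , + 0 , + 1

  sideForm : Bool → BaryForm
  sideForm true = + 1 , - + 1 , + 0
  sideForm false = - + 1 , + 1 , + 0

  rayForm : Bool → ℕ → BaryForm
  rayForm true j = + 0 , + 2 * (+ j + + 1) , + j - (+ L + + 2)
  rayForm false j = + 2 * (+ j + + 1) , + 0 , + j - (+ L + + 2)

  gapForm : Bool → ℕ → BaryForm
  gapForm true k = + 1 , + 2 * (+ k + + 1) + + 1 , + k - (+ L + + 2) + + 1
  gapForm false k = + 2 * (+ k + + 1) + + 1 , + 1 , + k - (+ L + + 2) + + 1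

  evalᵇ-pathBary : ∀ α β γ j → evalᵇ (α , β , γ) (pathBary j)
    ≡ α * (+ L + + 2 - + toℕ j) + β * (+ L + + 2 - + toℕ j) + γ * (+ 2 * (+ toℕ j + + 1))
  evalᵇ-pathBary α β γ j = cong₂ (λ u v → α * u + β * u + γ * v) (+-L+2∸j j) (+-2*suc (toℕ j))

  height-hub : ∀ σ → evalᵇ heightForm (hubBary σ) ≡ 0ℤ
  height-hub true = ring-identity (+ W)
    where
    ring-identity : ∀ x → + 0 * x + + 0 * + 0 + + 1 * + 0 ≡ 0ℤ
    ring-identity = solve-∀
  height-hub false = ring-identity (+ W)
    where
    ring-identity : ∀ x → + 0 * + 0 + + 0 * x + + 1 * + 0 ≡ 0ℤ
    ring-identity = solve-∀

  height-path : ∀ j → Pos (evalᵇ heightForm (pathBary j))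
  height-path j = subst Pos (sym (ring-identity (+ (L ℕ.+ 2 ℕ.∸ toℕ j)) (+ (2 ℕ.* suc (toℕ j))))) (_ , refl)
    where
    ring-identity : ∀ x y → + 0 * x + + 0 * x + + 1 * y ≡ y
    ring-identity = solve-∀

  side-hub : ∀ σ → evalᵇ (sideForm σ) (hubBary σ) ≡ + W
  side-hub true = ring-identity (+ W)
    where
    ring-identity : ∀ x → + 1 * x + - + 1 * + 0 + + 0 * + 0 ≡ x
    ring-identity = solve-∀
  side-hub false = ring-identity (+ W)
    where
    ring-identity : ∀ x → - + 1 * + 0 + + 1 * x + + 0 * + 0 ≡ x
    ring-identity = solve-∀

  side-otherHub : ∀ σ → evalᵇ (sideForm σ) (hubBary (not σ)) ≡ - + W
  side-otherHub true = ring-identity (+ W)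
    where
    ring-identity : ∀ x → + 1 * + 0 + - + 1 * x + + 0 * + 0 ≡ - x
    ring-identity = solve-∀
  side-otherHub false = ring-identity (+ W)
    where
    ring-identity : ∀ x → - + 1 * x + + 1 * + 0 + + 0 * + 0 ≡ - x
    ring-identity = solve-∀

  side-path : ∀ σ j → evalᵇ (sideForm σ) (pathBary j) ≡ 0ℤ
  side-path true j = ring-identity (+ (L ℕ.+ 2 ℕ.∸ toℕ j)) (+ (2 ℕ.* suc (toℕ j)))
    where
    ring-identity : ∀ x y → + 1 * x + - + 1 * x + + 0 * y ≡ 0ℤ
    ring-identity = solve-∀
  side-path false j = ring-identity (+ (L ℕ.+ 2 ℕ.∸ toℕ j)) (+ (2 ℕ.* suc (toℕ j)))
    where
    ring-identity : ∀ x y → - + 1 * x + + 1 * x + + 0 * y ≡ 0ℤ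
    ring-identity = solve-∀

  ray-hub : ∀ σ j → evalᵇ (rayForm σ j) (hubBary σ) ≡ 0ℤ
  ray-hub true j = ring-identity (+ W) (+ 2 * (+ j + + 1)) (+ j - (+ L + + 2))
    where
    ring-identity : ∀ x b c → + 0 * x + b * + 0 + c * + 0 ≡ 0ℤ
    ring-identity = solve-∀
  ray-hub false j = ring-identity (+ W) (+ 2 * (+ j + + 1)) (+ j - (+ L + + 2))
    where
    ring-identity : ∀ x a c → a * + 0 + + 0 * x + c * + 0 ≡ 0ℤ
    ring-identity = solve-∀

  ray-path : ∀ σ j i → evalᵇ (rayForm σ j) (pathBary i) ≡ + W * (+ j - + toℕ i)
  ray-path true j i = trans (evalᵇ-pathBary (+ 0) (+ 2 * (+ j + + 1)) (+ j - (+ L + + 2)) i)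
    (trans (ring-identity (+ L) (+ j) (+ toℕ i)) (cong (_* (+ j - + toℕ i)) (sym +W≡)))
    where
    ring-identity : ∀ Lz J I →
      + 0 * (Lz + + 2 - I) + + 2 * (J + + 1) * (Lz + + 2 - I) + (J - (Lz + + 2)) * (+ 2 * (I + + 1))
      ≡ + 2 * (+ 3 + Lz) * (J - I)
    ring-identity = solve-∀
  ray-path false j i = trans (evalᵇ-pathBary (+ 2 * (+ j + + 1)) (+ 0) (+ j - (+ L + + 2)) i)
    (trans (ring-identity (+ L) (+ j) (+ toℕ i)) (cong (_* (+ j - + toℕ i)) (sym +W≡)))
    where
    ring-identity : ∀ Lz J I →
      + 2 * (J + + 1) * (Lz + + 2 - I) + + 0 * (Lz + + 2 - I) + (J - (Lz + + 2)) * (+ 2 * (I + + 1))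
      ≡ + 2 * (+ 3 + Lz) * (J - I)
    ring-identity = solve-∀

  gap-hub : ∀ σ k → evalᵇ (gapForm σ k) (hubBary σ) ≡ + W
  gap-hub true k = ring-identity (+ W) (+ 2 * (+ k + + 1) + + 1) (+ k - (+ L + + 2) + + 1)
    where
    ring-identity : ∀ x b c → + 1 * x + b * + 0 + c * + 0 ≡ x
    ring-identity = solve-∀
  gap-hub false k = ring-identity (+ W) (+ 2 * (+ k + + 1) + + 1) (+ k - (+ L + + 2) + + 1)
    where
    ring-identity : ∀ x a c → a * + 0 + + 1 * x + c * + 0 ≡ x
    ring-identity = solve-∀

  gap-path : ∀ σ k i → evalᵇ (gapForm σ k) (pathBary i) ≡ + W * (+ k - + toℕ i) + + W
  gap-path true k i = trans (evalᵇ-pathBary (+ 1) (+ 2 * (+ k + + 1) + + 1) (+ k - (+ L + + 2) + + 1) i)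
    (trans (ring-identity (+ L) (+ k) (+ toℕ i)) (cong (λ z → z * (+ k - + toℕ i) + z) (sym +W≡)))
    where
    ring-identity : ∀ Lz J I →
      + 1 * (Lz + + 2 - I) + (+ 2 * (J + + 1) + + 1) * (Lz + + 2 - I) + (J - (Lz + + 2) + + 1) * (+ 2 * (I + + 1))
      ≡ + 2 * (+ 3 + Lz) * (J - I) + + 2 * (+ 3 + Lz)
    ring-identity = solve-∀
  gap-path false k i = trans (evalᵇ-pathBary (+ 2 * (+ k + + 1) + + 1) (+ 1) (+ k - (+ L + + 2) + + 1) i)
    (trans (ring-identity (+ L) (+ k) (+ toℕ i)) (cong (λ z → z * (+ k - + toℕ i) + z) (sym +W≡)))
    where
    ring-identity : ∀ Lz J I →
      (+ 2 * (J + + 1) + + 1) * (Lz + + 2 - I) + + 1 * (Lz + + 2 - I) + (J - (Lz + + 2) + + 1) * (+ 2 * (I + + 1))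
      ≡ + 2 * (+ 3 + Lz) * (J - I) + + 2 * (+ 3 + Lz)
    ring-identity = solve-∀

  W>0 : 0 ℕ.< W
  W>0 = s≤s z≤n

  Pos-W : Pos (+ W)
  Pos-W = _ , refl

  <⇒Pos-diff : ∀ i j → i ℕ.< j → Pos (+ j - + i)
  <⇒Pos-diff i j lt = m , trans (cong (λ z → + z - + i) (sym e))
    (trans (cong (_- + i) (ℤP.pos-+ (suc i) m))
    (trans (cong (λ z → z + + m - + i) (+-suc i)) (trans (ring-identity (+ i) (+ m)) (sym (+-suc m)))))
    where
    m : ℕ
    m = j ℕ.∸ suc i
    e : suc i ℕ.+ m ≡ j
    e = ℕP.m+[n∸m]≡n lt
    ring-identity : ∀ I M → I + + 1 + M - I ≡ M + + 1
    ring-identity = solve-∀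

  >⇒Neg-diff : ∀ i j → j ℕ.< i → Neg (+ j - + i)
  >⇒Neg-diff i j lt = subst Neg (sym (ring-identity (+ j) (+ i))) (Pos⇒-Neg (<⇒Pos-diff j i lt))
    where
    ring-identity : ∀ J I → J - I ≡ - (I - J)
    ring-identity = solve-∀

  diff-self : ∀ i → + i - + i ≡ 0ℤ
  diff-self i = ℤP.+-inverseʳ (+ i)

  W*diff-Pos : ∀ i j → i ℕ.< j → Pos (+ W * (+ j - + i))
  W*diff-Pos i j lt = *-Pos W>0 (<⇒Pos-diff i j lt)

  W*diff-Neg : ∀ i j → j ℕ.< i → Neg (+ W * (+ j - + i))
  W*diff-Neg i j lt = *-Neg W>0 (>⇒Neg-diff i j lt)

  W*diff-self : ∀ i → + W * (+ i - + i) ≡ 0ℤ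
  W*diff-self i = trans (cong (+ W *_) (diff-self i)) (ℤP.*-zeroʳ (+ W))

  W*diff-NonNeg : ∀ i j → i ℕ.≤ j → NonNeg (+ W * (+ j - + i))
  W*diff-NonNeg i j le with ℕP.m≤n⇒m<n∨m≡n le
  ... | inj₁ lt = Pos⇒NonNeg (W*diff-Pos i j lt)
  ... | inj₂ refl = ≡0⇒NonNeg (W*diff-self i)

  W*diff-NonPos : ∀ i j → j ℕ.≤ i → NonPos (+ W * (+ j - + i))
  W*diff-NonPos i j le with ℕP.m≤n⇒m<n∨m≡n le
  ... | inj₁ lt = Neg⇒NonPos (W*diff-Neg i j lt)
  ... | inj₂ refl = ≡0⇒NonPos (W*diff-self j)

  gap-Pos : ∀ k i → i ℕ.≤ k → Pos (+ W * (+ k - + i) + + W)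
  gap-Pos k i le = +-NonNeg-Pos (W*diff-NonNeg i k le) Pos-W

  gap-zero : ∀ k → + W * (+ k - + suc k) + + W ≡ 0ℤ
  gap-zero k = trans (cong (λ z → + W * (+ k - z) + + W) (+-suc k)) (ring-identity (+ W) (+ k))
    where
    ring-identity : ∀ S K → S * (K - (K + + 1)) + S ≡ 0ℤ
    ring-identity = solve-∀

module Planarity (L : ℕ) where
  open import Data.Nat as ℕ using (ℕ; zero; suc; s≤s)
  import Data.Nat.Properties as ℕP
  open import Data.Fin using (Fin; zero; suc; toℕ; inject₁)
  import Data.Fin.Properties as FP
  open import Data.Bool using (Bool; true; false; not)
  open import Data.Integer using (ℤ; +_; _+_; _*_; _-_; -_; 0ℤ)
  import Data.Integer.Properties as ℤP
  open import Data.Product using (_×_; _,_; proj₁; proj₂)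
  open import Data.Sum using (_⊎_; inj₁; inj₂)
  open import Data.Empty using (⊥; ⊥-elim)
  open import Relation.Nullary using (¬_; yes; no)
  open import Relation.Binary.Definitions using (Tri; tri<; tri≈; tri>)
  open import Relation.Binary.PropositionalEquality
  open Sign
  open Separation
  open Fan L
  open Drawing L

  bary-hub : ∀ d σ → bary (suc d) (hub σ) ≡ scale d ·₃ hubBary σ
  bary-hub d true = cong (λ z → scale d ℕ.* W , z , z) (sym (ℕP.*-zeroʳ (scale d)))
  bary-hub d false = cong (λ z → z , scale d ℕ.* W , z) (sym (ℕP.*-zeroʳ (scale d)))

  VerticesOffEdges : ℕ → Set
  VerticesOffEdges d = ∀ (w a b : Vertex d) → adjacent d a b ≡ true → w ≢ a → w ≢ b →
                       ¬ OnSeg (point d a) (point d b) (point d w)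

  EdgesApart : ℕ → Set
  EdgesApart d = ∀ (a b x y : Vertex d) → adjacent d a b ≡ true → adjacent d x y ≡ true →
                 a ≢ x → a ≢ y → b ≢ x → b ≢ y → ¬ SegsMeet (point d a) (point d b) (point d x) (point d y)

  -- A vertex-edge or edge-edge pair of the depth-(d+1) drawing either lies in one child, where it is
  -- the affine image of a pair of the depth-d drawing, or is split by one of the lines of Drawing;
  -- the case analysis is on the edge classification and on the relative order of path indices.
  module Step (d : ℕ) (off-edges′ : VerticesOffEdges d) (apart-edges′ : EdgesApart d) where

    pt : Vertex (suc d) → Point
    pt = point (suc d)

    val : BaryForm → Vertex (suc d) → ℤ
    val f x = evalᵇ f (bary (suc d) x)

    form : BaryForm → Form
    form f = toForm (scale (suc d)) f

    eval-form : ∀ f x → eval (form f) (pt x) ≡ val f x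
    eval-form f x = eval-toForm (scale (suc d)) f (bary (suc d) x) (total-bary (suc d) x)

    val-negate : ∀ f x → val (negate f) x ≡ - val f x
    val-negate f x = evalᵇ-negate f (bary (suc d) x)

    Pos⇒Neg-negate : ∀ f x → Pos (val f x) → Neg (val (negate f) x)
    Pos⇒Neg-negate f x p = subst Neg (sym (val-negate f x)) (Pos⇒-Neg p)

    Neg⇒Pos-negate : ∀ f x → Neg (val f x) → Pos (val (negate f) x)
    Neg⇒Pos-negate f x p = subst Pos (sym (val-negate f x)) (Neg⇒-Pos p)

    NonPos⇒NonNeg-negate : ∀ f x → NonPos (val f x) → NonNeg (val (negate f) x)
    NonPos⇒NonNeg-negate f x (m , e) = m , trans (val-negate f x) (trans (cong -_ e) (ℤP.neg-involutive (+ m)))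

    ≡0-negate : ∀ f x → val f x ≡ 0ℤ → val (negate f) x ≡ 0ℤ
    ≡0-negate f x e = trans (val-negate f x) (cong -_ e)

    ¬meet-across : ∀ f {a b x y} → Neg (val f a) → Neg (val f b) → NonNeg (val f x) → NonNeg (val f y) →
      ¬ SegsMeet (pt a) (pt b) (pt x) (pt y)
    ¬meet-across f {a} {b} {x} {y} na nb nx ny =
      ¬SegsMeet-across (form f) (subst Neg (sym (eval-form f a)) na) (subst Neg (sym (eval-form f b)) nb)
        (subst NonNeg (sym (eval-form f x)) nx) (subst NonNeg (sym (eval-form f y)) ny)

    ¬on-across : ∀ f {a b w} → NonNeg (val f a) → NonNeg (val f b) → Neg (val f w) → ¬ OnSeg (pt a) (pt b) (pt w)
    ¬on-across f {a} {b} {w} na nb nw =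
      ¬OnSeg-across (form f) (subst NonNeg (sym (eval-form f a)) na) (subst NonNeg (sym (eval-form f b)) nb)
        (subst Neg (sym (eval-form f w)) nw)

    ¬on-across′ : ∀ f {a b w} → Neg (val f a) → Neg (val f b) → NonNeg (val f w) → ¬ OnSeg (pt a) (pt b) (pt w)
    ¬on-across′ f {a} {b} {w} na nb nw =
      ¬OnSeg-across′ (form f) (subst Neg (sym (eval-form f a)) na) (subst Neg (sym (eval-form f b)) nb)
        (subst NonNeg (sym (eval-form f w)) nw)

    meet-touch⇒on : ∀ f {a b x y} → val f a ≡ 0ℤ → Neg (val f b) → NonNeg (val f x) → NonNeg (val f y) →
      SegsMeet (pt a) (pt b) (pt x) (pt y) → OnSeg (pt x) (pt y) (pt a)
    meet-touch⇒on f {a} {b} {x} {y} za nb nx ny =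
      SegsMeet-touch⇒OnSeg (form f) (trans (eval-form f a) za) (subst Neg (sym (eval-form f b)) nb)
        (subst NonNeg (sym (eval-form f x)) nx) (subst NonNeg (sym (eval-form f y)) ny)

    Clear : BaryForm → Vertex (suc d) → Vertex (suc d) → Vertex (suc d) → Set
    Clear f x y a = Neg (val f a) ⊎ (val f a ≡ 0ℤ × ¬ OnSeg (pt x) (pt y) (pt a))

    ¬meet-avoiding : ∀ f {a b x y} → Clear f x y a → Clear f x y b → NonNeg (val f x) → NonNeg (val f y) →
      (val f a ≡ 0ℤ → val f b ≡ 0ℤ → ⊥) → ¬ SegsMeet (pt a) (pt b) (pt x) (pt y)
    ¬meet-avoiding f {a} {b} {x} {y} (inj₁ na) (inj₁ nb) nx ny _ = ¬meet-across f {a} {b} {x} {y} na nb nx ny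
    ¬meet-avoiding f {a} {b} {x} {y} (inj₂ (za , h)) (inj₁ nb) nx ny _ m = h
      (meet-touch⇒on f {a} {b} {x} {y} za nb nx ny m)
    ¬meet-avoiding f {a} {b} {x} {y} (inj₁ na) (inj₂ (zb , h)) nx ny _ m = h
      (meet-touch⇒on f {b} {a} {x} {y} zb na nx ny (SegsMeet-flip {pt a} {pt b} {pt x} {pt y} m))
    ¬meet-avoiding f (inj₂ (za , _)) (inj₂ (zb , _)) nx ny bz = ⊥-elim (bz za zb)

    scaled : ℤ → ℤ
    scaled e = + scale d * e

    val-hub : ∀ f σ → val f (hub σ) ≡ scaled (evalᵇ f (hubBary σ))
    val-hub f σ = trans (cong (evalᵇ f) (bary-hub d σ)) (evalᵇ-· f (scale d) (hubBary σ))

    val-path : ∀ f j → val f (inner (path j)) ≡ scaled (evalᵇ f (pathBary j))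
    val-path f j = evalᵇ-· f (scale d) (pathBary j)

    scaled-Pos : ∀ {e} → Pos e → Pos (scaled e)
    scaled-Pos = *-Pos (scale>0 d)
    scaled-Neg : ∀ {e} → Neg e → Neg (scaled e)
    scaled-Neg = *-Neg (scale>0 d)
    scaled-NonNeg : ∀ {e} → NonNeg e → NonNeg (scaled e)
    scaled-NonNeg = *-NonNeg (scale d)
    scaled-NonPos : ∀ {e} → NonPos e → NonPos (scaled e)
    scaled-NonPos = *-NonPos (scale d)
    scaled-0 : ∀ {e} → e ≡ 0ℤ → scaled e ≡ 0ℤ
    scaled-0 refl = ℤP.*-zeroʳ (+ scale d)

    val-child-Pos : ∀ f σ k i → NonNeg (evalᵇ f (hubBary σ)) → NonNeg (evalᵇ f (pathBary (inject₁ k))) →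
      NonNeg (evalᵇ f (pathBary (suc k))) →
      (Pos (evalᵇ f (hubBary σ)) ⊎ Pos (evalᵇ f (pathBary (inject₁ k))) ⊎ Pos (evalᵇ f (pathBary (suc k)))) →
      Pos (val f (inner (child σ k i)))
    val-child-Pos f σ k i n0 n1 n2 p = at-interior (bary d (inner i)) (interior-bary d i)
      where
      at-interior : ∀ t → Interior t → Pos (evalᵇ f (childBary σ k t))
      at-interior (a , b , c) (pa , pb , pc) = subst Pos (sym (evalᵇ-childBary f σ k a b c))
        (comb₃-Pos pa pb pc n0 n1 n2 p)

    val-child-Neg : ∀ f σ k i → NonPos (evalᵇ f (hubBary σ)) → NonPos (evalᵇ f (pathBary (inject₁ k))) →
      NonPos (evalᵇ f (pathBary (suc k))) →
      (Neg (evalᵇ f (hubBary σ)) ⊎ Neg (evalᵇ f (pathBary (inject₁ k))) ⊎ Neg (evalᵇ f (pathBary (suc k)))) →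
      Neg (val f (inner (child σ k i)))
    val-child-Neg f σ k i n0 n1 n2 p = at-interior (bary d (inner i)) (interior-bary d i)
      where
      at-interior : ∀ t → Interior t → Neg (evalᵇ f (childBary σ k t))
      at-interior (a , b , c) (pa , pb , pc) = subst Neg (sym (evalᵇ-childBary f σ k a b c))
        (comb₃-Neg pa pb pc n0 n1 n2 p)

    ray-path-inject₁ : ∀ σ j (k : Fin L) → evalᵇ (rayForm σ j) (pathBary (inject₁ k)) ≡ + W * (+ j - + toℕ k)
    ray-path-inject₁ σ j k = trans (ray-path σ j (inject₁ k)) (cong (λ z → + W * (+ j - + z)) (FP.toℕ-inject₁ k))

    ray-path-suc : ∀ σ j (k : Fin L) → evalᵇ (rayForm σ j) (pathBary (suc k)) ≡ + W * (+ j - + suc (toℕ k))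
    ray-path-suc σ j k = ray-path σ j (suc k)

    height-val-hub : ∀ σ → val heightForm (hub σ) ≡ 0ℤ
    height-val-hub σ = trans (val-hub heightForm σ) (scaled-0 (height-hub σ))

    height-val-path : ∀ j → Pos (val heightForm (inner (path j)))
    height-val-path j = subst Pos (sym (val-path heightForm j)) (scaled-Pos (height-path j))

    height-val-child : ∀ σ k i → Pos (val heightForm (inner (child σ k i)))
    height-val-child σ k i = val-child-Pos heightForm σ k i (≡0⇒NonNeg (height-hub σ))
      (Pos⇒NonNeg (height-path (inject₁ k))) (Pos⇒NonNeg (height-path (suc k)))
      (inj₂ (inj₁ (height-path (inject₁ k))))

    side-val-hub : ∀ σ → Pos (val (sideForm σ) (hub σ))
    side-val-hub σ = subst Pos (sym (trans (val-hub (sideForm σ) σ) (cong scaled (side-hub σ)))) (scaled-Pos Pos-W)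

    side-val-otherHub : ∀ σ → Neg (val (sideForm σ) (hub (not σ)))
    side-val-otherHub σ = subst Neg (sym (trans (val-hub (sideForm σ) (not σ)) (cong scaled (side-otherHub σ))))
      (scaled-Neg (Pos⇒-Neg Pos-W))

    side-val-path : ∀ σ j → val (sideForm σ) (inner (path j)) ≡ 0ℤ
    side-val-path σ j = trans (val-path (sideForm σ) j) (scaled-0 (side-path σ j))

    side-val-child : ∀ σ k i → Pos (val (sideForm σ) (inner (child σ k i)))
    side-val-child σ k i = val-child-Pos (sideForm σ) σ k i (subst NonNeg (sym (side-hub σ)) (Pos⇒NonNeg Pos-W))
      (≡0⇒NonNeg (side-path σ (inject₁ k))) (≡0⇒NonNeg (side-path σ (suc k)))
                    (inj₁ (subst Pos (sym (side-hub σ)) Pos-W))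

    side-val-otherChild : ∀ σ k i → Neg (val (sideForm σ) (inner (child (not σ) k i)))
    side-val-otherChild σ k i = val-child-Neg (sideForm σ) (not σ) k i
      (subst NonPos (sym (side-otherHub σ)) (_ , refl)) (≡0⇒NonPos (side-path σ (inject₁ k)))
      (≡0⇒NonPos (side-path σ (suc k)))
                    (inj₁ (subst Neg (sym (side-otherHub σ)) (Pos⇒-Neg Pos-W)))

    ray-val-hub : ∀ σ j → val (rayForm σ j) (hub σ) ≡ 0ℤ
    ray-val-hub σ j = trans (val-hub (rayForm σ j) σ) (scaled-0 (ray-hub σ j))

    ray-val-path : ∀ σ j i → val (rayForm σ j) (inner (path i)) ≡ scaled (+ W * (+ j - + toℕ i))
    ray-val-path σ j i = trans (val-path (rayForm σ j) i) (cong scaled (ray-path σ j i))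

    ray-val-path-Pos : ∀ σ j i → toℕ i ℕ.< j → Pos (val (rayForm σ j) (inner (path i)))
    ray-val-path-Pos σ j i lt = subst Pos (sym (ray-val-path σ j i)) (scaled-Pos (W*diff-Pos _ _ lt))

    ray-val-path-Neg : ∀ σ j i → j ℕ.< toℕ i → Neg (val (rayForm σ j) (inner (path i)))
    ray-val-path-Neg σ j i lt = subst Neg (sym (ray-val-path σ j i)) (scaled-Neg (W*diff-Neg _ _ lt))

    ray-val-path-self : ∀ σ i → val (rayForm σ (toℕ i)) (inner (path i)) ≡ 0ℤ
    ray-val-path-self σ i = trans (ray-val-path σ (toℕ i) i) (scaled-0 (W*diff-self (toℕ i)))

    ray-val-path-NonNeg : ∀ σ j i → toℕ i ℕ.≤ j → NonNeg (val (rayForm σ j) (inner (path i)))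
    ray-val-path-NonNeg σ j i le = subst NonNeg (sym (ray-val-path σ j i)) (scaled-NonNeg (W*diff-NonNeg _ _ le))

    ray-val-path-NonPos : ∀ σ j i → j ℕ.≤ toℕ i → NonPos (val (rayForm σ j) (inner (path i)))
    ray-val-path-NonPos σ j i le = subst NonPos (sym (ray-val-path σ j i)) (scaled-NonPos (W*diff-NonPos _ _ le))

    ray-val-child-Neg : ∀ σ j k i → j ℕ.≤ toℕ k → Neg (val (rayForm σ j) (inner (child σ k i)))
    ray-val-child-Neg σ j k i le = val-child-Neg (rayForm σ j) σ k i (≡0⇒NonPos (ray-hub σ j))
       (subst NonPos (sym (ray-path-inject₁ σ j k)) (W*diff-NonPos _ _ le))
       (subst NonPos (sym (ray-path-suc σ j k)) (Neg⇒NonPos (W*diff-Neg _ _ (s≤s le))))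
       (inj₂ (inj₂ (subst Neg (sym (ray-path-suc σ j k)) (W*diff-Neg _ _ (s≤s le)))))

    ray-val-child-Pos : ∀ σ j k i → toℕ k ℕ.< j → Pos (val (rayForm σ j) (inner (child σ k i)))
    ray-val-child-Pos σ j k i lt = val-child-Pos (rayForm σ j) σ k i (≡0⇒NonNeg (ray-hub σ j))
       (subst NonNeg (sym (ray-path-inject₁ σ j k)) (Pos⇒NonNeg (W*diff-Pos _ _ lt)))
       (subst NonNeg (sym (ray-path-suc σ j k)) (W*diff-NonNeg _ _ lt))
       (inj₂ (inj₁ (subst Pos (sym (ray-path-inject₁ σ j k)) (W*diff-Pos _ _ lt))))

    gap-val-hub : ∀ σ k → Pos (val (gapForm σ k) (hub σ))
    gap-val-hub σ k = subst Pos (sym (trans (val-hub (gapForm σ k) σ) (cong scaled (gap-hub σ k)))) (scaled-Pos Pos-W)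

    gap-path-inject₁ : ∀ σ (k : Fin L) → Pos (evalᵇ (gapForm σ (toℕ k)) (pathBary (inject₁ k)))
    gap-path-inject₁ σ k = subst Pos
      (sym (trans (gap-path σ (toℕ k) (inject₁ k)) (cong (λ z → + W * (+ toℕ k - + z) + + W) (FP.toℕ-inject₁ k))))
      (gap-Pos (toℕ k) (toℕ k) ℕP.≤-refl)

    gap-path-suc : ∀ σ (k : Fin L) → evalᵇ (gapForm σ (toℕ k)) (pathBary (suc k)) ≡ 0ℤ
    gap-path-suc σ k = trans (gap-path σ (toℕ k) (suc k)) (gap-zero (toℕ k))

    gap-val-path : ∀ σ k → Pos (val (gapForm σ (toℕ k)) (inner (path (inject₁ k))))
    gap-val-path σ k = subst Pos (sym (val-path (gapForm σ (toℕ k)) (inject₁ k))) (scaled-Pos (gap-path-inject₁ σ k))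

    gap-val-nextPath : ∀ σ k → val (gapForm σ (toℕ k)) (inner (path (suc k))) ≡ 0ℤ
    gap-val-nextPath σ k = trans (val-path (gapForm σ (toℕ k)) (suc k)) (scaled-0 (gap-path-suc σ k))

    gap-val-child : ∀ σ k i → Pos (val (gapForm σ (toℕ k)) (inner (child σ k i)))
    gap-val-child σ k i = val-child-Pos (gapForm σ (toℕ k)) σ k i
      (subst NonNeg (sym (gap-hub σ (toℕ k))) (Pos⇒NonNeg Pos-W)) (Pos⇒NonNeg (gap-path-inject₁ σ k))
      (≡0⇒NonNeg (gap-path-suc σ k))
                   (inj₁ (subst Pos (sym (gap-hub σ (toℕ k))) Pos-W))

    OnSeg-cong : ∀ {p q w p' q' w'} → p ≡ p' → q ≡ q' → w ≡ w' → OnSeg p q w → OnSeg p' q' w'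
    OnSeg-cong refl refl refl x = x

    SegsMeet-cong : ∀ {p q r t p' q' r' t'} → p ≡ p' → q ≡ q' → r ≡ r' → t ≡ t' → SegsMeet p q r t →
      SegsMeet p' q' r' t'
    SegsMeet-cong refl refl refl refl x = x

    off-inChild : ∀ σ k (a' b' w' : Vertex d) → adjacent d a' b' ≡ true → w' ≢ a' → w' ≢ b' →
      ¬ OnSeg (pt (inChild σ k a')) (pt (inChild σ k b')) (pt (inChild σ k w'))
    off-inChild σ k a' b' w' adj n1 n2 os =
      off-edges′ w' a' b' adj n1 n2 (OnSeg-reflect (childAffine d σ k) (det-childAffine≢0 d σ k)
        (OnSeg-cong (point-inChild d σ k a') (point-inChild d σ k b') (point-inChild d σ k w') os))

    apart-inChild : ∀ σ k (a' b' x' y' : Vertex d) → adjacent d a' b' ≡ true → adjacent d x' y' ≡ true → a' ≢ x' →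
      a' ≢ y' → b' ≢ x' → b' ≢ y' →
      ¬ SegsMeet (pt (inChild σ k a')) (pt (inChild σ k b')) (pt (inChild σ k x')) (pt (inChild σ k y'))
    apart-inChild σ k a' b' x' y' adj1 adj2 n1 n2 n3 n4 m =
      apart-edges′ a' b' x' y' adj1 adj2 n1 n2 n3 n4
        (SegsMeet-reflect (childAffine d σ k) (det-childAffine≢0 d σ k)
          (SegsMeet-cong (point-inChild d σ k a') (point-inChild d σ k b') (point-inChild d σ k x')
          (point-inChild d σ k y') m))

    side-child-NonNeg : ∀ σ k (x : Vertex d) → NonNeg (val (sideForm σ) (inChild σ k x))
    side-child-NonNeg true k hu = Pos⇒NonNeg (side-val-hub true)
    side-child-NonNeg false k hu = Pos⇒NonNeg (side-val-hub false)
    side-child-NonNeg σ k hv = ≡0⇒NonNeg (side-val-path σ (inject₁ k))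
    side-child-NonNeg σ k (inner i) = Pos⇒NonNeg (side-val-child σ k i)

    gap-child-Pos : ∀ σ k (x : Vertex d) → Pos (val (gapForm σ (toℕ k)) (inChild σ k x))
    gap-child-Pos true k hu = gap-val-hub true (toℕ k)
    gap-child-Pos false k hu = gap-val-hub false (toℕ k)
    gap-child-Pos σ k hv = gap-val-path σ k
    gap-child-Pos σ k (inner i) = gap-val-child σ k i

    ≤inject₁ : ∀ (k : Fin L) → toℕ (inject₁ k) ℕ.≤ toℕ k
    ≤inject₁ k = ℕP.≤-reflexive (FP.toℕ-inject₁ k)

    ≥inject₁ : ∀ (k : Fin L) → toℕ k ℕ.≤ toℕ (inject₁ k)
    ≥inject₁ k = ℕP.≤-reflexive (sym (FP.toℕ-inject₁ k))

    ray-child-NonPos : ∀ σ k (x : Vertex d) → NonPos (val (rayForm σ (toℕ k)) (inChild σ k x))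
    ray-child-NonPos true k hu = ≡0⇒NonPos (ray-val-hub true (toℕ k))
    ray-child-NonPos false k hu = ≡0⇒NonPos (ray-val-hub false (toℕ k))
    ray-child-NonPos σ k hv = ray-val-path-NonPos σ (toℕ k) (inject₁ k) (≥inject₁ k)
    ray-child-NonPos σ k (inner i) = Neg⇒NonPos (ray-val-child-Neg σ (toℕ k) k i ℕP.≤-refl)

    nextRay-child-NonNeg : ∀ σ k (x : Vertex d) → NonNeg (val (rayForm σ (suc (toℕ k))) (inChild σ k x))
    nextRay-child-NonNeg true k hu = ≡0⇒NonNeg (ray-val-hub true (suc (toℕ k)))
    nextRay-child-NonNeg false k hu = ≡0⇒NonNeg (ray-val-hub false (suc (toℕ k)))
    nextRay-child-NonNeg σ k hv = ray-val-path-NonNeg σ (suc (toℕ k)) (inject₁ k) (ℕP.m≤n⇒m≤1+n (≤inject₁ k))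
    nextRay-child-NonNeg σ k (inner i) = Pos⇒NonNeg (ray-val-child-Pos σ (suc (toℕ k)) k i ℕP.≤-refl)

    nextRay-child-Pos : ∀ σ k (x : Vertex d) → (x ≡ hu) ⊎ Pos (val (rayForm σ (suc (toℕ k))) (inChild σ k x))
    nextRay-child-Pos σ k hu = inj₁ refl
    nextRay-child-Pos σ k hv = inj₂ (ray-val-path-Pos σ (suc (toℕ k)) (inject₁ k) (s≤s (≤inject₁ k)))
    nextRay-child-Pos σ k (inner i) = inj₂ (ray-val-child-Pos σ (suc (toℕ k)) k i ℕP.≤-refl)

    height-child-Pos : ∀ σ k (x : Vertex d) → (x ≡ hu) ⊎ Pos (val heightForm (inChild σ k x))
    height-child-Pos σ k hu = inj₁ refl
    height-child-Pos σ k hv = inj₂ (height-val-path (inject₁ k))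
    height-child-Pos σ k (inner i) = inj₂ (height-val-child σ k i)

    side-child-Pos : ∀ σ k (x : Vertex d) → (x ≡ hv) ⊎ Pos (val (sideForm σ) (inChild σ k x))
    side-child-Pos true k hu = inj₂ (side-val-hub true)
    side-child-Pos false k hu = inj₂ (side-val-hub false)
    side-child-Pos σ k hv = inj₁ refl
    side-child-Pos σ k (inner i) = inj₂ (side-val-child σ k i)

    side-otherChild-Neg : ∀ σ k (x : Vertex d) → (x ≡ hv) ⊎ Neg (val (sideForm σ) (inChild (not σ) k x))
    side-otherChild-Neg true k hu = inj₂ (side-val-otherHub true)
    side-otherChild-Neg false k hu = inj₂ (side-val-otherHub false)
    side-otherChild-Neg σ k hv = inj₁ refl
    side-otherChild-Neg σ k (inner i) = inj₂ (side-val-otherChild σ k i)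

    nextRay-laterChild-NonPos : ∀ σ (k k' : Fin L) (x : Vertex d) → toℕ k ℕ.< toℕ k' →
      NonPos (val (rayForm σ (suc (toℕ k))) (inChild σ k' x))
    nextRay-laterChild-NonPos true k k' hu lt = ≡0⇒NonPos (ray-val-hub true (suc (toℕ k)))
    nextRay-laterChild-NonPos false k k' hu lt = ≡0⇒NonPos (ray-val-hub false (suc (toℕ k)))
    nextRay-laterChild-NonPos σ k k' hv lt = ray-val-path-NonPos σ (suc (toℕ k)) (inject₁ k')
      (ℕP.≤-trans lt (≥inject₁ k'))
    nextRay-laterChild-NonPos σ k k' (inner i) lt = Neg⇒NonPos (ray-val-child-Neg σ (suc (toℕ k)) k' i lt)

    off-HH : ∀ w → w ≢ hu → w ≢ hv → ¬ OnSeg (pt hu) (pt hv) (pt w)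
    off-HH hu n1 n2 = ⊥-elim (n1 refl)
    off-HH hv n1 n2 = ⊥-elim (n2 refl)
    off-HH (inner (path j)) _ _ = ¬on-across (negate heightForm) {hu} {hv} {inner (path j)}
      (≡0⇒NonNeg (≡0-negate heightForm hu (height-val-hub true)))
      (≡0⇒NonNeg (≡0-negate heightForm hv (height-val-hub false)))
      (Pos⇒Neg-negate heightForm (inner (path j)) (height-val-path j))
    off-HH (inner (child σ k i)) _ _ = ¬on-across (negate heightForm) {hu} {hv} {inner (child σ k i)}
      (≡0⇒NonNeg (≡0-negate heightForm hu (height-val-hub true)))
      (≡0⇒NonNeg (≡0-negate heightForm hv (height-val-hub false)))
      (Pos⇒Neg-negate heightForm (inner (child σ k i)) (height-val-child σ k i))

    off-HP-otherHub : ∀ σ j → ¬ OnSeg (pt (hub σ)) (pt (inner (path j))) (pt (hub (not σ)))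
    off-HP-otherHub σ j = ¬on-across (sideForm σ) {hub σ} {inner (path j)} {hub (not σ)} (Pos⇒NonNeg (side-val-hub σ))
      (≡0⇒NonNeg (side-val-path σ j)) (side-val-otherHub σ)

    off-HP-path : ∀ σ j i → inner (path i) ≢ inner (path j) →
      Tri (toℕ i ℕ.< toℕ j) (toℕ i ≡ toℕ j) (toℕ j ℕ.< toℕ i) →
      ¬ OnSeg (pt (hub σ)) (pt (inner (path j))) (pt (inner (path i)))
    off-HP-path σ j i n (tri< lt _ _) = ¬on-across (negate (rayForm σ (toℕ j))) {hub σ} {inner (path j)}
      {inner (path i)}
      (≡0⇒NonNeg (≡0-negate (rayForm σ (toℕ j)) (hub σ) (ray-val-hub σ (toℕ j))))
        (≡0⇒NonNeg (≡0-negate (rayForm σ (toℕ j)) (inner (path j)) (ray-val-path-self σ j)))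
      (Pos⇒Neg-negate (rayForm σ (toℕ j)) (inner (path i)) (ray-val-path-Pos σ (toℕ j) i lt))
    off-HP-path σ j i n (tri≈ _ eq _) = ⊥-elim (n (cong (λ z → inner (path {d} z)) (FP.toℕ-injective eq)))
    off-HP-path σ j i n (tri> _ _ gt) = ¬on-across (rayForm σ (toℕ j)) {hub σ} {inner (path j)} {inner (path i)}
      (≡0⇒NonNeg (ray-val-hub σ (toℕ j))) (≡0⇒NonNeg (ray-val-path-self σ j)) (ray-val-path-Neg σ (toℕ j) i gt)

    off-HP-child : ∀ σ j k i → (toℕ j ℕ.≤ toℕ k) ⊎ (toℕ k ℕ.< toℕ j) →
      ¬ OnSeg (pt (hub σ)) (pt (inner (path j))) (pt (inner (child σ k i)))
    off-HP-child σ j k i (inj₁ le) = ¬on-across (rayForm σ (toℕ j)) {hub σ} {inner (path j)} {inner (child σ k i)}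
      (≡0⇒NonNeg (ray-val-hub σ (toℕ j))) (≡0⇒NonNeg (ray-val-path-self σ j)) (ray-val-child-Neg σ (toℕ j) k i le)
    off-HP-child σ j k i (inj₂ lt) = ¬on-across (negate (rayForm σ (toℕ j))) {hub σ} {inner (path j)}
      {inner (child σ k i)}
      (≡0⇒NonNeg (≡0-negate (rayForm σ (toℕ j)) (hub σ) (ray-val-hub σ (toℕ j))))
        (≡0⇒NonNeg (≡0-negate (rayForm σ (toℕ j)) (inner (path j)) (ray-val-path-self σ j)))
      (Pos⇒Neg-negate (rayForm σ (toℕ j)) (inner (child σ k i)) (ray-val-child-Pos σ (toℕ j) k i lt))

    off-HP-otherChild : ∀ σ j k i → ¬ OnSeg (pt (hub σ)) (pt (inner (path j))) (pt (inner (child (not σ) k i)))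
    off-HP-otherChild σ j k i = ¬on-across (sideForm σ) {hub σ} {inner (path j)} {inner (child (not σ) k i)}
      (Pos⇒NonNeg (side-val-hub σ)) (≡0⇒NonNeg (side-val-path σ j)) (side-val-otherChild σ k i)

    off-HP : ∀ σ j w → w ≢ hub σ → w ≢ inner (path j) → ¬ OnSeg (pt (hub σ)) (pt (inner (path j))) (pt w)
    off-HP true j hu n1 _ = ⊥-elim (n1 refl)
    off-HP true j hv _ _ = off-HP-otherHub true j
    off-HP false j hv n1 _ = ⊥-elim (n1 refl)
    off-HP false j hu _ _ = off-HP-otherHub false j
    off-HP σ j (inner (path i)) _ n2 = off-HP-path σ j i n2 (ℕP.<-cmp (toℕ i) (toℕ j))
    off-HP true j (inner (child true k i)) _ _ = off-HP-child true j k i (ℕP.≤-<-connex (toℕ j) (toℕ k))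
    off-HP true j (inner (child false k i)) _ _ = off-HP-otherChild true j k i
    off-HP false j (inner (child false k i)) _ _ = off-HP-child false j k i (ℕP.≤-<-connex (toℕ j) (toℕ k))
    off-HP false j (inner (child true k i)) _ _ = off-HP-otherChild false j k i

    off-PP-hub : ∀ σ (j : Fin L) → ¬ OnSeg (pt (inner (path (inject₁ j)))) (pt (inner (path (suc j)))) (pt (hub σ))
    off-PP-hub σ j = ¬on-across (negate (sideForm σ)) {inner (path (inject₁ j))} {inner (path (suc j))} {hub σ}
      (≡0⇒NonNeg (≡0-negate (sideForm σ) (inner (path (inject₁ j))) (side-val-path σ (inject₁ j))))
        (≡0⇒NonNeg (≡0-negate (sideForm σ) (inner (path (suc j))) (side-val-path σ (suc j))))
        (Pos⇒Neg-negate (sideForm σ) (hub σ) (side-val-hub σ))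

    off-PP-child : ∀ σ (j : Fin L) k i →
      ¬ OnSeg (pt (inner (path (inject₁ j)))) (pt (inner (path (suc j)))) (pt (inner (child σ k i)))
    off-PP-child σ j k i = ¬on-across (negate (sideForm σ)) {inner (path (inject₁ j))} {inner (path (suc j))}
      {inner (child σ k i)}
      (≡0⇒NonNeg (≡0-negate (sideForm σ) (inner (path (inject₁ j))) (side-val-path σ (inject₁ j))))
        (≡0⇒NonNeg (≡0-negate (sideForm σ) (inner (path (suc j))) (side-val-path σ (suc j))))
        (Pos⇒Neg-negate (sideForm σ) (inner (child σ k i)) (side-val-child σ k i))

    off-PP-laterPath : ∀ (j : Fin L) i → toℕ j ℕ.< toℕ i → inner (path i) ≢ inner (path (suc j)) →
      Tri (toℕ i ℕ.< suc (toℕ j)) (toℕ i ≡ suc (toℕ j)) (suc (toℕ j) ℕ.< toℕ i) →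
      ¬ OnSeg (pt (inner (path (inject₁ j)))) (pt (inner (path (suc j)))) (pt (inner (path i)))
    off-PP-laterPath j i g n (tri< lt _ _) = ⊥-elim (ℕP.<⇒≱ g (ℕP.≤-pred lt))
    off-PP-laterPath j i g n (tri≈ _ eq _) = ⊥-elim (n (cong (λ z → inner (path {d} z)) (FP.toℕ-injective eq)))
    off-PP-laterPath j i g n (tri> _ _ gt) = ¬on-across (rayForm true (suc (toℕ j))) {inner (path (inject₁ j))}
      {inner (path (suc j))} {inner (path i)}
      (Pos⇒NonNeg (ray-val-path-Pos true (suc (toℕ j)) (inject₁ j) (s≤s (≤inject₁ j))))
        (≡0⇒NonNeg (ray-val-path-self true (suc j))) (ray-val-path-Neg true (suc (toℕ j)) i gt)

    off-PP-path : ∀ (j : Fin L) i → inner (path i) ≢ inner (path (inject₁ j)) →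
      inner (path i) ≢ inner (path (suc j)) → Tri (toℕ i ℕ.< toℕ j) (toℕ i ≡ toℕ j) (toℕ j ℕ.< toℕ i) →
      ¬ OnSeg (pt (inner (path (inject₁ j)))) (pt (inner (path (suc j)))) (pt (inner (path i)))
    off-PP-path j i n1 n2 (tri< lt _ _) = ¬on-across (negate (rayForm true (toℕ (inject₁ j))))
      {inner (path (inject₁ j))} {inner (path (suc j))} {inner (path i)}
      (≡0⇒NonNeg (≡0-negate (rayForm true (toℕ (inject₁ j))) (inner (path (inject₁ j)))
        (ray-val-path-self true (inject₁ j))))
      (Pos⇒NonNeg (Neg⇒Pos-negate (rayForm true (toℕ (inject₁ j))) (inner (path (suc j)))
        (ray-val-path-Neg true (toℕ (inject₁ j)) (suc j) (s≤s (≤inject₁ j)))))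
      (Pos⇒Neg-negate (rayForm true (toℕ (inject₁ j))) (inner (path i))
        (ray-val-path-Pos true (toℕ (inject₁ j)) i (ℕP.≤-trans lt (≥inject₁ j))))
    off-PP-path j i n1 n2 (tri≈ _ eq _) = ⊥-elim
      (n1 (cong (λ z → inner (path {d} z)) (FP.toℕ-injective (trans eq (sym (FP.toℕ-inject₁ j))))))
    off-PP-path j i n1 n2 (tri> _ _ gt) = off-PP-laterPath j i gt n2 (ℕP.<-cmp (toℕ i) (suc (toℕ j)))

    off-PP : ∀ (j : Fin L) w → w ≢ inner (path (inject₁ j)) → w ≢ inner (path (suc j)) →
      ¬ OnSeg (pt (inner (path (inject₁ j)))) (pt (inner (path (suc j)))) (pt w)
    off-PP j hu _ _ = off-PP-hub true j
    off-PP j hv _ _ = off-PP-hub false j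
    off-PP j (inner (path i)) n1 n2 = off-PP-path j i n1 n2 (ℕP.<-cmp (toℕ i) (toℕ j))
    off-PP j (inner (child σ k i)) _ _ = off-PP-child σ j k i

    module _ (σ : Bool) (k : Fin L) (a' b' : Vertex d) (adj : adjacent d a' b' ≡ true) where
      end₁ end₂ : Point
      end₁ = pt (inChild σ k a')
      end₂ = pt (inChild σ k b')

      off-C-inChild : ∀ w' → inChild σ k w' ≢ inChild σ k a' → inChild σ k w' ≢ inChild σ k b' →
        ¬ OnSeg end₁ end₂ (pt (inChild σ k w'))
      off-C-inChild w' n1 n2 = off-inChild σ k a' b' w' adj (inChild-≢ σ k n1) (inChild-≢ σ k n2)

      off-C-otherHub : ¬ OnSeg end₁ end₂ (pt (hub (not σ)))
      off-C-otherHub = ¬on-across (sideForm σ) {inChild σ k a'} {inChild σ k b'} {hub (not σ)}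
        (side-child-NonNeg σ k a') (side-child-NonNeg σ k b') (side-val-otherHub σ)

      off-C-nextPath : ¬ OnSeg end₁ end₂ (pt (inner (path (suc k))))
      off-C-nextPath = ¬on-across′ (negate (gapForm σ (toℕ k))) {inChild σ k a'} {inChild σ k b'}
        {inner (path (suc k))}
        (Pos⇒Neg-negate (gapForm σ (toℕ k)) (inChild σ k a') (gap-child-Pos σ k a'))
          (Pos⇒Neg-negate (gapForm σ (toℕ k)) (inChild σ k b') (gap-child-Pos σ k b'))
        (≡0⇒NonNeg (≡0-negate (gapForm σ (toℕ k)) (inner (path (suc k))) (gap-val-nextPath σ k)))

      off-C-earlierPath : ∀ i → toℕ i ℕ.< toℕ k → ¬ OnSeg end₁ end₂ (pt (inner (path i)))
      off-C-earlierPath i lt = ¬on-across (negate (rayForm σ (toℕ k))) {inChild σ k a'} {inChild σ k b'}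
        {inner (path i)}
        (NonPos⇒NonNeg-negate (rayForm σ (toℕ k)) (inChild σ k a') (ray-child-NonPos σ k a'))
          (NonPos⇒NonNeg-negate (rayForm σ (toℕ k)) (inChild σ k b') (ray-child-NonPos σ k b'))
        (Pos⇒Neg-negate (rayForm σ (toℕ k)) (inner (path i)) (ray-val-path-Pos σ (toℕ k) i lt))

      off-C-laterPath : ∀ i → suc (toℕ k) ℕ.< toℕ i → ¬ OnSeg end₁ end₂ (pt (inner (path i)))
      off-C-laterPath i gt = ¬on-across (rayForm σ (suc (toℕ k))) {inChild σ k a'} {inChild σ k b'} {inner (path i)}
        (nextRay-child-NonNeg σ k a') (nextRay-child-NonNeg σ k b') (ray-val-path-Neg σ (suc (toℕ k)) i gt)

      off-C-earlierChild : ∀ k' i → toℕ k' ℕ.< toℕ k → ¬ OnSeg end₁ end₂ (pt (inner (child σ k' i)))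
      off-C-earlierChild k' i lt = ¬on-across (negate (rayForm σ (toℕ k))) {inChild σ k a'} {inChild σ k b'}
        {inner (child σ k' i)}
        (NonPos⇒NonNeg-negate (rayForm σ (toℕ k)) (inChild σ k a') (ray-child-NonPos σ k a'))
          (NonPos⇒NonNeg-negate (rayForm σ (toℕ k)) (inChild σ k b') (ray-child-NonPos σ k b'))
        (Pos⇒Neg-negate (rayForm σ (toℕ k)) (inner (child σ k' i)) (ray-val-child-Pos σ (toℕ k) k' i lt))

      off-C-laterChild : ∀ k' i → toℕ k ℕ.< toℕ k' → ¬ OnSeg end₁ end₂ (pt (inner (child σ k' i)))
      off-C-laterChild k' i gt = ¬on-across (rayForm σ (suc (toℕ k))) {inChild σ k a'} {inChild σ k b'}
        {inner (child σ k' i)}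
        (nextRay-child-NonNeg σ k a') (nextRay-child-NonNeg σ k b') (ray-val-child-Neg σ (suc (toℕ k)) k' i gt)

      off-C-otherChild : ∀ k' i → ¬ OnSeg end₁ end₂ (pt (inner (child (not σ) k' i)))
      off-C-otherChild k' i = ¬on-across (sideForm σ) {inChild σ k a'} {inChild σ k b'} {inner (child (not σ) k' i)}
        (side-child-NonNeg σ k a') (side-child-NonNeg σ k b') (side-val-otherChild σ k' i)

      off-C-ownPath : ∀ i → inject₁ k ≡ i → inner (path i) ≢ inChild σ k a' → inner (path i) ≢ inChild σ k b' →
        ¬ OnSeg end₁ end₂ (pt (inner (path i)))
      off-C-ownPath .(inject₁ k) refl n1 n2 = off-C-inChild hv n1 n2

      off-C-pathAfter : ∀ i → toℕ k ℕ.< toℕ i →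
        Tri (toℕ i ℕ.< suc (toℕ k)) (toℕ i ≡ suc (toℕ k)) (suc (toℕ k) ℕ.< toℕ i) →
        ¬ OnSeg end₁ end₂ (pt (inner (path i)))
      off-C-pathAfter i g (tri< lt _ _) = ⊥-elim (ℕP.<⇒≱ g (ℕP.≤-pred lt))
      off-C-pathAfter i g (tri≈ _ eq _) = subst (λ z → ¬ OnSeg end₁ end₂ (pt (inner (path z))))
        (FP.toℕ-injective (sym eq)) off-C-nextPath
      off-C-pathAfter i g (tri> _ _ gt) = off-C-laterPath i gt

      off-C-path : ∀ i → inner (path i) ≢ inChild σ k a' → inner (path i) ≢ inChild σ k b' →
        Tri (toℕ i ℕ.< toℕ k) (toℕ i ≡ toℕ k) (toℕ k ℕ.< toℕ i) → ¬ OnSeg end₁ end₂ (pt (inner (path i)))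
      off-C-path i n1 n2 (tri< lt _ _) = off-C-earlierPath i lt
      off-C-path i n1 n2 (tri≈ _ eq _) = off-C-ownPath i (FP.toℕ-injective (trans (FP.toℕ-inject₁ k) (sym eq))) n1 n2
      off-C-path i n1 n2 (tri> _ _ gt) = off-C-pathAfter i gt (ℕP.<-cmp (toℕ i) (suc (toℕ k)))

      off-C-sameChild : ∀ k' i → k ≡ k' → inner (child σ k' i) ≢ inChild σ k a' →
        inner (child σ k' i) ≢ inChild σ k b' → ¬ OnSeg end₁ end₂ (pt (inner (child σ k' i)))
      off-C-sameChild .k i refl n1 n2 = off-C-inChild (inner i) n1 n2

      off-C-child : ∀ k' i → inner (child σ k' i) ≢ inChild σ k a' → inner (child σ k' i) ≢ inChild σ k b' →
        Tri (toℕ k' ℕ.< toℕ k) (toℕ k' ≡ toℕ k) (toℕ k ℕ.< toℕ k') → ¬ OnSeg end₁ end₂ (pt (inner (child σ k' i)))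
      off-C-child k' i n1 n2 (tri< lt _ _) = off-C-earlierChild k' i lt
      off-C-child k' i n1 n2 (tri≈ _ eq _) = off-C-sameChild k' i (FP.toℕ-injective (sym eq)) n1 n2
      off-C-child k' i n1 n2 (tri> _ _ gt) = off-C-laterChild k' i gt

    off-C : ∀ σ k a' b' (adj : adjacent d a' b' ≡ true) w → w ≢ inChild σ k a' → w ≢ inChild σ k b' →
      ¬ OnSeg (pt (inChild σ k a')) (pt (inChild σ k b')) (pt w)
    off-C true k a' b' adj hu n1 n2 = off-C-inChild true k a' b' adj hu n1 n2
    off-C true k a' b' adj hv n1 n2 = off-C-otherHub true k a' b' adj
    off-C false k a' b' adj hv n1 n2 = off-C-inChild false k a' b' adj hu n1 n2
    off-C false k a' b' adj hu n1 n2 = off-C-otherHub false k a' b' adj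
    off-C σ k a' b' adj (inner (path i)) n1 n2 = off-C-path σ k a' b' adj i n1 n2 (ℕP.<-cmp (toℕ i) (toℕ k))
    off-C true k a' b' adj (inner (child true k' i)) n1 n2 = off-C-child true k a' b' adj k' i n1 n2
      (ℕP.<-cmp (toℕ k') (toℕ k))
    off-C true k a' b' adj (inner (child false k' i)) n1 n2 = off-C-otherChild true k a' b' adj k' i
    off-C false k a' b' adj (inner (child false k' i)) n1 n2 = off-C-child false k a' b' adj k' i n1 n2
      (ℕP.<-cmp (toℕ k') (toℕ k))
    off-C false k a' b' adj (inner (child true k' i)) n1 n2 = off-C-otherChild false k a' b' adj k' i

    off-edge : ∀ {a b} → Edge a b → ∀ w → w ≢ a → w ≢ b → ¬ OnSeg (pt a) (pt b) (pt w)
    off-edge hub-hub w = off-HH w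
    off-edge (hub-path σ j) w = off-HP σ j w
    off-edge (path-path j) w = off-PP j w
    off-edge (in-child σ k {a'} {b'} adj) w = off-C σ k a' b' adj w

    off-edges : ∀ (w a b : Vertex (suc d)) → adjacent (suc d) a b ≡ true → w ≢ a → w ≢ b →
      ¬ OnSeg (pt a) (pt b) (pt w)
    off-edges w a b adj n1 n2 with classify-edge d a b adj
    ... | inj₁ e = off-edge e w n1 n2
    ... | inj₂ e = λ os → off-edge e w n2 n1 (OnSeg-flip {pt a} {pt b} {pt w} os)

    ¬meet-swap : ∀ {a b x y : Vertex (suc d)} → ¬ SegsMeet (pt x) (pt y) (pt a) (pt b) →
      ¬ SegsMeet (pt a) (pt b) (pt x) (pt y)
    ¬meet-swap {a} {b} {x} {y} h m = h (SegsMeet-swap {pt a} {pt b} {pt x} {pt y} m)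

    hub-not-both : ∀ σ → hub {suc d} σ ≢ hu → hub {suc d} σ ≢ hv → ⊥
    hub-not-both true n1 n2 = n1 refl
    hub-not-both false n1 n2 = n2 refl

    path≢hub : ∀ σ j → inner {suc d} (path j) ≢ hub σ
    path≢hub true j ()
    path≢hub false j ()

    apart-HH-PP : ∀ (m : Fin L) →
      ¬ SegsMeet (pt hu) (pt hv) (pt (inner (path (inject₁ m)))) (pt (inner (path (suc m))))
    apart-HH-PP m = ¬meet-swap {hu} {hv} {inner (path (inject₁ m))} {inner (path (suc m))}
      (¬meet-across (negate heightForm) {inner (path (inject₁ m))} {inner (path (suc m))} {hu} {hv}
        (Pos⇒Neg-negate heightForm (inner (path (inject₁ m))) (height-val-path (inject₁ m)))
          (Pos⇒Neg-negate heightForm (inner (path (suc m))) (height-val-path (suc m)))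
        (≡0⇒NonNeg (≡0-negate heightForm hu (height-val-hub true)))
          (≡0⇒NonNeg (≡0-negate heightForm hv (height-val-hub false))))

    height-child-Neg : ∀ σ k (x : Vertex d) → inChild σ k x ≢ hu → inChild σ k x ≢ hv →
      Neg (val (negate heightForm) (inChild σ k x))
    height-child-Neg σ k x n1 n2 with height-child-Pos σ k x
    ... | inj₁ refl = ⊥-elim (hub-not-both σ n1 n2)
    ... | inj₂ p = Pos⇒Neg-negate heightForm (inChild σ k x) p

    apart-C-HH : ∀ σ k (a' b' : Vertex d) → inChild σ k a' ≢ hu → inChild σ k a' ≢ hv → inChild σ k b' ≢ hu →
      inChild σ k b' ≢ hv → ¬ SegsMeet (pt (inChild σ k a')) (pt (inChild σ k b')) (pt hu) (pt hv)
    apart-C-HH σ k a' b' n1 n2 n3 n4 = ¬meet-across (negate heightForm) {inChild σ k a'} {inChild σ k b'} {hu} {hv}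
      (height-child-Neg σ k a' n1 n2) (height-child-Neg σ k b' n3 n4)
        (≡0⇒NonNeg (≡0-negate heightForm hu (height-val-hub true)))
        (≡0⇒NonNeg (≡0-negate heightForm hv (height-val-hub false)))

    apart-HP-otherHP : ∀ σ j j' → inner (path j') ≢ inner (path j) →
      ¬ SegsMeet (pt (hub (not σ))) (pt (inner (path j'))) (pt (hub σ)) (pt (inner (path j)))
    apart-HP-otherHP σ j j' n = ¬meet-avoiding (sideForm σ) {hub (not σ)} {inner (path j')} {hub σ} {inner (path j)}
      (inj₁ (side-val-otherHub σ)) (inj₂ (side-val-path σ j' , off-HP σ j (inner (path j')) (path≢hub σ j') n))
      (Pos⇒NonNeg (side-val-hub σ)) (≡0⇒NonNeg (side-val-path σ j)) (λ za _ → Neg⇒≢0 (side-val-otherHub σ) za)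

    apart-HP-PP : ∀ σ j (m : Fin L) → inner (path j) ≢ inner (path (inject₁ m)) →
      inner (path j) ≢ inner (path (suc m)) →
      ¬ SegsMeet (pt (hub σ)) (pt (inner (path j))) (pt (inner (path (inject₁ m)))) (pt (inner (path (suc m))))
    apart-HP-PP σ j m n1 n2 = ¬meet-avoiding (negate (sideForm σ)) {hub σ} {inner (path j)} {inner (path (inject₁ m))}
      {inner (path (suc m))}
      (inj₁ (Pos⇒Neg-negate (sideForm σ) (hub σ) (side-val-hub σ)))
        (inj₂ (≡0-negate (sideForm σ) (inner (path j)) (side-val-path σ j) , off-PP m (inner (path j)) n1 n2))
      (≡0⇒NonNeg (≡0-negate (sideForm σ) (inner (path (inject₁ m))) (side-val-path σ (inject₁ m))))
        (≡0⇒NonNeg (≡0-negate (sideForm σ) (inner (path (suc m))) (side-val-path σ (suc m))))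
      (λ za _ → Neg⇒≢0 (Pos⇒Neg-negate (sideForm σ) (hub σ) (side-val-hub σ)) za)

    ¬meet-avoiding-child : ∀ f σ k (a' b' t : Vertex d) {x y} → adjacent d a' b' ≡ true →
      ((a' ≡ t) ⊎ Neg (val f (inChild σ k a'))) → ((b' ≡ t) ⊎ Neg (val f (inChild σ k b'))) →
      val f (inChild σ k t) ≡ 0ℤ →
      (inChild σ k t ≢ x → inChild σ k t ≢ y → ¬ OnSeg (pt x) (pt y) (pt (inChild σ k t))) →
      NonNeg (val f x) → NonNeg (val f y) →
      inChild σ k a' ≢ x → inChild σ k a' ≢ y → inChild σ k b' ≢ x → inChild σ k b' ≢ y →
      ¬ SegsMeet (pt (inChild σ k a')) (pt (inChild σ k b')) (pt x) (pt y)
    ¬meet-avoiding-child f σ k a' b' t adj (inj₁ refl) (inj₁ refl) z cb nx ny n1 n2 n3 n4 =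
      λ _ → t≢f (trans (sym adj) (adjacent-irrefl d a'))
      where
      t≢f : true ≢ false
      t≢f ()
    ¬meet-avoiding-child f σ k a' b' t {x} {y} adj (inj₁ refl) (inj₂ nb) z cb nx ny n1 n2 n3 n4 =
      ¬meet-avoiding f {inChild σ k a'} {inChild σ k b'} {x} {y} (inj₂ (z , cb n1 n2)) (inj₁ nb) nx ny
        (λ _ zb → Neg⇒≢0 nb zb)
    ¬meet-avoiding-child f σ k a' b' t {x} {y} adj (inj₂ na) (inj₁ refl) z cb nx ny n1 n2 n3 n4 =
      ¬meet-avoiding f {inChild σ k a'} {inChild σ k b'} {x} {y} (inj₁ na) (inj₂ (z , cb n3 n4)) nx ny
        (λ za _ → Neg⇒≢0 na za)
    ¬meet-avoiding-child f σ k a' b' t {x} {y} adj (inj₂ na) (inj₂ nb) z cb nx ny n1 n2 n3 n4 =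
      ¬meet-across f {inChild σ k a'} {inChild σ k b'} {x} {y} na nb nx ny

    ray-val-ownPath : ∀ σ (k : Fin L) → val (rayForm σ (toℕ k)) (inner (path (inject₁ k))) ≡ 0ℤ
    ray-val-ownPath σ k = trans (ray-val-path σ (toℕ k) (inject₁ k))
      (trans (cong (λ z → scaled (+ W * (+ toℕ k - + z))) (FP.toℕ-inject₁ k)) (scaled-0 (W*diff-self (toℕ k))))

    ray-child-Neg-or-hv : ∀ σ k (x : Vertex d) → inChild σ k x ≢ hub σ →
      (x ≡ hv) ⊎ Neg (val (rayForm σ (toℕ k)) (inChild σ k x))
    ray-child-Neg-or-hv σ k hu n = ⊥-elim (n refl)
    ray-child-Neg-or-hv σ k hv n = inj₁ refl
    ray-child-Neg-or-hv σ k (inner i) n = inj₂ (ray-val-child-Neg σ (toℕ k) k i ℕP.≤-refl)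

    nextRay-child-Neg : ∀ σ k (x : Vertex d) → inChild σ k x ≢ hub σ →
      Neg (val (negate (rayForm σ (suc (toℕ k)))) (inChild σ k x))
    nextRay-child-Neg σ k x n with nextRay-child-Pos σ k x
    ... | inj₁ refl = ⊥-elim (n refl)
    ... | inj₂ p = Pos⇒Neg-negate (rayForm σ (suc (toℕ k))) (inChild σ k x) p

    side-child-Neg-or-hv : ∀ σ k (x : Vertex d) → (x ≡ hv) ⊎ Neg (val (negate (sideForm σ)) (inChild σ k x))
    side-child-Neg-or-hv σ k x with side-child-Pos σ k x
    ... | inj₁ e = inj₁ e
    ... | inj₂ p = inj₂ (Pos⇒Neg-negate (sideForm σ) (inChild σ k x) p)

    nextRay-child-Neg-or-hu : ∀ σ k (x : Vertex d) →
      (x ≡ hu) ⊎ Neg (val (negate (rayForm σ (suc (toℕ k)))) (inChild σ k x))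
    nextRay-child-Neg-or-hu σ k x with nextRay-child-Pos σ k x
    ... | inj₁ e = inj₁ e
    ... | inj₂ p = inj₂ (Pos⇒Neg-negate (rayForm σ (suc (toℕ k))) (inChild σ k x) p)

    apart-HP-ownC : ∀ σ j k (a' b' : Vertex d) → adjacent d a' b' ≡ true → j ≡ inject₁ k → hub σ ≢ inChild σ k a' →
      hub σ ≢ inChild σ k b' → inner (path j) ≢ inChild σ k a' → inner (path j) ≢ inChild σ k b' →
      ¬ SegsMeet (pt (hub σ)) (pt (inner (path j))) (pt (inChild σ k a')) (pt (inChild σ k b'))
    apart-HP-ownC σ .(inject₁ k) k a' b' adj refl n1 n2 n3 n4 =
      apart-inChild σ k hu hv a' b' refl adj (inChild-≢ σ k n1) (inChild-≢ σ k n2) (inChild-≢ σ k n3)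
        (inChild-≢ σ k n4)

    apart-C-earlierHP : ∀ σ j k (a' b' : Vertex d) → adjacent d a' b' ≡ true → toℕ j ℕ.≤ toℕ k →
      inChild σ k a' ≢ hub σ → inChild σ k a' ≢ inner (path j) → inChild σ k b' ≢ hub σ →
      inChild σ k b' ≢ inner (path j) →
      ¬ SegsMeet (pt (inChild σ k a')) (pt (inChild σ k b')) (pt (hub σ)) (pt (inner (path j)))
    apart-C-earlierHP σ j k a' b' adj le n1 n2 n3 n4 =
      ¬meet-avoiding-child (rayForm σ (toℕ k)) σ k a' b' hv {hub σ} {inner (path j)} adj
        (ray-child-Neg-or-hv σ k a' n1) (ray-child-Neg-or-hv σ k b' n3) (ray-val-ownPath σ k)
        (λ m1 m2 → off-HP σ j (inChild σ k hv) m1 m2) (≡0⇒NonNeg (ray-val-hub σ (toℕ k)))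
          (ray-val-path-NonNeg σ (toℕ k) j le) n1 n2 n3 n4

    apart-C-laterHP : ∀ σ j k (a' b' : Vertex d) → toℕ k ℕ.< toℕ j → inChild σ k a' ≢ hub σ →
      inChild σ k b' ≢ hub σ →
      ¬ SegsMeet (pt (inChild σ k a')) (pt (inChild σ k b')) (pt (hub σ)) (pt (inner (path j)))
    apart-C-laterHP σ j k a' b' lt n1 n3 =
      ¬meet-across (negate (rayForm σ (suc (toℕ k)))) {inChild σ k a'} {inChild σ k b'} {hub σ} {inner (path j)}
        (nextRay-child-Neg σ k a' n1) (nextRay-child-Neg σ k b' n3)
        (≡0⇒NonNeg (≡0-negate (rayForm σ (suc (toℕ k))) (hub σ) (ray-val-hub σ (suc (toℕ k)))))
          (NonPos⇒NonNeg-negate (rayForm σ (suc (toℕ k))) (inner (path j)) (ray-val-path-NonPos σ (suc (toℕ k)) j lt))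

    apart-C-otherHP : ∀ σ j k (a' b' : Vertex d) → adjacent d a' b' ≡ true → inChild (not σ) k a' ≢ hub σ →
      inChild (not σ) k a' ≢ inner (path j) → inChild (not σ) k b' ≢ hub σ → inChild (not σ) k b' ≢ inner (path j) →
      ¬ SegsMeet (pt (inChild (not σ) k a')) (pt (inChild (not σ) k b')) (pt (hub σ)) (pt (inner (path j)))
    apart-C-otherHP σ j k a' b' adj n1 n2 n3 n4 =
      ¬meet-avoiding-child (sideForm σ) (not σ) k a' b' hv {hub σ} {inner (path j)} adj (side-otherChild-Neg σ k a')
        (side-otherChild-Neg σ k b') (side-val-path σ (inject₁ k))
        (λ m1 m2 → off-HP σ j (inChild (not σ) k hv) m1 m2) (Pos⇒NonNeg (side-val-hub σ))
          (≡0⇒NonNeg (side-val-path σ j)) n1 n2 n3 n4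

    apart-C-PP : ∀ (m : Fin L) σ k (a' b' : Vertex d) → adjacent d a' b' ≡ true →
      inChild σ k a' ≢ inner (path (inject₁ m)) → inChild σ k a' ≢ inner (path (suc m)) →
      inChild σ k b' ≢ inner (path (inject₁ m)) → inChild σ k b' ≢ inner (path (suc m)) →
      ¬ SegsMeet (pt (inChild σ k a')) (pt (inChild σ k b')) (pt (inner (path (inject₁ m))))
        (pt (inner (path (suc m))))
    apart-C-PP m σ k a' b' adj n1 n2 n3 n4 =
      ¬meet-avoiding-child (negate (sideForm σ)) σ k a' b' hv {inner (path (inject₁ m))} {inner (path (suc m))} adj
        (side-child-Neg-or-hv σ k a') (side-child-Neg-or-hv σ k b')
        (≡0-negate (sideForm σ) (inner (path (inject₁ k))) (side-val-path σ (inject₁ k)))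
        (λ m1 m2 → off-PP m (inChild σ k hv) m1 m2)
        (≡0⇒NonNeg (≡0-negate (sideForm σ) (inner (path (inject₁ m))) (side-val-path σ (inject₁ m))))
          (≡0⇒NonNeg (≡0-negate (sideForm σ) (inner (path (suc m))) (side-val-path σ (suc m)))) n1 n2 n3 n4

    apart-C-laterC : ∀ σ k k' (a' b' x' y' : Vertex d) → adjacent d a' b' ≡ true → adjacent d x' y' ≡ true →
      toℕ k ℕ.< toℕ k' → inChild σ k a' ≢ inChild σ k' x' → inChild σ k a' ≢ inChild σ k' y' →
      inChild σ k b' ≢ inChild σ k' x' → inChild σ k b' ≢ inChild σ k' y' →
      ¬ SegsMeet (pt (inChild σ k a')) (pt (inChild σ k b')) (pt (inChild σ k' x')) (pt (inChild σ k' y'))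
    apart-C-laterC σ k k' a' b' x' y' adj1 adj2 lt n1 n2 n3 n4 =
      ¬meet-avoiding-child (negate (rayForm σ (suc (toℕ k)))) σ k a' b' hu {inChild σ k' x'} {inChild σ k' y'} adj1
        (nextRay-child-Neg-or-hu σ k a') (nextRay-child-Neg-or-hu σ k b')
        (≡0-negate (rayForm σ (suc (toℕ k))) (hub σ) (ray-val-hub σ (suc (toℕ k))))
        (λ m1 m2 → off-C σ k' x' y' adj2 (inChild σ k hu) m1 m2)
        (NonPos⇒NonNeg-negate (rayForm σ (suc (toℕ k))) (inChild σ k' x') (nextRay-laterChild-NonPos σ k k' x' lt))
          (NonPos⇒NonNeg-negate (rayForm σ (suc (toℕ k))) (inChild σ k' y') (nextRay-laterChild-NonPos σ k k' y' lt))
        n1 n2 n3 n4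

    apart-C-otherC : ∀ σ k k' (a' b' x' y' : Vertex d) → adjacent d a' b' ≡ true → adjacent d x' y' ≡ true →
      inChild (not σ) k' x' ≢ inChild σ k a' → inChild (not σ) k' x' ≢ inChild σ k b' →
      inChild (not σ) k' y' ≢ inChild σ k a' → inChild (not σ) k' y' ≢ inChild σ k b' →
      ¬ SegsMeet (pt (inChild (not σ) k' x')) (pt (inChild (not σ) k' y')) (pt (inChild σ k a')) (pt (inChild σ k b'))
    apart-C-otherC σ k k' a' b' x' y' adj1 adj2 n1 n2 n3 n4 =
      ¬meet-avoiding-child (sideForm σ) (not σ) k' x' y' hv {inChild σ k a'} {inChild σ k b'} adj2
        (side-otherChild-Neg σ k' x') (side-otherChild-Neg σ k' y') (side-val-path σ (inject₁ k'))
        (λ m1 m2 → off-C σ k a' b' adj1 (inChild (not σ) k' hv) m1 m2)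
        (side-child-NonNeg σ k a') (side-child-NonNeg σ k b') n1 n2 n3 n4

    apart-PP-laterPP : ∀ (m m' : Fin L) → suc (toℕ m) ℕ.< toℕ m' →
      ¬ SegsMeet (pt (inner (path (inject₁ m')))) (pt (inner (path (suc m')))) (pt (inner (path (inject₁ m))))
        (pt (inner (path (suc m))))
    apart-PP-laterPP m m' lt = ¬meet-across (rayForm true (suc (toℕ m))) {inner (path (inject₁ m'))}
      {inner (path (suc m'))} {inner (path (inject₁ m))} {inner (path (suc m))}
      (ray-val-path-Neg true (suc (toℕ m)) (inject₁ m') (ℕP.≤-trans lt (≥inject₁ m')))
      (ray-val-path-Neg true (suc (toℕ m)) (suc m') (ℕP.m≤n⇒m≤1+n lt))
      (Pos⇒NonNeg (ray-val-path-Pos true (suc (toℕ m)) (inject₁ m) (s≤s (≤inject₁ m))))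
      (≡0⇒NonNeg (ray-val-path-self true (suc m)))

    apart-PP-PP< : ∀ (m m' : Fin L) → toℕ m ℕ.< toℕ m' → inner {suc d} (path (suc m)) ≢ inner (path (inject₁ m')) →
      Tri (suc (toℕ m) ℕ.< toℕ m') (suc (toℕ m) ≡ toℕ m') (toℕ m' ℕ.< suc (toℕ m)) →
      ¬ SegsMeet (pt (inner (path (inject₁ m')))) (pt (inner (path (suc m')))) (pt (inner (path (inject₁ m))))
        (pt (inner (path (suc m))))
    apart-PP-PP< m m' lt n (tri< lt' _ _) = apart-PP-laterPP m m' lt'
    apart-PP-PP< m m' lt n (tri≈ _ eq _) = ⊥-elim
      (n (cong (λ z → inner (path {d} z)) (FP.toℕ-injective (trans eq (sym (FP.toℕ-inject₁ m'))))))
    apart-PP-PP< m m' lt n (tri> _ _ gt) = ⊥-elim (ℕP.<⇒≱ lt (ℕP.≤-pred gt))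

    apart-PP-PP : ∀ (m m' : Fin L) → inner {suc d} (path (inject₁ m)) ≢ inner (path (inject₁ m')) →
      inner {suc d} (path (inject₁ m)) ≢ inner (path (suc m')) →
      inner {suc d} (path (suc m)) ≢ inner (path (inject₁ m')) →
      inner {suc d} (path (suc m)) ≢ inner (path (suc m')) →
      Tri (toℕ m ℕ.< toℕ m') (toℕ m ≡ toℕ m') (toℕ m' ℕ.< toℕ m) →
      ¬ SegsMeet (pt (inner (path (inject₁ m)))) (pt (inner (path (suc m)))) (pt (inner (path (inject₁ m'))))
        (pt (inner (path (suc m'))))
    apart-PP-PP m m' n1 n2 n3 n4 (tri< lt _ _) =
      ¬meet-swap {inner (path (inject₁ m))} {inner (path (suc m))} {inner (path (inject₁ m'))} {inner (path (suc m'))}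
        (apart-PP-PP< m m' lt n3 (ℕP.<-cmp (suc (toℕ m)) (toℕ m')))
    apart-PP-PP m m' n1 n2 n3 n4 (tri≈ _ eq _) = ⊥-elim
      (n1 (cong (λ z → inner (path {d} (inject₁ z))) (FP.toℕ-injective eq)))
    apart-PP-PP m m' n1 n2 n3 n4 (tri> _ _ gt) = apart-PP-PP< m' m gt (≢-sym n2) (ℕP.<-cmp (suc (toℕ m')) (toℕ m))

    apart-C-sameC : ∀ σ k k' (a' b' x' y' : Vertex d) → adjacent d a' b' ≡ true → adjacent d x' y' ≡ true → k ≡ k' →
      inChild σ k a' ≢ inChild σ k' x' → inChild σ k a' ≢ inChild σ k' y' → inChild σ k b' ≢ inChild σ k' x' →
      inChild σ k b' ≢ inChild σ k' y' →
      ¬ SegsMeet (pt (inChild σ k a')) (pt (inChild σ k b')) (pt (inChild σ k' x')) (pt (inChild σ k' y'))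
    apart-C-sameC σ k .k a' b' x' y' adj1 adj2 refl n1 n2 n3 n4 =
      apart-inChild σ k a' b' x' y' adj1 adj2 (inChild-≢ σ k n1) (inChild-≢ σ k n2) (inChild-≢ σ k n3)
        (inChild-≢ σ k n4)

    apart-C-C : ∀ σ k k' (a' b' x' y' : Vertex d) → adjacent d a' b' ≡ true → adjacent d x' y' ≡ true →
      inChild σ k a' ≢ inChild σ k' x' → inChild σ k a' ≢ inChild σ k' y' → inChild σ k b' ≢ inChild σ k' x' →
      inChild σ k b' ≢ inChild σ k' y' → Tri (toℕ k ℕ.< toℕ k') (toℕ k ≡ toℕ k') (toℕ k' ℕ.< toℕ k) →
      ¬ SegsMeet (pt (inChild σ k a')) (pt (inChild σ k b')) (pt (inChild σ k' x')) (pt (inChild σ k' y'))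
    apart-C-C σ k k' a' b' x' y' adj1 adj2 n1 n2 n3 n4 (tri< lt _ _) = apart-C-laterC σ k k' a' b' x' y' adj1 adj2 lt
      n1 n2 n3 n4
    apart-C-C σ k k' a' b' x' y' adj1 adj2 n1 n2 n3 n4 (tri≈ _ eq _) = apart-C-sameC σ k k' a' b' x' y' adj1 adj2
      (FP.toℕ-injective eq) n1 n2 n3 n4
    apart-C-C σ k k' a' b' x' y' adj1 adj2 n1 n2 n3 n4 (tri> _ _ gt) =
      ¬meet-swap {inChild σ k a'} {inChild σ k b'} {inChild σ k' x'} {inChild σ k' y'}
        (apart-C-laterC σ k' k x' y' a' b' adj2 adj1 gt (≢-sym n1) (≢-sym n3) (≢-sym n2) (≢-sym n4))

    apart-HP-C : ∀ σ j k (a' b' : Vertex d) → adjacent d a' b' ≡ true → hub σ ≢ inChild σ k a' →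
      hub σ ≢ inChild σ k b' → inner (path j) ≢ inChild σ k a' → inner (path j) ≢ inChild σ k b' →
      Tri (toℕ j ℕ.< toℕ k) (toℕ j ≡ toℕ k) (toℕ k ℕ.< toℕ j) →
      ¬ SegsMeet (pt (hub σ)) (pt (inner (path j))) (pt (inChild σ k a')) (pt (inChild σ k b'))
    apart-HP-C σ j k a' b' adj n1 n2 n3 n4 (tri< lt _ _) =
      ¬meet-swap {hub σ} {inner (path j)} {inChild σ k a'} {inChild σ k b'}
        (apart-C-earlierHP σ j k a' b' adj (ℕP.<⇒≤ lt) (≢-sym n1) (≢-sym n3) (≢-sym n2) (≢-sym n4))
    apart-HP-C σ j k a' b' adj n1 n2 n3 n4 (tri≈ _ eq _) =
      apart-HP-ownC σ j k a' b' adj (FP.toℕ-injective (trans eq (sym (FP.toℕ-inject₁ k)))) n1 n2 n3 n4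
    apart-HP-C σ j k a' b' adj n1 n2 n3 n4 (tri> _ _ gt) =
      ¬meet-swap {hub σ} {inner (path j)} {inChild σ k a'} {inChild σ k b'}
        (apart-C-laterHP σ j k a' b' gt (≢-sym n1) (≢-sym n2))

    apart-HH-edge : ∀ {x y} → Edge x y → hu ≢ x → hu ≢ y → hv ≢ x → hv ≢ y →
      ¬ SegsMeet (pt hu) (pt hv) (pt x) (pt y)
    apart-HH-edge hub-hub n1 n2 n3 n4 = ⊥-elim (n1 refl)
    apart-HH-edge (hub-path true j) n1 n2 n3 n4 = ⊥-elim (n1 refl)
    apart-HH-edge (hub-path false j) n1 n2 n3 n4 = ⊥-elim (n3 refl)
    apart-HH-edge (path-path m) n1 n2 n3 n4 = apart-HH-PP m
    apart-HH-edge (in-child σ k {a'} {b'} adj) n1 n2 n3 n4 =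
      ¬meet-swap {hu} {hv} {inChild σ k a'} {inChild σ k b'}
        (apart-C-HH σ k a' b' (≢-sym n1) (≢-sym n3) (≢-sym n2) (≢-sym n4))

    apart-HP-edge : ∀ σ j {x y} → Edge x y → hub σ ≢ x → hub σ ≢ y → inner (path j) ≢ x → inner (path j) ≢ y →
      ¬ SegsMeet (pt (hub σ)) (pt (inner (path j))) (pt x) (pt y)
    apart-HP-edge true j hub-hub n1 n2 n3 n4 = ⊥-elim (n1 refl)
    apart-HP-edge false j hub-hub n1 n2 n3 n4 = ⊥-elim (n2 refl)
    apart-HP-edge true j (hub-path true j') n1 n2 n3 n4 = ⊥-elim (n1 refl)
    apart-HP-edge false j (hub-path false j') n1 n2 n3 n4 = ⊥-elim (n1 refl)
    apart-HP-edge true j (hub-path false j') n1 n2 n3 n4 = apart-HP-otherHP false j' j n4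
    apart-HP-edge false j (hub-path true j') n1 n2 n3 n4 = apart-HP-otherHP true j' j n4
    apart-HP-edge σ j (path-path m) n1 n2 n3 n4 = apart-HP-PP σ j m n3 n4
    apart-HP-edge true j (in-child true k {a'} {b'} adj) n1 n2 n3 n4 = apart-HP-C true j k a' b' adj n1 n2 n3 n4
      (ℕP.<-cmp (toℕ j) (toℕ k))
    apart-HP-edge false j (in-child false k {a'} {b'} adj) n1 n2 n3 n4 = apart-HP-C false j k a' b' adj n1 n2 n3 n4
      (ℕP.<-cmp (toℕ j) (toℕ k))
    apart-HP-edge true j (in-child false k {a'} {b'} adj) n1 n2 n3 n4 =
      ¬meet-swap {hu} {inner (path j)} {inChild false k a'} {inChild false k b'}
        (apart-C-otherHP true j k a' b' adj (≢-sym n1) (≢-sym n3) (≢-sym n2) (≢-sym n4))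
    apart-HP-edge false j (in-child true k {a'} {b'} adj) n1 n2 n3 n4 =
      ¬meet-swap {hv} {inner (path j)} {inChild true k a'} {inChild true k b'}
        (apart-C-otherHP false j k a' b' adj (≢-sym n1) (≢-sym n3) (≢-sym n2) (≢-sym n4))

    apart-PP-edge : ∀ m {x y} → Edge x y → inner (path (inject₁ m)) ≢ x → inner (path (inject₁ m)) ≢ y →
      inner (path (suc m)) ≢ x → inner (path (suc m)) ≢ y →
      ¬ SegsMeet (pt (inner (path (inject₁ m)))) (pt (inner (path (suc m)))) (pt x) (pt y)
    apart-PP-edge m hub-hub n1 n2 n3 n4 = ¬meet-swap {inner (path (inject₁ m))} {inner (path (suc m))} {hu} {hv}
      (apart-HH-PP m)
    apart-PP-edge m (hub-path σ j) n1 n2 n3 n4 =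
      ¬meet-swap {inner (path (inject₁ m))} {inner (path (suc m))} {hub σ} {inner (path j)}
        (apart-HP-PP σ j m (≢-sym n2) (≢-sym n4))
    apart-PP-edge m (path-path m') n1 n2 n3 n4 = apart-PP-PP m m' n1 n2 n3 n4 (ℕP.<-cmp (toℕ m) (toℕ m'))
    apart-PP-edge m (in-child σ k {a'} {b'} adj) n1 n2 n3 n4 =
      ¬meet-swap {inner (path (inject₁ m))} {inner (path (suc m))} {inChild σ k a'} {inChild σ k b'}
        (apart-C-PP m σ k a' b' adj (≢-sym n1) (≢-sym n3) (≢-sym n2) (≢-sym n4))

    apart-C-edge : ∀ σ k {a' b' : Vertex d} → adjacent d a' b' ≡ true → ∀ {x y} → Edge x y → inChild σ k a' ≢ x →
      inChild σ k a' ≢ y → inChild σ k b' ≢ x → inChild σ k b' ≢ y →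
      ¬ SegsMeet (pt (inChild σ k a')) (pt (inChild σ k b')) (pt x) (pt y)
    apart-C-edge σ k {a'} {b'} adj hub-hub n1 n2 n3 n4 = apart-C-HH σ k a' b' n1 n2 n3 n4
    apart-C-edge true k {a'} {b'} adj (hub-path true j) n1 n2 n3 n4 =
      ¬meet-swap {inChild true k a'} {inChild true k b'} {hu} {inner (path j)}
        (apart-HP-C true j k a' b' adj (≢-sym n1) (≢-sym n3) (≢-sym n2) (≢-sym n4) (ℕP.<-cmp (toℕ j) (toℕ k)))
    apart-C-edge false k {a'} {b'} adj (hub-path false j) n1 n2 n3 n4 =
      ¬meet-swap {inChild false k a'} {inChild false k b'} {hv} {inner (path j)}
        (apart-HP-C false j k a' b' adj (≢-sym n1) (≢-sym n3) (≢-sym n2) (≢-sym n4) (ℕP.<-cmp (toℕ j) (toℕ k)))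
    apart-C-edge false k {a'} {b'} adj (hub-path true j) n1 n2 n3 n4 = apart-C-otherHP true j k a' b' adj n1 n2 n3 n4
    apart-C-edge true k {a'} {b'} adj (hub-path false j) n1 n2 n3 n4 = apart-C-otherHP false j k a' b' adj n1 n2 n3 n4
    apart-C-edge σ k {a'} {b'} adj (path-path m) n1 n2 n3 n4 = apart-C-PP m σ k a' b' adj n1 n2 n3 n4
    apart-C-edge true k {a'} {b'} adj1 (in-child true k' {x'} {y'} adj2) n1 n2 n3 n4 =
      apart-C-C true k k' a' b' x' y' adj1 adj2 n1 n2 n3 n4 (ℕP.<-cmp (toℕ k) (toℕ k'))
    apart-C-edge false k {a'} {b'} adj1 (in-child false k' {x'} {y'} adj2) n1 n2 n3 n4 =
      apart-C-C false k k' a' b' x' y' adj1 adj2 n1 n2 n3 n4 (ℕP.<-cmp (toℕ k) (toℕ k'))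
    apart-C-edge true k {a'} {b'} adj1 (in-child false k' {x'} {y'} adj2) n1 n2 n3 n4 = apart-C-otherC false k' k x'
      y' a' b' adj2 adj1 n1 n2 n3 n4
    apart-C-edge false k {a'} {b'} adj1 (in-child true k' {x'} {y'} adj2) n1 n2 n3 n4 = apart-C-otherC true k' k x' y'
      a' b' adj2 adj1 n1 n2 n3 n4

    apart-edge-pair : ∀ {a b x y} → Edge a b → Edge x y → a ≢ x → a ≢ y → b ≢ x → b ≢ y →
      ¬ SegsMeet (pt a) (pt b) (pt x) (pt y)
    apart-edge-pair hub-hub = apart-HH-edge
    apart-edge-pair (hub-path σ j) = apart-HP-edge σ j
    apart-edge-pair (path-path m) = apart-PP-edge m
    apart-edge-pair (in-child σ k {a} {b} adj) = apart-C-edge σ k {a} {b} adj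

    apart-edges : ∀ (a b x y : Vertex (suc d)) → adjacent (suc d) a b ≡ true → adjacent (suc d) x y ≡ true → a ≢ x →
      a ≢ y → b ≢ x → b ≢ y → ¬ SegsMeet (pt a) (pt b) (pt x) (pt y)
    apart-edges a b x y adj1 adj2 n1 n2 n3 n4 = oriented (classify-edge d a b adj1) (classify-edge d x y adj2)
      where
      oriented : Edge a b ⊎ Edge b a → Edge x y ⊎ Edge y x → ¬ SegsMeet (pt a) (pt b) (pt x) (pt y)
      oriented (inj₁ e1) (inj₁ e2) = apart-edge-pair e1 e2 n1 n2 n3 n4
      oriented (inj₂ e1) (inj₁ e2) m = apart-edge-pair e1 e2 n3 n4 n1 n2 (SegsMeet-flip {pt a} {pt b} {pt x} {pt y} m)
      oriented (inj₁ e1) (inj₂ e2) m = apart-edge-pair e1 e2 n2 n1 n4 n3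
        (SegsMeet-swap {pt y} {pt x} {pt a} {pt b}
        (SegsMeet-flip {pt x} {pt y} {pt a} {pt b} (SegsMeet-swap {pt a} {pt b} {pt x} {pt y} m)))
      oriented (inj₂ e1) (inj₂ e2) m = apart-edge-pair e1 e2 n4 n3 n2 n1
        (SegsMeet-swap {pt y} {pt x} {pt b} {pt a}
        (SegsMeet-flip {pt x} {pt y} {pt b} {pt a}
        (SegsMeet-swap {pt b} {pt a} {pt x} {pt y} (SegsMeet-flip {pt a} {pt b} {pt x} {pt y} m))))

  vertices-off-edges₀ : VerticesOffEdges 0
  vertices-off-edges₀ hu hu hv _ n1 _ = ⊥-elim (n1 refl)
  vertices-off-edges₀ hv hu hv _ _ n2 = ⊥-elim (n2 refl)
  vertices-off-edges₀ hu hv hu _ _ n2 = ⊥-elim (n2 refl)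
  vertices-off-edges₀ hv hv hu _ n1 _ = ⊥-elim (n1 refl)
  vertices-off-edges₀ w hu hu () _ _
  vertices-off-edges₀ w hv hv () _ _

  edges-apart₀ : EdgesApart 0
  edges-apart₀ hu hv hu y _ _ n1 _ _ _ = ⊥-elim (n1 refl)
  edges-apart₀ hu hv hv y _ _ _ _ n3 _ = ⊥-elim (n3 refl)
  edges-apart₀ hv hu hu y _ _ _ _ n3 _ = ⊥-elim (n3 refl)
  edges-apart₀ hv hu hv y _ _ n1 _ _ _ = ⊥-elim (n1 refl)
  edges-apart₀ hu hu x y () _ _ _ _ _
  edges-apart₀ hv hv x y () _ _ _ _ _

  planar-drawing : ∀ d → VerticesOffEdges d × EdgesApart d
  planar-drawing zero = vertices-off-edges₀ , edges-apart₀
  planar-drawing (suc d) = S.off-edges , S.apart-edges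
    where
    module S = Step d (proj₁ (planar-drawing d)) (proj₂ (planar-drawing d))

  vertices-off-edges : ∀ d → VerticesOffEdges d
  vertices-off-edges d = proj₁ (planar-drawing d)

  edges-apart : ∀ d → EdgesApart d
  edges-apart d = proj₂ (planar-drawing d)

  -- A second vertex at the point of x would lie on the segment from x to a neighbour of x other than it.
  point-injective : ∀ d (x y : Vertex d) → x ≢ y → point d x ≢ point d y
  point-injective zero hu hu x≢y e = x≢y refl
  point-injective zero hv hv x≢y e = x≢y refl
  point-injective zero hu hv x≢y ()
  point-injective zero hv hu x≢y ()
  point-injective (suc d) x y x≢y e with two-neighbours d x
  ... | z₁ , z₂ , x~z₁ , x~z₂ , z₁≢z₂ with z₁ ≟ⱽ y
  ... | no z₁≢y = vertices-off-edges (suc d) y x z₁ x~z₁ (≢-sym x≢y) (≢-sym z₁≢y)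
    (subst (OnSeg _ (point (suc d) z₁)) e (OnSeg-start {q = point (suc d) z₁}))
  ... | yes refl = vertices-off-edges (suc d) y x z₂ x~z₂ (≢-sym x≢y) z₁≢z₂
    (subst (OnSeg _ (point (suc d) z₂)) e (OnSeg-start {q = point (suc d) z₂}))

module Enumeration (L : ℕ) where
  open import Data.Nat as ℕ using (ℕ; zero; suc)
  open import Data.Fin using (Fin; zero; suc; splitAt; join; remQuot; combine)
  import Data.Fin.Properties as FP
  open import Data.Bool using (Bool; true; false)
  open import Data.Product using (_×_; _,_; proj₁; proj₂)
  open import Data.Sum using (_⊎_; inj₁; inj₂)
  open import Relation.Binary.PropositionalEquality
  open Fan L

  innerCount : ℕ → ℕ
  innerCount zero = 0
  innerCount (suc d) = suc L ℕ.+ 2 ℕ.* (L ℕ.* innerCount d)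

  vertexCount : ℕ → ℕ
  vertexCount d = suc (suc (innerCount d))

  private
    fromBool : Bool → Fin 2
    fromBool true = zero
    fromBool false = suc zero

    toBool : Fin 2 → Bool
    toBool zero = true
    toBool (suc zero) = false

    toBool-fromBool : ∀ b → toBool (fromBool b) ≡ b
    toBool-fromBool true = refl
    toBool-fromBool false = refl

    fromBool-toBool : ∀ x → fromBool (toBool x) ≡ x
    fromBool-toBool zero = refl
    fromBool-toBool (suc zero) = refl

  encodeInner : ∀ d → Inner d → Fin (innerCount d)
  encodeInner (suc d) (path j) = join (suc L) _ (inj₁ j)
  encodeInner (suc d) (child σ k i) = join (suc L) _ (inj₂ (combine (fromBool σ) (combine k (encodeInner d i))))

  decodeInner : ∀ d → Fin (innerCount d) → Inner d
  decodeChild : ∀ d → Fin (suc L) ⊎ Fin (2 ℕ.* (L ℕ.* innerCount d)) → Inner (suc d)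
  decodeInner (suc d) x = decodeChild d (splitAt (suc L) x)
  decodeChild d (inj₁ j) = path j
  decodeChild d (inj₂ y) = childAt (remQuot {2} (L ℕ.* innerCount d) y)
    where
    childAt : Fin 2 × Fin (L ℕ.* innerCount d) → Inner (suc d)
    childAt (σ , y′) = child (toBool σ) (proj₁ (remQuot {L} (innerCount d) y′))
      (decodeInner d (proj₂ (remQuot {L} (innerCount d) y′)))

  decode-encodeInner : ∀ d i → decodeInner d (encodeInner d i) ≡ i
  decode-encodeInner (suc d) (path j) = cong (decodeChild d) (FP.splitAt-join (suc L) _ (inj₁ j))
  decode-encodeInner (suc d) (child σ k i) = begin
    decodeChild d (splitAt (suc L) (join (suc L) _ (inj₂ (combine (fromBool σ) (combine k (encodeInner d i))))))
      ≡⟨ cong (decodeChild d) (FP.splitAt-join (suc L) _ (inj₂ (combine (fromBool σ) (combine k (encodeInner d i)))))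
        ⟩
    decodeChild d (inj₂ (combine (fromBool σ) (combine k (encodeInner d i))))
      ≡⟨ cong (λ (z : Fin 2 × _) → child (toBool (proj₁ z)) (proj₁ (remQuot {L} (innerCount d) (proj₂ z)))
                                        (decodeInner d (proj₂ (remQuot {L} (innerCount d) (proj₂ z)))))
              (FP.remQuot-combine (fromBool σ) (combine k (encodeInner d i))) ⟩
    child (toBool (fromBool σ)) (proj₁ (remQuot {L} (innerCount d) (combine k (encodeInner d i))))
          (decodeInner d (proj₂ (remQuot {L} (innerCount d) (combine k (encodeInner d i)))))
      ≡⟨ cong (λ z → child (toBool (fromBool σ)) (proj₁ z) (decodeInner d (proj₂ z)))
        (FP.remQuot-combine k (encodeInner d i)) ⟩
    child (toBool (fromBool σ)) k (decodeInner d (encodeInner d i))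
      ≡⟨ cong₂ (λ σ i → child σ k i) (toBool-fromBool σ) (decode-encodeInner d i) ⟩
    child σ k i ∎
    where open ≡-Reasoning

  encode-decodeInner : ∀ d x → encodeInner d (decodeInner d x) ≡ x
  encode-decodeChild : ∀ d z → encodeInner (suc d) (decodeChild d z) ≡ join (suc L) _ z
  encode-decodeInner (suc d) x = trans (encode-decodeChild d (splitAt (suc L) x)) (FP.join-splitAt (suc L) _ x)
  encode-decodeChild d (inj₁ j) = refl
  encode-decodeChild d (inj₂ y) = cong (λ z → join (suc L) _ (inj₂ z)) (begin
    combine (fromBool (toBool σ)) (combine k (encodeInner d (decodeInner d i)))
      ≡⟨ cong₂ (λ σ i → combine σ (combine k i)) (fromBool-toBool σ) (encode-decodeInner d i) ⟩
    combine σ (combine k i)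
      ≡⟨ cong (combine σ) (FP.combine-remQuot {L} (innerCount d) y′) ⟩
    combine σ y′
      ≡⟨ FP.combine-remQuot {2} (L ℕ.* innerCount d) y ⟩
    y ∎)
    where
    open ≡-Reasoning
    σ : Fin 2
    σ = proj₁ (remQuot {2} (L ℕ.* innerCount d) y)
    y′ : Fin (L ℕ.* innerCount d)
    y′ = proj₂ (remQuot {2} (L ℕ.* innerCount d) y)
    k : Fin L
    k = proj₁ (remQuot {L} (innerCount d) y′)
    i : Fin (innerCount d)
    i = proj₂ (remQuot {L} (innerCount d) y′)

  encode : ∀ d → Vertex d → Fin (vertexCount d)
  encode d hu = zero
  encode d hv = suc zero
  encode d (inner i) = suc (suc (encodeInner d i))

  decode : ∀ d → Fin (vertexCount d) → Vertex d
  decode d zero = hu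
  decode d (suc zero) = hv
  decode d (suc (suc x)) = inner (decodeInner d x)

  decode-encode : ∀ d x → decode d (encode d x) ≡ x
  decode-encode d hu = refl
  decode-encode d hv = refl
  decode-encode d (inner i) = cong inner (decode-encodeInner d i)

  encode-decode : ∀ d x → encode d (decode d x) ≡ x
  encode-decode d zero = refl
  encode-decode d (suc zero) = refl
  encode-decode d (suc (suc x)) = cong (λ z → suc (suc z)) (encode-decodeInner d x)

module Counting where
  open import Data.Nat using (ℕ; _≤_; _*_; _≟_; z≤n)
  import Data.Nat.Properties as ℕP
  open import Data.Fin using (Fin)
  import Data.Fin.Properties as FP
  open import Data.List using (List; []; _∷_; length; filter; allFin; _++_; lookup)
  open import Data.List.Properties using (length-++)
  open import Data.List.Membership.Propositional using (_∈_)
  open import Data.List.Membership.Propositional.Properties using (∈-filter⁺; ∈-allFin; ∈-++⁺ˡ; ∈-++⁺ʳ)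
  open import Data.List.Relation.Unary.Any using (Any; here; there; index)
  open import Data.List.Relation.Unary.Any.Properties using (lookup-index)
  open import Data.Product using (_×_; _,_)
  open import Relation.Nullary using (yes; no; contradiction)
  open import Relation.Nullary.Decidable using (_×-dec_)
  open import Relation.Binary.PropositionalEquality

  injection⇒≤length : ∀ {A : Set} {m} (g : Fin m → A) → (∀ i j → g i ≡ g j → i ≡ j) → (S : List A) →
    (∀ i → g i ∈ S) → m ≤ length S
  injection⇒≤length {m = m} g g-inj S g∈S with m ℕP.≤? length S
  ... | yes m≤ = m≤
  ... | no m≰ with FP.pigeonhole (ℕP.≰⇒> m≰) (λ i → index (g∈S i))
  ...   | i , j , i<j , same-index =
    contradiction (g-inj i j (trans (lookup-index (g∈S i))
      (trans (cong (lookup S) same-index) (sym (lookup-index (g∈S j))))))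
                  (FP.<⇒≢ i<j)

  -- A cell (a , b) stands for the intersection of the part a of P with the part b of Q.
  module Cells (G : Graph) (P Q : Partition G) where

    InCell : Fin (n G) → ℕ × ℕ → Set
    InCell v (a , b) = P v ≡ a × Q v ≡ b

    members : ℕ × ℕ → List (Fin (n G))
    members (a , b) = filter (λ v → (P v ≟ a) ×-dec (Q v ≟ b)) (allFin (n G))

    membersOf : List (ℕ × ℕ) → List (Fin (n G))
    membersOf [] = []
    membersOf (cell ∷ cells) = members cell ++ membersOf cells

    ∈-membersOf : ∀ {v} cells → Any (InCell v) cells → v ∈ membersOf cells
    ∈-membersOf {v} ((a , b) ∷ cells) (here v∈ab) =
      ∈-++⁺ˡ (∈-filter⁺ (λ v → (P v ≟ a) ×-dec (Q v ≟ b)) (∈-allFin v) v∈ab)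
    ∈-membersOf (cell ∷ cells) (there v∈cells) = ∈-++⁺ʳ (members cell) (∈-membersOf cells v∈cells)

    module _ {c : ℕ} (bound : ∀ a b → meetSize G P Q a b ≤ c) where

      length-membersOf : ∀ cells → length (membersOf cells) ≤ length cells * c
      length-membersOf [] = z≤n
      length-membersOf ((a , b) ∷ cells) =
        ℕP.≤-trans (ℕP.≤-reflexive (length-++ (members (a , b)))) (ℕP.+-mono-≤ (bound a b) (length-membersOf cells))

      injection-into-cells : ∀ {m} (g : Fin m → Fin (n G)) → (∀ i j → g i ≡ g j → i ≡ j) → ∀ cells →
        (∀ i → Any (InCell (g i)) cells) → m ≤ length cells * c
      injection-into-cells g g-inj cells g∈ =
        ℕP.≤-trans (injection⇒≤length g g-inj (membersOf cells) (λ i → ∈-membersOf cells (g∈ i)))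
          (length-membersOf cells)

module TreePartition (G : Graph) (P : Partition G) (tp : IsTreePartition G P) where
  open import Data.Nat using (_≟_)
  open import Data.Fin using (Fin; zero; suc; inject₁)
  open import Data.Product using (proj₁; proj₂)
  open import Data.Sum using (_⊎_; inj₁; inj₂)
  open import Data.Empty using (⊥-elim)
  open import Relation.Nullary using (yes; no)
  open import Relation.Binary.PropositionalEquality
  open import Function.Bundles using (Equivalence)

  private
    T : Graph
    T = proj₁ tp

    f : Fin (n G) → Fin (n T)
    f = proj₁ (proj₂ (proj₂ tp))

    f-≢ : ∀ {u v} → P u ≢ P v → f u ≢ f v
    f-≢ {u} {v} Pu≢Pv e = Pu≢Pv (Equivalence.to (proj₁ (proj₂ (proj₂ (proj₂ tp))) u v) e)

    f-adjacent : ∀ {u v} → Adj G u v → P u ≢ P v → Adj T (f u) (f v)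
    f-adjacent = proj₂ (proj₂ (proj₂ (proj₂ tp))) _ _

  -- Three pairwise distinct parts on a triangle would give a triangle in the tree.
  triangle-meets-two-parts : ∀ {u v w} → Adj G u v → Adj G u w → Adj G v w → P u ≢ P v → P w ≡ P u ⊎ P w ≡ P v
  triangle-meets-two-parts {u} {v} {w} u~v u~w v~w Pu≢Pv with P w ≟ P u | P w ≟ P v
  ... | yes e | _ = inj₁ e
  ... | no _ | yes e = inj₂ e
  ... | no Pw≢Pu | no Pw≢Pv = ⊥-elim (proj₂ (proj₂ (proj₁ (proj₂ tp))) triangle)
    where
    vtx : Fin 3 → Fin (n T)
    vtx zero = f u
    vtx (suc zero) = f v
    vtx (suc (suc zero)) = f w
    vtx-injective : ∀ {i j} → vtx i ≡ vtx j → i ≡ j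
    vtx-injective {zero} {zero} e = refl
    vtx-injective {zero} {suc zero} e = ⊥-elim (f-≢ Pu≢Pv e)
    vtx-injective {zero} {suc (suc zero)} e = ⊥-elim (f-≢ (≢-sym Pw≢Pu) e)
    vtx-injective {suc zero} {zero} e = ⊥-elim (f-≢ (≢-sym Pu≢Pv) e)
    vtx-injective {suc zero} {suc zero} e = refl
    vtx-injective {suc zero} {suc (suc zero)} e = ⊥-elim (f-≢ (≢-sym Pw≢Pv) e)
    vtx-injective {suc (suc zero)} {zero} e = ⊥-elim (f-≢ Pw≢Pu e)
    vtx-injective {suc (suc zero)} {suc zero} e = ⊥-elim (f-≢ Pw≢Pv e)
    vtx-injective {suc (suc zero)} {suc (suc zero)} e = refl
    consecutive : ∀ (i : Fin 2) → Adj T (vtx (inject₁ i)) (vtx (suc i))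
    consecutive zero = f-adjacent u~v Pu≢Pv
    consecutive (suc zero) = f-adjacent v~w (≢-sym Pw≢Pv)
    triangle : Cycle T
    triangle = record
      { k = 0 ; vtx = vtx ; inj = vtx-injective ; consec = consecutive
      ; close = f-adjacent (trans (Graph.sym G w u) u~w) Pw≢Pu }

RainbowK4 : (G : Graph) → Partition G → Set
RainbowK4 G Q =
  ∃[ v₁ ] ∃[ v₂ ] ∃[ v₃ ] ∃[ v₄ ]
    (Adj G v₁ v₂ × Adj G v₁ v₃ × Adj G v₁ v₄ × Adj G v₂ v₃ × Adj G v₂ v₄ × Adj G v₃ v₄) ×
    (Q v₁ ≢ Q v₂ × Q v₁ ≢ Q v₃ × Q v₁ ≢ Q v₄ × Q v₂ ≢ Q v₃ × Q v₂ ≢ Q v₄ × Q v₃ ≢ Q v₄)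

consecutive-equal⇒constant : ∀ {A : Set} {m} (h : Fin (suc m) → A) → (∀ (o : Fin m) → h (inject₁ o) ≡ h (suc o)) →
  ∀ o → h o ≡ h zero
consecutive-equal⇒constant h eq zero = refl
consecutive-equal⇒constant {m = suc m} h eq (suc o) =
  trans (sym (eq o)) (consecutive-equal⇒constant (λ x → h (inject₁ x)) (λ o' → eq (inject₁ o')) o)

module Rainbow (c : ℕ) where
  open import Data.Nat as ℕ using (ℕ; suc; _≤_; _≟_; _*_)
  import Data.Nat.Properties as ℕP
  open import Data.Fin using (Fin; zero; suc; toℕ; inject₁; combine)
  import Data.Fin.Properties as FP
  open import Data.Bool using (true; false)
  open import Data.List using ([]; _∷_)
  open import Data.List.Relation.Unary.Any using (Any; here; there)
  open import Data.Product using (Σ; ∃; _×_; _,_; proj₁; proj₂)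
  open import Data.Sum using (_⊎_; inj₁; inj₂)
  open import Relation.Nullary using (¬_; Dec; yes; no; contradiction)
  open import Relation.Nullary.Decidable using (_×-dec_; ¬?; decidable-stable)
  open import Relation.Binary.PropositionalEquality
  open Counting

  blockLength blockCount L : ℕ
  blockLength = suc (2 * c)
  blockCount = suc (4 * c)
  L = blockCount * blockLength

  open Fan L

  L>c : ¬ (L ≤ 1 * c)
  L>c L≤c = ℕP.<-irrefl refl (ℕP.≤-trans (ℕP.m≤m+n blockLength _)
                                (ℕP.≤-trans L≤c (ℕP.*-monoˡ-≤ c (ℕP.n≤1+n 1))))

  L>2c : ¬ (L ≤ 2 * c)
  L>2c L≤2c = ℕP.<-irrefl refl (ℕP.≤-trans (ℕP.m≤m+n blockLength _) L≤2c)

  Avoids : ℕ → ℕ → ℕ → Set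
  Avoids α β x = x ≢ α × x ≢ β

  ¬Avoids : ∀ α β x → ¬ Avoids α β x → x ≡ α ⊎ x ≡ β
  ¬Avoids α β x ¬avoids with x ≟ α | x ≟ β
  ... | yes e | _ = inj₁ e
  ... | no _ | yes e = inj₂ e
  ... | no x≢α | no x≢β = contradiction (x≢α , x≢β) ¬avoids

  ¬≢⇒≡ : ∀ {x y} → ¬ x ≢ y → x ≡ y
  ¬≢⇒≡ {x} {y} = decidable-stable (x ≟ y)

  private
    suc-combine-inject₁ : ∀ (t : Fin blockCount) (o : Fin (2 * c)) →
      suc (combine t (inject₁ o)) ≡ inject₁ (combine t (suc o))
    suc-combine-inject₁ t o = FP.toℕ-injective (begin
      suc (toℕ (combine t (inject₁ o)))
        ≡⟨ cong suc (FP.toℕ-combine t (inject₁ o)) ⟩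
      suc (blockLength * toℕ t ℕ.+ toℕ (inject₁ o))
        ≡⟨ cong (λ z → suc (blockLength * toℕ t ℕ.+ z)) (FP.toℕ-inject₁ o) ⟩
      suc (blockLength * toℕ t ℕ.+ toℕ o)
        ≡⟨ ℕP.+-suc (blockLength * toℕ t) (toℕ o) ⟨
      blockLength * toℕ t ℕ.+ toℕ (suc o)
        ≡⟨ FP.toℕ-combine t (suc o) ⟨
      toℕ (combine t (suc o))
        ≡⟨ FP.toℕ-inject₁ (combine t (suc o)) ⟨
      toℕ (inject₁ (combine t (suc o))) ∎)
      where open ≡-Reasoning

  module _ (G : Graph) (P Q : Partition G) (tp : IsTreePartition G P) (bound : ∀ a b → meetSize G P Q a b ≤ c) where
    open Cells G P Q
    open TreePartition G P tp

    module Hubs {d : ℕ} (F : FanIn G (suc d)) where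
      open FanIn F

      u v : Fin (n G)
      u = embed hu
      v = embed hv

      p : Fin (suc L) → Fin (n G)
      p j = embed (inner (path j))

      p⁻ : Fin L → Fin (n G)
      p⁻ k = p (inject₁ k)

      p-injective : ∀ i j → p i ≡ p j → i ≡ j
      p-injective i j e with embed-injective _ _ e
      ... | refl = refl

      p⁻-injective : ∀ i j → p⁻ i ≡ p⁻ j → i ≡ j
      p⁻-injective i j e = FP.inject₁-injective (p-injective _ _ e)

      path-in-hub-parts : P u ≢ P v → ∀ j → P (p j) ≡ P u ⊎ P (p j) ≡ P v
      path-in-hub-parts Pu≢Pv j =
        triangle-meets-two-parts (embed-adjacent hu hv refl) (embed-adjacent hu (inner (path j)) refl)
                                 (embed-adjacent hv (inner (path j)) refl) Pu≢Pv

      rainbow : ∀ k → Q u ≢ Q v → Q (p⁻ k) ≢ Q (p (suc k)) → Q (p⁻ k) ≢ Q u → Q (p⁻ k) ≢ Q v → Q (p (suc k)) ≢ Q u →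
        Q (p (suc k)) ≢ Q v → RainbowK4 G Q
      rainbow k Qu≢Qv Qp≢Qp' Qp≢Qu Qp≢Qv Qp'≢Qu Qp'≢Qv =
        u , v , p⁻ k , p (suc k) ,
        (embed-adjacent hu hv refl , embed-adjacent hu _ refl , embed-adjacent hu _ refl ,
         embed-adjacent hv _ refl , embed-adjacent hv _ refl , embed-adjacent _ _ (path-adjacent {d} k)) ,
        (Qu≢Qv , ≢-sym Qp≢Qu , ≢-sym Qp'≢Qu , ≢-sym Qp≢Qv , ≢-sym Qp'≢Qv , Qp≢Qp')

    RainbowEdge : (Fin (suc L) → Fin (n G)) → ℕ → ℕ → Fin L → Set
    RainbowEdge p α β k =
      Q (p (inject₁ k)) ≢ Q (p (suc k)) × Avoids α β (Q (p (inject₁ k))) × Avoids α β (Q (p (suc k)))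

    module _ (p : Fin (suc L) → Fin (n G)) (p-injective : ∀ i j → p i ≡ p j → i ≡ j) (A B α β : ℕ)
             (in-A∪B : ∀ (k : Fin L) → P (p (inject₁ k)) ≡ A ⊎ P (p (inject₁ k)) ≡ B) where

      private
        block : Fin blockCount → Fin blockLength → Fin (n G)
        block t o = p (inject₁ (combine t o))

        block-injectiveˡ : ∀ t o t' o' → block t o ≡ block t' o' → t ≡ t'
        block-injectiveˡ t o t' o' e = FP.combine-injectiveˡ t o t' o' (FP.inject₁-injective (p-injective _ _ e))

        block-injectiveʳ : ∀ t o o' → block t o ≡ block t o' → o ≡ o'
        block-injectiveʳ t o o' e = FP.combine-injectiveʳ t o t o' (FP.inject₁-injective (p-injective _ _ e))

        avoids? : ∀ v → Dec (Avoids α β (Q v))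
        avoids? v = ¬? (Q v ≟ α) ×-dec ¬? (Q v ≟ β)

      rainbow-edge-in-block : ∀ t → (∀ o → Avoids α β (Q (block t o))) → Σ (Fin L) (RainbowEdge p α β)
      rainbow-edge-in-block t avoiding with FP.any?
        (λ (o : Fin (2 * c)) → ¬? (Q (block t (inject₁ o)) ≟ Q (block t (suc o))))
      ... | yes (o , Q≢) =
        combine t (inject₁ o) ,
        (λ e → Q≢ (trans e (cong (λ z → Q (p z)) (suc-combine-inject₁ t o)))) , avoiding (inject₁ o) ,
        subst (λ z → Avoids α β (Q (p z))) (sym (suc-combine-inject₁ t o)) (avoiding (suc o))
      ... | no monochromatic = contradiction
        (injection-into-cells bound (block t) (block-injectiveʳ t) ((A , γ) ∷ (B , γ) ∷ [])
           (λ o → cell (in-A∪B (combine t o)) (constant o)))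
        (ℕP.<-irrefl refl)
        where
        γ : ℕ
        γ = Q (block t zero)
        constant : ∀ o → Q (block t o) ≡ γ
        constant = consecutive-equal⇒constant (λ o → Q (block t o)) (λ o → ¬≢⇒≡ (λ Q≢ → monochromatic (o , Q≢)))
        cell : ∀ {v} → P v ≡ A ⊎ P v ≡ B → Q v ≡ γ → Any (InCell v) ((A , γ) ∷ (B , γ) ∷ [])
        cell (inj₁ PA) Qγ = here (PA , Qγ)
        cell (inj₂ PB) Qγ = there (here (PB , Qγ))

      -- Cut the path into 4c + 1 blocks of 2c + 1 consecutive vertices. A block avoiding α and β
      -- contains a rainbow edge, since it cannot be monochromatic inside two cells; and the blocks
      -- cannot all meet α or β, since one vertex of each would give 4c + 1 vertices in four cells.
      rainbow-edge : Σ (Fin L) (RainbowEdge p α β)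
      rainbow-edge with FP.any? (λ t → FP.all? (λ o → avoids? (block t o)))
      ... | yes (t , avoiding) = rainbow-edge-in-block t avoiding
      ... | no ¬avoiding = contradiction
        (injection-into-cells bound hit (λ t t' → block-injectiveˡ t _ t' _)
          ((A , α) ∷ (B , α) ∷ (A , β) ∷ (B , β) ∷ [])
           (λ t → cell (in-A∪B (combine t (proj₁ (meets t)))) (¬Avoids α β _ (proj₂ (meets t)))))
        (ℕP.<-irrefl refl)
        where
        meets : ∀ t → ∃ λ o → ¬ Avoids α β (Q (block t o))
        meets t = FP.¬∀⟶∃¬ blockLength _ (λ o → avoids? (block t o)) (λ avoiding → ¬avoiding (t , avoiding))
        hit : Fin blockCount → Fin (n G)
        hit t = block t (proj₁ (meets t))
        cell : ∀ {v} → P v ≡ A ⊎ P v ≡ B → Q v ≡ α ⊎ Q v ≡ β →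
          Any (InCell v) ((A , α) ∷ (B , α) ∷ (A , β) ∷ (B , β) ∷ [])
        cell (inj₁ PA) (inj₁ Qα) = here (PA , Qα)
        cell (inj₂ PB) (inj₁ Qα) = there (here (PB , Qα))
        cell (inj₁ PA) (inj₂ Qβ) = there (there (here (PA , Qβ)))
        cell (inj₂ PB) (inj₂ Qβ) = there (there (there (here (PB , Qβ))))

    module _ {d : ℕ} (F : FanIn G (suc d)) where
      open Hubs F

      rainbow-from-split-hubs : P u ≢ P v → Q u ≢ Q v → RainbowK4 G Q
      rainbow-from-split-hubs Pu≢Pv Qu≢Qv
        with rainbow-edge p p-injective (P u) (P v) (Q u) (Q v) (λ k → path-in-hub-parts Pu≢Pv (inject₁ k))
      ... | k , Q≢ , (Qp≢Qu , Qp≢Qv) , (Qp'≢Qu , Qp'≢Qv) = rainbow k Qu≢Qv Q≢ Qp≢Qu Qp≢Qv Qp'≢Qu Qp'≢Qv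

    module _ {d : ℕ} (F : FanIn G (suc (suc d))) where
      open Hubs F

      -- Some p_k leaves the Q-part of u (else L > 2c vertices lie in two cells); then whichever of u, v
      -- is P-separated from p_k forms with it the hubs of a child fan split by both P and Q.
      rainbow-from-P-split : P u ≢ P v → Q u ≡ Q v → RainbowK4 G Q
      rainbow-from-P-split Pu≢Pv Qu≡Qv with FP.any? (λ k → ¬? (Q (p⁻ k) ≟ Q u))
      ... | yes (k , Qp≢Qu) with P (p⁻ k) ≟ P u
      ...   | no Pp≢Pu = rainbow-from-split-hubs (childFan true k F) (≢-sym Pp≢Pu) (≢-sym Qp≢Qu)
      ...   | yes Pp≡Pu = rainbow-from-split-hubs (childFan false k F)
                            (λ e → Pu≢Pv (trans (sym Pp≡Pu) (sym e))) (λ e → Qp≢Qu (trans (sym e) (sym Qu≡Qv)))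
      rainbow-from-P-split Pu≢Pv Qu≡Qv | no all-Qu = contradiction
        (injection-into-cells bound p⁻ p⁻-injective ((P u , Q u) ∷ (P v , Q u) ∷ [])
          (λ k → cell (path-in-hub-parts Pu≢Pv (inject₁ k)) (¬≢⇒≡ (λ Q≢ → all-Qu (k , Q≢)))))
        L>2c
        where
        cell : ∀ {x} → P x ≡ P u ⊎ P x ≡ P v → Q x ≡ Q u → Any (InCell x) ((P u , Q u) ∷ (P v , Q u) ∷ [])
        cell (inj₁ Pu) Qu = here (Pu , Qu)
        cell (inj₂ Pv) Qu = there (here (Pv , Qu))

      rainbow-from-Q-split : Q u ≢ Q v → RainbowK4 G Q
      rainbow-from-Q-split Qu≢Qv with P u ≟ P v
      ... | no Pu≢Pv = rainbow-from-split-hubs F Pu≢Pv Qu≢Qv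
      ... | yes Pu≡Pv with FP.any? (λ k → ¬? (P (p⁻ k) ≟ P u))
      ...   | yes (k , Pp≢Pu) with Q (p⁻ k) ≟ Q u
      ...     | no Qp≢Qu = rainbow-from-split-hubs (childFan true k F) (≢-sym Pp≢Pu) (≢-sym Qp≢Qu)
      ...     | yes Qp≡Qu = rainbow-from-split-hubs (childFan false k F)
                              (λ e → Pp≢Pu (trans (sym e) (sym Pu≡Pv))) (λ e → Qu≢Qv (trans (sym Qp≡Qu) (sym e)))
      rainbow-from-Q-split Qu≢Qv | yes Pu≡Pv | no all-Pu
        with rainbow-edge p p-injective (P u) (P u) (Q u) (Q v) (λ k → inj₁ (¬≢⇒≡ (λ P≢ → all-Pu (k , P≢))))
      ... | k , Q≢ , (Qp≢Qu , Qp≢Qv) , (Qp'≢Qu , Qp'≢Qv) = rainbow k Qu≢Qv Q≢ Qp≢Qu Qp≢Qv Qp'≢Qu Qp'≢Qv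

    module _ (F : FanIn G 3) where
      open Hubs F

      rainbow-from-fan₃ : RainbowK4 G Q
      rainbow-from-fan₃ with Q u ≟ Q v
      ... | no Qu≢Qv = rainbow-from-Q-split F Qu≢Qv
      ... | yes Qu≡Qv with P u ≟ P v
      ...   | no Pu≢Pv = rainbow-from-P-split F Pu≢Pv Qu≡Qv
      ...   | yes Pu≡Pv with FP.any? (λ k → ¬? (Q (p⁻ k) ≟ Q u))
      ...     | yes (k , Qp≢Qu) = rainbow-from-Q-split (childFan true k F) (≢-sym Qp≢Qu)
      ...     | no all-Qu with FP.any? (λ k → ¬? (P (p⁻ k) ≟ P u))
      ...       | yes (k , Pp≢Pu) =
                    rainbow-from-P-split (childFan true k F) (≢-sym Pp≢Pu) (sym (¬≢⇒≡ (λ Q≢ → all-Qu (k , Q≢))))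
      ...       | no all-Pu = contradiction
                    (injection-into-cells bound p⁻ p⁻-injective ((P u , Q u) ∷ [])
                      (λ k → here (¬≢⇒≡ (λ P≢ → all-Pu (k , P≢)) , ¬≢⇒≡ (λ Q≢ → all-Qu (k , Q≢)))))
                    L>c

module FanGraph (L d : ℕ) where
  open import Data.Bool using (true)
  open import Data.Product using (_,_)
  open import Relation.Nullary using (yes; no)
  open import Relation.Binary.PropositionalEquality
  open Fan L
  open Enumeration L
  open Drawing L using (point)
  open Planarity L

  graph : Graph
  graph = record
    { n = vertexCount d
    ; adj = λ i j → adjacent d (decode d i) (decode d j)
    ; sym = λ i j → adjacent-sym d (decode d i) (decode d j)
    ; irrefl = λ i → adjacent-irrefl d (decode d i) }

  decode-injective : ∀ {i j} → decode d i ≡ decode d j → i ≡ j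
  decode-injective {i} {j} e = trans (sym (encode-decode d i)) (trans (cong (encode d) e) (encode-decode d j))

  decode-≢ : ∀ {i j} → i ≢ j → decode d i ≢ decode d j
  decode-≢ i≢j e = i≢j (decode-injective e)

  planar : Planar graph
  planar = drawing , drawing-injective ,
    (λ u v w u~v w≢u w≢v → vertices-off-edges d (decode d w) (decode d u) (decode d v) u~v (decode-≢ w≢u)
      (decode-≢ w≢v)) ,
    (λ u v x y u~v x~y u≢x u≢y v≢x v≢y →
       edges-apart d (decode d u) (decode d v) (decode d x) (decode d y) u~v x~y
                   (decode-≢ u≢x) (decode-≢ u≢y) (decode-≢ v≢x) (decode-≢ v≢y))
    where
    drawing : Fin (vertexCount d) → Point
    drawing i = point d (decode d i)
    drawing-injective : ∀ {i j} → drawing i ≡ drawing j → i ≡ j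
    drawing-injective {i} {j} e with i FP.≟ j
    ... | yes i≡j = i≡j
    ... | no i≢j = ⊥-elim (point-injective d (decode d i) (decode d j) (decode-≢ i≢j) e)

  fanIn-graph : FanIn graph d
  fanIn-graph = record
    { embed = encode d
    ; embed-injective = λ a b e → trans (sym (decode-encode d a)) (trans (cong (decode d) e) (decode-encode d b))
    ; embed-adjacent = λ a b a~b →
        subst₂ (λ x y → adjacent d x y ≡ true) (sym (decode-encode d a)) (sym (decode-encode d b)) a~b }

lemma12 : (c : ℕ) → Σ Graph λ G → Planar G ×
    ((P Q : Partition G) → IsTreePartition G P →
      (∀ a b → meetSize G P Q a b ≤ c) →
      ∃[ v₁ ] ∃[ v₂ ] ∃[ v₃ ] ∃[ v₄ ]
        (Adj G v₁ v₂ × Adj G v₁ v₃ × Adj G v₁ v₄ ×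
         Adj G v₂ v₃ × Adj G v₂ v₄ × Adj G v₃ v₄) ×
        (Q v₁ ≢ Q v₂ × Q v₁ ≢ Q v₃ × Q v₁ ≢ Q v₄ ×
         Q v₂ ≢ Q v₃ × Q v₂ ≢ Q v₄ × Q v₃ ≢ Q v₄))
lemma12 c = graph , planar , λ P Q tp bound → Rainbow.rainbow-from-fan₃ c graph P Q tp bound fanIn-graph
  where open FanGraph (Rainbow.L c) 3
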